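{- Let $S$ be a subdivided star or the empty graph, and let $B=S\overset{1}{ - }S_{1,1}$. Then in the game $\mathbf{0.33}$, $\mathcal{G}(S)=\mathcal{G}(B)$.
   Context: The game $\mathbf{0.33}$ on a finite graph $G$: players alternate; a move chooses a set $X$ of one vertex or of two adjacent vertices of $G$, lying in a connected component $H$ of $G$, such that $H-X$ is empty or connected, and deletes $X$. A player unable to move loses (normal play). Grundy value: $\mathcal{G}(G)=\mathrm{mex}\{\mathcal{G}(G'): G' \text{ reachable in one move}\}$. Subdivided star $S_{\ell_1,\ldots,\ell_k}$: a central vertex $c$ with $k$ vertex-disjoint paths of $\ell_1,\ldots,\ell_k$ vertices each having one endpoint adjacent to $c$; $S_{1,1}=P_3$ with its middle vertex as center. For subdivided stars $S,S'$ with centers $c,c'$, $S\overset{1}{ - }S'$ is the disjoint union of $S$ and $S'$ plus the edge $cc'$; with the empty graph, $\emptyset\overset{1}{ - }S'=S'$. -}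

module Defs where

open import Data.Bool using (Bool; true; false; _∧_; _∨_; not; if_then_else_)
open import Data.Nat using (ℕ; zero; suc; _+_; _≡ᵇ_; _<ᵇ_; _≤_)
open import Data.Fin using (Fin; toℕ)
open import Data.Vec using (Vec; lookup; tabulate)
open import Data.List using (List; []; _∷_; _++_; concatMap; length; map; allFin)
open import Data.Bool.ListAction using (any; all)
open import Data.Nat.ListAction using (sum)
open import Data.Product using (_×_; _,_)
open import Data.Maybe using (Maybe; just; nothing)

-- Finite simple graphs, given by a number of vertices (labelled 0..nV-1)
-- and an (unordered) edge list.

record Graph : Set where
  constructor mkGraph
  field
    nV    : ℕ
    edges : List (ℕ × ℕ)
open Graph public

adj : (G : Graph) → Fin (nV G) → Fin (nV G) → Bool
adj G u v = not (toℕ u ≡ᵇ toℕ v) ∧ any hit (edges G)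
  where
  hit : ℕ × ℕ → Bool
  hit (a , b) = ((a ≡ᵇ toℕ u) ∧ (b ≡ᵇ toℕ v)) ∨ ((a ≡ᵇ toℕ v) ∧ (b ≡ᵇ toℕ u))

-- The game 0.33.  A position is the set of still-present ("alive")
-- vertices of a fixed graph on Fin n; deleting X means removing X from
-- the alive set (the induced subgraph on alive vertices is the current graph).

VSet : ℕ → Set
VSet n = Vec Bool n

mex-aux : ℕ → ℕ → List ℕ → ℕ
mex-aux zero    k l = k
mex-aux (suc f) k l = if any (λ x → x ≡ᵇ k) l then mex-aux f (suc k) l else k

mex : List ℕ → ℕ
mex l = mex-aux (length l) 0 l

module Game {n : ℕ} (E : Fin n → Fin n → Bool) where

  verts : List (Fin n)
  verts = allFin n

  step : VSet n → VSet n → VSet n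
  step W R = tabulate λ x →
    lookup R x ∨ (lookup W x ∧ any (λ y → lookup R y ∧ E y x) verts)

  iter : ℕ → (VSet n → VSet n) → VSet n → VSet n
  iter zero    f R = R
  iter (suc k) f R = iter k f (f R)

  -- vertex set of the connected component of v in the induced subgraph on W
  -- (empty if v ∉ W)
  component : VSet n → Fin n → VSet n
  component W v = iter n (step W) (tabulate λ x → lookup W x ∧ (toℕ x ≡ᵇ toℕ v))

  firstIn : VSet n → List (Fin n) → Maybe (Fin n)
  firstIn W []       = nothing
  firstIn W (x ∷ xs) = if lookup W x then just x else firstIn W xs

  emptyOrConnected : VSet n → Bool
  emptyOrConnected W with firstIn W verts
  ... | nothing = true
  ... | just w  = all (λ x → not (lookup W x) ∨ lookup (component W w) x) verts

  remove : VSet n → VSet n → VSet n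
  remove A X = tabulate λ x → lookup A x ∧ not (lookup X x)

  single : Fin n → VSet n
  single v = tabulate λ x → toℕ x ≡ᵇ toℕ v

  pair : Fin n → Fin n → VSet n
  pair u v = tabulate λ x → (toℕ x ≡ᵇ toℕ u) ∨ (toℕ x ≡ᵇ toℕ v)

  -- X (a connected set containing v) lies in the component H of v;
  -- the move is legal iff H - X is empty or connected.
  legal : VSet n → Fin n → VSet n → Bool
  legal A v X = emptyOrConnected (remove (component A v) X)

  moves : VSet n → List (VSet n)
  moves A = concatMap singleMv verts ++ concatMap (λ u → concatMap (pairMv u) verts) verts
    where
    singleMv : Fin n → List (VSet n)
    singleMv v = if lookup A v ∧ legal A v (single v)
                 then remove A (single v) ∷ [] else []
    pairMv : Fin n → Fin n → List (VSet n)
    pairMv u v = if (toℕ u <ᵇ toℕ v) ∧ lookup A u ∧ lookup A v ∧ E u v ∧ legal A u (pair u v)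
                 then remove A (pair u v) ∷ [] else []

  -- Grundy value with fuel (fuel ≥ number of alive vertices suffices,
  -- since every move deletes at least one alive vertex)
  grundyF : ℕ → VSet n → ℕ
  grundyF zero    A = 0
  grundyF (suc f) A = mex (map (grundyF f) (moves A))

grundy : Graph → ℕ
grundy G = Game.grundyF (adj G) (nV G) (tabulate λ _ → true)

pathEdges : ℕ → ℕ → ℕ → List (ℕ × ℕ)
pathEdges prev start zero    = []
pathEdges prev start (suc ℓ) = (prev , start) ∷ pathEdges start (suc start) ℓ

starEdges : ℕ → ℕ → List ℕ → List (ℕ × ℕ)
starEdges c next []       = []
starEdges c next (ℓ ∷ ls) = pathEdges c next ℓ ++ starEdges c (next + ℓ) ls

star : List ℕ → Graph
star ls = mkGraph (suc (sum ls)) (starEdges 0 1 ls)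

starOrEmpty : Maybe (List ℕ) → Graph
starOrEmpty nothing   = mkGraph 0 []
starOrEmpty (just ls) = star ls

-- S -1- S' : disjoint union plus the edge between the centres; ∅ -1- S' = S'
link : Maybe (List ℕ) → List ℕ → Graph
link nothing   ls' = star ls'
link (just ls) ls' =
  mkGraph (m + suc (sum ls'))
          (starEdges 0 1 ls ++ starEdges m (suc m) ls' ++ (0 , m) ∷ [])
  where
  m : ℕ
  m = suc (sum ls)

module Submission where

-- Every position reachable here is a subtree of B = S -1- S_{1,1}, so we describe positions as
-- predicates on abstract sites: a Grundy value depends only on the sites and their edges, not on how
-- a concrete graph labels them. Let S′ be S with shortened arms and B′ = S′ -1- S_{1,1}; we show
-- G(S′) = G(B′) by induction on the size of S′. The remainder of a move must be connected, so a move
-- shortens an arm at its end, removes a leaf of S_{1,1}, or removes the hub when what is left is a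
-- path, and a path on L vertices has value L mod 3. Shortening an arm is answered by the same move on
-- the other side, where the induction hypothesis applies; from B′ without a leaf, S′ itself is one
-- move away; the hub moves are settled by the values of paths. Hence no option of B′ has value G(S′)
-- and, unless G(S′) = 0, no option of S′ has value G(B′), so G(S′) = G(B′) by the mex rule.

open import Defs
open import Data.Bool using (Bool; true; false; _∧_; _∨_; not; if_then_else_; T)
open import Data.Bool.ListAction using (any; all)
open import Data.Bool.Properties using (∨-comm; ∨-zeroʳ; ∧-identityʳ; ∧-zeroʳ)
open import Data.Empty using (⊥; ⊥-elim)
open import Data.Fin using (Fin; toℕ; zero; suc)
open import Data.Fin.Properties using (toℕ-injective; toℕ<n; toℕ-fromℕ<; any?)
  renaming (_≟_ to _≟F_; suc-injective to Fin-suc-injective)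
open import Data.List using (List; []; _∷_; _++_; concatMap; length; map)
import Data.List as List
open import Data.List.Membership.Propositional using (_∈_; _∉_)
open import Data.List.Membership.Propositional.Properties
  using (∈-allFin; ∈-map⁺; ∈-map⁻; ∈-concatMap⁻; ∈-concatMap⁺; ∈-++⁻; ∈-++⁺ˡ; ∈-++⁺ʳ)
open import Data.List.Properties using (length-map)
open import Data.List.Relation.Unary.All using (All)
open import Data.List.Relation.Unary.Any using (Any; here; there; satisfied)
open import Data.Maybe using (Maybe; just; nothing)
import Data.Maybe as Maybe
open import Data.Maybe.Properties using (just-injective)
open import Data.Maybe.Relation.Unary.All using () renaming (All to MAll)
open import Data.Nat using (ℕ; zero; suc; pred; _+_; _∸_; _≡ᵇ_; _<ᵇ_; _≤ᵇ_; _≤_; _<_; z≤n; s≤s; _<?_)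
open import Data.Nat.DivMod using (_mod_; m<n⇒m%n≡m)
open import Data.Nat.Induction using (<-rec)
open import Data.Nat.ListAction using (sum)
open import Data.Nat.Properties
open import Data.Product using (_×_; _,_; Σ; ∃; ∃₂; proj₁; proj₂)
open import Data.Sum using (_⊎_; inj₁; inj₂)
import Data.Sum
open import Data.Vec using (Vec; []; _∷_; lookup; tabulate)
open import Data.Vec.Properties using (lookup∘tabulate; tabulate∘lookup; tabulate-cong)
open import Relation.Binary using (tri<; tri≈; tri>)
open import Relation.Binary.PropositionalEquality
  using (_≡_; _≢_; ≢-sym; refl; sym; trans; cong; cong₂; subst; subst₂; module ≡-Reasoning)
open import Relation.Nullary using (¬_; Dec; yes; no)

true⊎false : (b : Bool) → b ≡ true ⊎ b ≡ false
true⊎false true  = inj₁ refl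
true⊎false false = inj₂ refl

true≢false : ∀ {b} → b ≡ true → b ≡ false → ⊥
true≢false refl ()

true-iff⇒≡ : ∀ {a b : Bool} → (a ≡ true → b ≡ true) → (b ≡ true → a ≡ true) → a ≡ b
true-iff⇒≡ {true}  {true}  f g = refl
true-iff⇒≡ {true}  {false} f g = sym (f refl)
true-iff⇒≡ {false} {true}  f g = g refl
true-iff⇒≡ {false} {false} f g = refl

∧-elimˡ : ∀ {a b} → a ∧ b ≡ true → a ≡ true
∧-elimˡ {true} _ = refl

∧-elimʳ : ∀ {a b} → a ∧ b ≡ true → b ≡ true
∧-elimʳ {true} e = e

∧-intro : ∀ {a b} → a ≡ true → b ≡ true → a ∧ b ≡ true
∧-intro refl refl = refl

∨-elim : ∀ {a b} → a ∨ b ≡ true → a ≡ true ⊎ b ≡ true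
∨-elim {true}  _ = inj₁ refl
∨-elim {false} e = inj₂ e

∨-introˡ : ∀ {a} b → a ≡ true → a ∨ b ≡ true
∨-introˡ b refl = refl

∨-introʳ : ∀ a {b} → b ≡ true → a ∨ b ≡ true
∨-introʳ true  _ = refl
∨-introʳ false e = e

∧-not-intro : ∀ {a b} → a ≡ true → b ≡ false → a ∧ not b ≡ true
∧-not-intro refl refl = refl

∨-false : ∀ {a b} → a ≡ false → b ≡ false → a ∨ b ≡ false
∨-false refl refl = refl

∨-falseˡ : ∀ {a b} → a ∨ b ≡ false → a ≡ false
∨-falseˡ {false} _ = refl

not-true⇒false : ∀ {a} → not a ≡ true → a ≡ false
not-true⇒false {false} _ = refl

false⇒not-true : ∀ {a} → a ≡ false → not a ≡ true
false⇒not-true refl = refl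

T⇒≡true : ∀ {b} → T b → b ≡ true
T⇒≡true {true} _ = refl

≡true⇒T : ∀ {b} → b ≡ true → T b
≡true⇒T refl = _

≡ᵇ-true⇒≡ : ∀ m n → (m ≡ᵇ n) ≡ true → m ≡ n
≡ᵇ-true⇒≡ m n e = ≡ᵇ⇒≡ m n (≡true⇒T e)

≡⇒≡ᵇ-true : ∀ m n → m ≡ n → (m ≡ᵇ n) ≡ true
≡⇒≡ᵇ-true m n e = T⇒≡true (≡⇒≡ᵇ m n e)

≢⇒≡ᵇ-false : ∀ m n → m ≢ n → (m ≡ᵇ n) ≡ false
≢⇒≡ᵇ-false m n m≢n with true⊎false (m ≡ᵇ n)
... | inj₁ e = ⊥-elim (m≢n (≡ᵇ-true⇒≡ m n e))
... | inj₂ e = e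

<ᵇ-true⇒< : ∀ m n → (m <ᵇ n) ≡ true → m < n
<ᵇ-true⇒< m n e = <ᵇ⇒< m n (≡true⇒T e)

<⇒<ᵇ-true : ∀ m n → m < n → (m <ᵇ n) ≡ true
<⇒<ᵇ-true m n m<n = T⇒≡true (<⇒<ᵇ m<n)

<ᵇ-false⇒≥ : ∀ m n → (m <ᵇ n) ≡ false → n ≤ m
<ᵇ-false⇒≥ m n e = ≮⇒≥ λ m<n → true≢false (<⇒<ᵇ-true m n m<n) e

≥⇒<ᵇ-false : ∀ m n → n ≤ m → (m <ᵇ n) ≡ false
≥⇒<ᵇ-false m n n≤m with true⊎false (m <ᵇ n)
... | inj₁ e = ⊥-elim (<-irrefl refl (≤-trans (<ᵇ-true⇒< m n e) n≤m))
... | inj₂ e = e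

≤ᵇ-true⇒≤ : ∀ m n → (m ≤ᵇ n) ≡ true → m ≤ n
≤ᵇ-true⇒≤ m n e = ≤ᵇ⇒≤ m n (≡true⇒T e)

≤⇒≤ᵇ-true : ∀ m n → m ≤ n → (m ≤ᵇ n) ≡ true
≤⇒≤ᵇ-true m n m≤n = T⇒≡true (≤⇒≤ᵇ m≤n)

suc≡⇒≤ : ∀ {m n} → suc m ≡ n → m ≤ n
suc≡⇒≤ refl = n≤1+n _

2+≡⇒≤ : ∀ {m n} → suc (suc m) ≡ n → m ≤ n
2+≡⇒≤ refl = m≤n+m _ 2

positive⇒suc : ∀ {n} → 1 ≤ n → ∃ λ m → n ≡ suc m
positive⇒suc {suc m} _ = m , refl

n<ᵇ0 : ∀ n → (n <ᵇ 0) ≡ false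
n<ᵇ0 zero = refl
n<ᵇ0 (suc n) = refl

<ᵇ-≤-absorb : ∀ p a b → a ≤ b → (p <ᵇ a) ≡ ((p <ᵇ b) ∧ (p <ᵇ a))
<ᵇ-≤-absorb p a b a≤b = true-iff⇒≡ (λ e → ∧-intro (<⇒<ᵇ-true p b (<-≤-trans (<ᵇ-true⇒< p a e) a≤b)) e) (λ e → ∧-elimʳ {p <ᵇ b} e)

_==F_ : ∀ {n} → Fin n → Fin n → Bool
i ==F j = toℕ i ≡ᵇ toℕ j

==F⇒≡ : ∀ {n} (i j : Fin n) → (i ==F j) ≡ true → i ≡ j
==F⇒≡ i j e = toℕ-injective (≡ᵇ-true⇒≡ (toℕ i) (toℕ j) e)

==F-refl : ∀ {n} (i : Fin n) → (i ==F i) ≡ true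
==F-refl i = ≡⇒≡ᵇ-true (toℕ i) (toℕ i) refl

≢⇒==F-false : ∀ {n} (i j : Fin n) → i ≢ j → (i ==F j) ≡ false
≢⇒==F-false i j i≢j = ≢⇒≡ᵇ-false (toℕ i) (toℕ j) λ e → i≢j (toℕ-injective e)

module _ {A : Set} (p : A → Bool) where

  any-true⇒∃ : ∀ xs → any p xs ≡ true → ∃ λ y → y ∈ xs × p y ≡ true
  any-true⇒∃ (x ∷ xs) e with ∨-elim {p x} e
  ... | inj₁ px = x , here refl , px
  ... | inj₂ rest with any-true⇒∃ xs rest
  ... | y , y∈xs , py = y , there y∈xs , py

  ∈⇒any-true : ∀ {xs y} → y ∈ xs → p y ≡ true → any p xs ≡ true
  ∈⇒any-true {x ∷ xs} (here refl) py = ∨-introˡ (any p xs) py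
  ∈⇒any-true {x ∷ xs} (there y∈xs) py = ∨-introʳ (p x) (∈⇒any-true y∈xs py)

  all-true⇒∀ : ∀ xs → all p xs ≡ true → ∀ {y} → y ∈ xs → p y ≡ true
  all-true⇒∀ (x ∷ xs) e (here refl) = ∧-elimˡ e
  all-true⇒∀ (x ∷ xs) e (there y∈xs) = all-true⇒∀ xs (∧-elimʳ {p x} e) y∈xs

  ∀⇒all-true : ∀ xs → (∀ {y} → y ∈ xs → p y ≡ true) → all p xs ≡ true
  ∀⇒all-true [] h = refl
  ∀⇒all-true (x ∷ xs) h = ∧-intro (h (here refl)) (∀⇒all-true xs (λ y∈xs → h (there y∈xs)))

-- Minimum excludant

∈-tail : ∀ {v x : ℕ} {xs} → v ∈ x ∷ xs → v ≢ x → v ∈ xs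
∈-tail (here v≡x) v≢x = ⊥-elim (v≢x v≡x)
∈-tail (there v∈xs) _ = v∈xs

any-≡ᵇ⇒∈ : ∀ v xs → any (λ x → x ≡ᵇ v) xs ≡ true → v ∈ xs
any-≡ᵇ⇒∈ v xs e with any-true⇒∃ (λ x → x ≡ᵇ v) xs e
... | y , y∈xs , y==v = subst (_∈ xs) (≡ᵇ-true⇒≡ y v y==v) y∈xs

squeeze : ℕ → ℕ → ℕ
squeeze x y with y <? x
... | yes _ = y
... | no  _ = pred y

squeeze-< : ∀ {x y} → y < x → squeeze x y ≡ y
squeeze-< {x} {y} y<x with y <? x
... | yes _ = refl
... | no y≮x = ⊥-elim (y≮x y<x)

squeeze-> : ∀ {x y} → x ≤ y → squeeze x (suc y) ≡ y
squeeze-> {x} {y} x≤y with suc y <? x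
... | yes sy<x = ⊥-elim (1+n≰n (≤-trans (n≤1+n (suc y)) (≤-trans sy<x x≤y)))
... | no _ = refl

-- Pigeonhole: drop the head x and close the gap it leaves among the values.
initial-segment-≤-length : ∀ k xs → (∀ j → j < k → j ∈ xs) → k ≤ length xs
initial-segment-≤-length zero xs _ = z≤n
initial-segment-≤-length (suc k) [] h with h 0 (s≤s z≤n)
... | ()
initial-segment-≤-length (suc k) (x ∷ xs) h =
  s≤s (subst (k ≤_) (length-map (squeeze x) xs) (initial-segment-≤-length k (map (squeeze x) xs) below))
  where
  below : ∀ j → j < k → j ∈ map (squeeze x) xs
  below j j<k with j <? x
  ... | yes j<x = subst (_∈ map (squeeze x) xs) (squeeze-< j<x)
                    (∈-map⁺ (squeeze x) (∈-tail (h j (m<n⇒m<1+n j<k)) (<⇒≢ j<x)))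
  ... | no j≮x = subst (_∈ map (squeeze x) xs) (squeeze-> (≮⇒≥ j≮x))
                    (∈-map⁺ (squeeze x) (∈-tail (h (suc j) (s≤s j<k)) λ sj≡x → j≮x (≤-reflexive sj≡x)))

-- When the fuel runs out k = length xs, so k ∈ xs would make k + 1 distinct values in xs.
mex-aux-spec : ∀ f k xs → (∀ j → j < k → j ∈ xs) → k + f ≡ length xs →
               mex-aux f k xs ∉ xs × (∀ j → j < mex-aux f k xs → j ∈ xs)
mex-aux-spec zero k xs below k≡len =
  (λ k∈xs → <-irrefl refl (≤-trans (initial-segment-≤-length (suc k) xs (extend k∈xs))
                                   (≤-reflexive (trans (sym k≡len) (+-identityʳ k))))) , below
  where
  extend : k ∈ xs → ∀ j → j < suc k → j ∈ xs
  extend k∈xs j (s≤s j≤k) with m≤n⇒m<n∨m≡n j≤k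
  ... | inj₁ j<k = below j j<k
  ... | inj₂ refl = k∈xs
mex-aux-spec (suc f) k xs below k+f≡len with true⊎false (any (λ x → x ≡ᵇ k) xs)
... | inj₁ k∈ rewrite k∈ = mex-aux-spec f (suc k) xs extend (trans (sym (+-suc k f)) k+f≡len)
  where
  extend : ∀ j → j < suc k → j ∈ xs
  extend j (s≤s j≤k) with m≤n⇒m<n∨m≡n j≤k
  ... | inj₁ j<k = below j j<k
  ... | inj₂ refl = any-≡ᵇ⇒∈ j xs k∈
... | inj₂ k∉ rewrite k∉ = (λ k∈xs → true≢false (∈⇒any-true (λ x → x ≡ᵇ k) k∈xs (≡⇒≡ᵇ-true k k refl)) k∉) , below

mex-∉ : ∀ xs → mex xs ∉ xs
mex-∉ xs = proj₁ (mex-aux-spec (length xs) 0 xs (λ j ()) refl)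

mex-below : ∀ xs j → j < mex xs → j ∈ xs
mex-below xs = proj₂ (mex-aux-spec (length xs) 0 xs (λ j ()) refl)

mex-≤ : ∀ xs v → v ∉ xs → mex xs ≤ v
mex-≤ xs v v∉xs = ≮⇒≥ λ v<mex → v∉xs (mex-below xs v v<mex)

mex-unique : ∀ xs v → v ∉ xs → (∀ j → j < v → j ∈ xs) → mex xs ≡ v
mex-unique xs v v∉xs below = ≤-antisym (mex-≤ xs v v∉xs) (≮⇒≥ λ mex<v → mex-∉ xs (below (mex xs) mex<v))

mex-cong : ∀ xs ys → (∀ {v} → v ∈ xs → v ∈ ys) → (∀ {v} → v ∈ ys → v ∈ xs) → mex xs ≡ mex ys
mex-cong xs ys xs⊆ys ys⊆xs =
  sym (mex-unique ys (mex xs) (λ m → mex-∉ xs (ys⊆xs m)) λ j j<mex → xs⊆ys (mex-below xs j j<mex))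

count : ∀ {n} → Vec Bool n → ℕ
count [] = 0
count (true ∷ v) = suc (count v)
count (false ∷ v) = count v

count-≤ : ∀ {n} (v : Vec Bool n) → count v ≤ n
count-≤ [] = z≤n
count-≤ (true ∷ v) = s≤s (count-≤ v)
count-≤ (false ∷ v) = m≤n⇒m≤1+n (count-≤ v)

_∈ˢ_ : ∀ {n} → Fin n → Vec Bool n → Set
x ∈ˢ W = lookup W x ≡ true

_⊆ˢ_ : ∀ {n} → Vec Bool n → Vec Bool n → Set
A ⊆ˢ B = ∀ x → x ∈ˢ A → x ∈ˢ B

count-mono : ∀ {n} (A B : Vec Bool n) → A ⊆ˢ B → count A ≤ count B
count-mono [] [] h = z≤n
count-mono (true ∷ A) (true ∷ B) h = s≤s (count-mono A B (λ x → h (suc x)))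
count-mono (true ∷ A) (false ∷ B) h with h zero refl
... | ()
count-mono (false ∷ A) (true ∷ B) h = m≤n⇒m≤1+n (count-mono A B (λ x → h (suc x)))
count-mono (false ∷ A) (false ∷ B) h = count-mono A B (λ x → h (suc x))

count-strict : ∀ {n} (A B : Vec Bool n) → A ⊆ˢ B → ∀ x → lookup A x ≡ false → x ∈ˢ B → count A < count B
count-strict (false ∷ A) (true ∷ B) h zero _ _ = s≤s (count-mono A B (λ x → h (suc x)))
count-strict (true ∷ A) (true ∷ B) h (suc x) a b = s≤s (count-strict A B (λ y → h (suc y)) x a b)
count-strict (true ∷ A) (false ∷ B) h (suc x) a b with h zero refl
... | ()
count-strict (false ∷ A) (true ∷ B) h (suc x) a b = m≤n⇒m≤1+n (count-strict A B (λ y → h (suc y)) x a b)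
count-strict (false ∷ A) (false ∷ B) h (suc x) a b = count-strict A B (λ y → h (suc y)) x a b

count-pos : ∀ {n} (A : Vec Bool n) x → x ∈ˢ A → 1 ≤ count A
count-pos (true ∷ A) zero e = s≤s z≤n
count-pos (true ∷ A) (suc x) e = s≤s z≤n
count-pos (false ∷ A) (suc x) e = count-pos A x e

lookup-ext : ∀ {n} {A : Set} (u v : Vec A n) → (∀ x → lookup u x ≡ lookup v x) → u ≡ v
lookup-ext u v h = trans (sym (tabulate∘lookup u)) (trans (tabulate-cong h) (tabulate∘lookup v))

-- Connectivity and moves in a graph

module GameOn {n : ℕ} (E : Fin n → Fin n → Bool) (E-sym : ∀ x y → E x y ≡ E y x) where
  open Game E public

  data Reachᵛ (W : VSet n) (v : Fin n) : Fin n → Set where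
    rhere  : v ∈ˢ W → Reachᵛ W v v
    rthere : ∀ {y x} → Reachᵛ W v y → E y x ≡ true → x ∈ˢ W → Reachᵛ W v x

  reachᵛ-source : ∀ {W v x} → Reachᵛ W v x → v ∈ˢ W
  reachᵛ-source (rhere p) = p
  reachᵛ-source (rthere r _ _) = reachᵛ-source r

  reachᵛ-target : ∀ {W v x} → Reachᵛ W v x → x ∈ˢ W
  reachᵛ-target (rhere p) = p
  reachᵛ-target (rthere _ _ p) = p

  reachᵛ-trans : ∀ {W u v w} → Reachᵛ W u v → Reachᵛ W v w → Reachᵛ W u w
  reachᵛ-trans r (rhere _) = r
  reachᵛ-trans r (rthere s e p) = rthere (reachᵛ-trans r s) e p

  reachᵛ-sym : ∀ {W u v} → Reachᵛ W u v → Reachᵛ W v u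
  reachᵛ-sym (rhere p) = rhere p
  reachᵛ-sym (rthere r e p) =
    reachᵛ-trans (rthere (rhere p) (trans (E-sym _ _) e) (reachᵛ-target r)) (reachᵛ-sym r)

  Connectedᵛ : VSet n → Set
  Connectedᵛ W = ∀ x y → x ∈ˢ W → y ∈ˢ W → Reachᵛ W x y

  iter-suc : ∀ k (f : VSet n → VSet n) R → iter (suc k) f R ≡ f (iter k f R)
  iter-suc zero f R = refl
  iter-suc (suc k) f R = iter-suc k f (f R)

  step-lookup : ∀ W R x → lookup (step W R) x ≡ (lookup R x ∨ (lookup W x ∧ any (λ y → lookup R y ∧ E y x) verts))
  step-lookup W R x = lookup∘tabulate _ x

  step-inflationary : ∀ W R → R ⊆ˢ step W R
  step-inflationary W R x e = trans (step-lookup W R x) (∨-introˡ _ e)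

  seed : VSet n → Fin n → VSet n
  seed W v = tabulate λ x → lookup W x ∧ (x ==F v)

  seed-∋ : ∀ W v → v ∈ˢ W → v ∈ˢ seed W v
  seed-∋ W v v∈W = trans (lookup∘tabulate _ v) (∧-intro v∈W (==F-refl v))

  grow : VSet n → Fin n → ℕ → VSet n
  grow W v k = iter k (step W) (seed W v)

  grow-suc : ∀ W v k → grow W v (suc k) ≡ step W (grow W v k)
  grow-suc W v k = iter-suc k (step W) (seed W v)

  grow-mono : ∀ W v k j → grow W v k ⊆ˢ grow W v (j + k)
  grow-mono W v k zero x e = e
  grow-mono W v k (suc j) x e rewrite grow-suc W v (j + k) =
    step-inflationary W (grow W v (j + k)) x (grow-mono W v k j x e)

  grow-sound : ∀ W v k x → x ∈ˢ grow W v k → Reachᵛ W v x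
  grow-sound W v zero x e rewrite lookup∘tabulate (λ x → lookup W x ∧ (x ==F v)) x
    with ==F⇒≡ x v (∧-elimʳ {lookup W x} e)
  ... | refl = rhere (∧-elimˡ e)
  grow-sound W v (suc k) x e rewrite grow-suc W v k | step-lookup W (grow W v k) x with ∨-elim e
  ... | inj₁ old = grow-sound W v k x old
  ... | inj₂ new with any-true⇒∃ (λ y → lookup (grow W v k) y ∧ E y x) verts (∧-elimʳ {lookup W x} new)
  ... | y , _ , r = rthere (grow-sound W v k y (∧-elimˡ r)) (∧-elimʳ {lookup (grow W v k) y} r) (∧-elimˡ new)

  component-sound : ∀ W v x → x ∈ˢ component W v → Reachᵛ W v x
  component-sound W v x e = grow-sound W v n x e

  Closedᵛ : VSet n → VSet n → Set
  Closedᵛ W R = step W R ⊆ˢ R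

  closed-or-escapes : ∀ W R → Closedᵛ W R ⊎ Σ (Fin n) λ x → x ∈ˢ step W R × lookup R x ≡ false
  closed-or-escapes W R with any? escapes?
    where
    escapes? : ∀ x → Dec (x ∈ˢ step W R × lookup R x ≡ false)
    escapes? x with lookup (step W R) x | lookup R x
    ... | true  | false = yes (refl , refl)
    ... | true  | true  = no λ ()
    ... | false | _     = no λ ()
  ... | yes escape = inj₂ escape
  ... | no ¬escape = inj₁ λ x e → stays x e (true⊎false (lookup R x))
    where
    stays : ∀ x → x ∈ˢ step W R → (lookup R x ≡ true ⊎ lookup R x ≡ false) → x ∈ˢ R
    stays x e (inj₁ q) = q
    stays x e (inj₂ q) = ⊥-elim (¬escape (x , e , q))

  grow-closes : ∀ W v → v ∈ˢ W → ∀ k → Closedᵛ W (grow W v k) ⊎ suc k ≤ count (grow W v k)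
  grow-closes W v v∈W zero = inj₂ (count-pos (seed W v) v (seed-∋ W v v∈W))
  grow-closes W v v∈W (suc k) with closed-or-escapes W (grow W v k)
  ... | inj₁ closed = inj₁ (subst (Closedᵛ W) (sym fixed) closed)
    where
    fixed : grow W v (suc k) ≡ grow W v k
    fixed = trans (grow-suc W v k) (lookup-ext _ _ λ x → same x (true⊎false (lookup (step W (grow W v k)) x)))
      where
      same : ∀ x → (lookup (step W (grow W v k)) x ≡ true ⊎ lookup (step W (grow W v k)) x ≡ false) →
             lookup (step W (grow W v k)) x ≡ lookup (grow W v k) x
      same x (inj₁ q) = trans q (sym (closed x q))
      same x (inj₂ q) with true⊎false (lookup (grow W v k) x)
      ... | inj₁ r = ⊥-elim (true≢false (step-inflationary W (grow W v k) x r) q)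
      ... | inj₂ r = trans q (sym r)
  ... | inj₂ (x , x∈step , x∉) with grow-closes W v v∈W k
  ... | inj₁ closed = ⊥-elim (true≢false (closed x x∈step) x∉)
  ... | inj₂ big = inj₂ (≤-trans (s≤s big) (subst (λ Z → suc (count (grow W v k)) ≤ count Z) (sym (grow-suc W v k))
                        (count-strict (grow W v k) (step W (grow W v k)) (step-inflationary W (grow W v k)) x x∉ x∈step)))

  component-closed : ∀ W v → v ∈ˢ W → Closedᵛ W (component W v)
  component-closed W v v∈W with grow-closes W v v∈W n
  ... | inj₁ closed = closed
  ... | inj₂ big = ⊥-elim (1+n≰n (≤-trans big (count-≤ (grow W v n))))

  component-complete : ∀ W v x → Reachᵛ W v x → x ∈ˢ component W v
  component-complete W v x (rhere p) =
    subst (λ j → v ∈ˢ grow W v j) (+-identityʳ n) (grow-mono W v 0 n v (seed-∋ W v p))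
  component-complete W v x (rthere {y} r e q) = component-closed W v (reachᵛ-source r) x
    (trans (step-lookup W (component W v) x)
      (∨-introʳ (lookup (component W v) x)
        (∧-intro q (∈⇒any-true (λ z → lookup (component W v) z ∧ E z x) (∈-allFin y)
                      (∧-intro (component-complete W v y r) e)))))

  firstIn-just : ∀ W xs {w} → firstIn W xs ≡ just w → w ∈ˢ W
  firstIn-just W (x ∷ xs) e with lookup W x in q
  firstIn-just W (x ∷ xs) refl | true = q
  firstIn-just W (x ∷ xs) e | false = firstIn-just W xs e

  firstIn-nothing : ∀ W xs {y} → firstIn W xs ≡ nothing → y ∈ xs → lookup W y ≡ false
  firstIn-nothing W (x ∷ xs) e m with lookup W x in q
  firstIn-nothing W (x ∷ xs) () m | true
  firstIn-nothing W (x ∷ xs) e (here refl) | false = q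
  firstIn-nothing W (x ∷ xs) e (there m) | false = firstIn-nothing W xs e m

  emptyOrConnected-sound : ∀ W → emptyOrConnected W ≡ true → Connectedᵛ W
  emptyOrConnected-sound W e x y x∈W y∈W with firstIn W verts in first
  ... | nothing = ⊥-elim (true≢false x∈W (firstIn-nothing W verts first (∈-allFin x)))
  ... | just w = reachᵛ-trans (reachᵛ-sym (component-sound W w x (in-component x x∈W))) (component-sound W w y (in-component y y∈W))
    where
    in-component : ∀ z → z ∈ˢ W → z ∈ˢ component W w
    in-component z z∈W with true⊎false (lookup (component W w) z)
    ... | inj₁ q = q
    ... | inj₂ q = ⊥-elim (true≢false
                     (all-true⇒∀ (λ x → not (lookup W x) ∨ lookup (component W w) x) verts e (∈-allFin z))
                     (clash z∈W q))
      where
      clash : ∀ {a b} → a ≡ true → b ≡ false → not a ∨ b ≡ false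
      clash refl refl = refl

  emptyOrConnected-complete : ∀ W → Connectedᵛ W → emptyOrConnected W ≡ true
  emptyOrConnected-complete W conn with firstIn W verts in first
  ... | nothing = refl
  ... | just w = ∀⇒all-true _ verts λ {z} _ → covered z (true⊎false (lookup W z))
    where
    covered : ∀ z → (lookup W z ≡ true ⊎ lookup W z ≡ false) → not (lookup W z) ∨ lookup (component W w) z ≡ true
    covered z (inj₁ q) rewrite q = component-complete W w z (conn w z (firstIn-just W verts first) q)
    covered z (inj₂ q) rewrite q = refl

  component-of-connected : ∀ A v → Connectedᵛ A → v ∈ˢ A → component A v ≡ A
  component-of-connected A v conn v∈A = lookup-ext _ _ λ x → same x (true⊎false (lookup A x)) (true⊎false (lookup (component A v) x))
    where
    same : ∀ x → (lookup A x ≡ true ⊎ lookup A x ≡ false) → (lookup (component A v) x ≡ true ⊎ lookup (component A v) x ≡ false)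
           → lookup (component A v) x ≡ lookup A x
    same x (inj₁ a) _ = trans (component-complete A v x (conn v x v∈A a)) (sym a)
    same x (inj₂ a) (inj₁ b) = ⊥-elim (true≢false (reachᵛ-target (component-sound A v x b)) a)
    same x (inj₂ a) (inj₂ b) = trans b (sym a)

  legal⇒connected : ∀ A v X → Connectedᵛ A → v ∈ˢ A → legal A v X ≡ true → Connectedᵛ (remove A X)
  legal⇒connected A v X conn v∈A rewrite component-of-connected A v conn v∈A = emptyOrConnected-sound (remove A X)

  connected⇒legal : ∀ A v X → Connectedᵛ A → v ∈ˢ A → Connectedᵛ (remove A X) → legal A v X ≡ true
  connected⇒legal A v X conn v∈A rewrite component-of-connected A v conn v∈A = emptyOrConnected-complete (remove A X)

  data Moveᵛ (A Y : VSet n) : Set where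
    delete-one : ∀ v → v ∈ˢ A → legal A v (single v) ≡ true → Y ≡ remove A (single v) → Moveᵛ A Y
    delete-two : ∀ u v → (toℕ u <ᵇ toℕ v) ≡ true → u ∈ˢ A → v ∈ˢ A → E u v ≡ true → legal A u (pair u v) ≡ true →
                 Y ≡ remove A (pair u v) → Moveᵛ A Y

  private
    singleMoves : VSet n → Fin n → List (VSet n)
    singleMoves A v = if lookup A v ∧ legal A v (single v) then remove A (single v) ∷ [] else []

    pairMoves : VSet n → Fin n → Fin n → List (VSet n)
    pairMoves A u v = if (toℕ u <ᵇ toℕ v) ∧ lookup A u ∧ lookup A v ∧ E u v ∧ legal A u (pair u v)
                      then remove A (pair u v) ∷ [] else []

    ∈-if : ∀ {B : Set} {b : Bool} {x y : B} → y ∈ (if b then x ∷ [] else []) → b ≡ true × y ≡ x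
    ∈-if {b = true} (here refl) = refl , refl

    if-∈ : ∀ {B : Set} {b : Bool} {x : B} → b ≡ true → x ∈ (if b then x ∷ [] else [])
    if-∈ refl = here refl

    ∈⇒Any : ∀ {B : Set} {P : B → Set} {xs} y → y ∈ xs → P y → Any P xs
    ∈⇒Any y (here refl) p = here p
    ∈⇒Any y (there m) p = there (∈⇒Any y m p)

  ∈-moves⇒Moveᵛ : ∀ A Y → Y ∈ moves A → Moveᵛ A Y
  ∈-moves⇒Moveᵛ A Y m with ∈-++⁻ (concatMap (singleMoves A) verts) m
  ... | inj₁ m₁ with satisfied (∈-concatMap⁻ (singleMoves A) {xs = verts} m₁)
  ... | v , m₂ with ∈-if m₂
  ... | c , eq = delete-one v (∧-elimˡ c) (∧-elimʳ {lookup A v} c) eq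
  ∈-moves⇒Moveᵛ A Y m | inj₂ m₁ with satisfied (∈-concatMap⁻ (λ u → concatMap (pairMoves A u) verts) {xs = verts} m₁)
  ... | u , m₂ with satisfied (∈-concatMap⁻ (pairMoves A u) {xs = verts} m₂)
  ... | v , m₃ with ∈-if m₃
  ... | c , eq = delete-two u v (∧-elimˡ c) (∧-elimˡ c₂) (∧-elimˡ c₃) (∧-elimˡ c₄) (∧-elimʳ {E u v} c₄) eq
    where
    c₂ = ∧-elimʳ {toℕ u <ᵇ toℕ v} c
    c₃ = ∧-elimʳ {lookup A u} c₂
    c₄ = ∧-elimʳ {lookup A v} c₃

  Moveᵛ⇒∈-moves : ∀ A Y → Moveᵛ A Y → Y ∈ moves A
  Moveᵛ⇒∈-moves A Y (delete-one v p l refl) =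
    ∈-++⁺ˡ (∈-concatMap⁺ (singleMoves A) {xs = verts} (∈⇒Any v (∈-allFin v) (if-∈ (∧-intro p l))))
  Moveᵛ⇒∈-moves A Y (delete-two u v lt pu pv e l refl) =
    ∈-++⁺ʳ (concatMap (singleMoves A) verts)
      (∈-concatMap⁺ (λ u → concatMap (pairMoves A u) verts) {xs = verts}
        (∈⇒Any u (∈-allFin u) (∈-concatMap⁺ (pairMoves A u) {xs = verts}
          (∈⇒Any v (∈-allFin v) (if-∈ (∧-intro lt (∧-intro pu (∧-intro pv (∧-intro e l)))))))))

  remove-lookup : ∀ A X x → lookup (remove A X) x ≡ (lookup A x ∧ not (lookup X x))
  remove-lookup A X x = lookup∘tabulate _ x

  remove-⊆ : ∀ A X → remove A X ⊆ˢ A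
  remove-⊆ A X x e = ∧-elimˡ (trans (sym (remove-lookup A X x)) e)

  remove-∌ : ∀ A X x → x ∈ˢ X → lookup (remove A X) x ≡ false
  remove-∌ A X x e rewrite remove-lookup A X x | e = ∧-zeroʳ (lookup A x)

  moves-shrink : ∀ A Y → Y ∈ moves A → count Y < count A
  moves-shrink A Y m with ∈-moves⇒Moveᵛ A Y m
  ... | delete-one v p _ refl =
    count-strict (remove A (single v)) A (remove-⊆ A (single v)) v
      (remove-∌ A (single v) v (trans (lookup∘tabulate _ v) (==F-refl v))) p
  ... | delete-two u v _ p _ _ _ refl =
    count-strict (remove A (pair u v)) A (remove-⊆ A (pair u v)) u
      (remove-∌ A (pair u v) u (trans (lookup∘tabulate _ u) (∨-introˡ _ (==F-refl u)))) p

  no-moves-from-empty : ∀ A → count A ≡ 0 → moves A ≡ []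
  no-moves-from-empty A e with moves A in eq
  ... | [] = refl
  ... | Y ∷ _ with subst (count Y <_) e (moves-shrink A Y (subst (Y ∈_) (sym eq) (here refl)))
  ... | ()

  map-cong-∈ : ∀ {B C : Set} (f g : B → C) xs → (∀ {y} → y ∈ xs → f y ≡ g y) → map f xs ≡ map g xs
  map-cong-∈ f g [] h = refl
  map-cong-∈ f g (x ∷ xs) h = cong₂ _∷_ (h (here refl)) (map-cong-∈ f g xs (λ m → h (there m)))

  grundyF-fuel : ∀ f g A → count A ≤ f → count A ≤ g → grundyF f A ≡ grundyF g A
  grundyF-fuel zero zero A p q = refl
  grundyF-fuel zero (suc g) A p q rewrite no-moves-from-empty A (n≤0⇒n≡0 p) = refl
  grundyF-fuel (suc f) zero A p q rewrite no-moves-from-empty A (n≤0⇒n≡0 q) = refl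
  grundyF-fuel (suc f) (suc g) A p q = cong mex (map-cong-∈ _ _ (moves A) λ {Y} m →
    grundyF-fuel f g Y (≤-pred (≤-trans (moves-shrink A Y m) p)) (≤-pred (≤-trans (moves-shrink A Y m) q)))

  grundyᵛ : VSet n → ℕ
  grundyᵛ A = grundyF n A

  grundyᵛ-mex : ∀ A → grundyᵛ A ≡ mex (map grundyᵛ (moves A))
  grundyᵛ-mex A = unfold n refl
    where
    unfold : ∀ f → n ≡ f → grundyF f A ≡ mex (map grundyᵛ (moves A))
    unfold zero n≡0 rewrite no-moves-from-empty A (n≤0⇒n≡0 (subst (count A ≤_) n≡0 (count-≤ A))) = refl
    unfold (suc f) n≡sf = cong mex (map-cong-∈ _ _ (moves A) λ {Y} m →
      grundyF-fuel f n Y (≤-pred (≤-trans (moves-shrink A Y m) (subst (count A ≤_) n≡sf (count-≤ A)))) (count-≤ Y))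

  grundyᵛ-≢-option : ∀ A Y → Y ∈ moves A → grundyᵛ Y ≢ grundyᵛ A
  grundyᵛ-≢-option A Y m e =
    mex-∉ (map grundyᵛ (moves A)) (subst (_∈ map grundyᵛ (moves A)) (trans e (grundyᵛ-mex A)) (∈-map⁺ grundyᵛ m))

  grundyᵛ-≤ : ∀ A v → (∀ Y → Y ∈ moves A → grundyᵛ Y ≢ v) → grundyᵛ A ≤ v
  grundyᵛ-≤ A v avoid rewrite grundyᵛ-mex A =
    mex-≤ _ v λ m → let (Y , m′ , e) = ∈-map⁻ grundyᵛ m in avoid Y m′ (sym e)

  grundyᵛ-≡ : ∀ A v → (∀ Y → Y ∈ moves A → grundyᵛ Y ≢ v) → (∀ j → j < v → ∃ λ Y → Y ∈ moves A × grundyᵛ Y ≡ j) →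
              grundyᵛ A ≡ v
  grundyᵛ-≡ A v avoid reach rewrite grundyᵛ-mex A =
    mex-unique _ v (λ m → let (Y , m′ , e) = ∈-map⁻ grundyᵛ m in avoid Y m′ (sym e))
      λ j j<v → let (Y , m , e) = reach j j<v in subst (_∈ map grundyᵛ (moves A)) e (∈-map⁺ grundyᵛ m)

-- Sites of S -1- S_{1,1}

-- arm i p is the vertex at distance p + 1 from the hub on arm i, hub′ is the centre of S_{1,1},
-- and outside is the junk value for labels that name no vertex.
data Site (k : ℕ) : Set where
  hub hub′ leaf₁ leaf₂ outside : Site k
  arm : Fin k → ℕ → Site k

module _ {k : ℕ} where

  isChild : Site k → Site k → Bool
  isChild hub (arm i zero) = true
  isChild hub hub′ = true
  isChild hub′ leaf₁ = true
  isChild hub′ leaf₂ = true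
  isChild (arm i p) (arm j q) = (i ==F j) ∧ (q ≡ᵇ suc p)
  isChild _ _ = false

  edge : Site k → Site k → Bool
  edge a b = isChild a b ∨ isChild b a

  edge-sym : ∀ a b → edge a b ≡ edge b a
  edge-sym a b = ∨-comm (isChild a b) (isChild b a)

  private
    n≢1+n : ∀ n → (n ≡ᵇ suc n) ≡ false
    n≢1+n zero = refl
    n≢1+n (suc n) = n≢1+n n

    isChild-irrefl : ∀ a → isChild a a ≡ false
    isChild-irrefl hub = refl
    isChild-irrefl hub′ = refl
    isChild-irrefl leaf₁ = refl
    isChild-irrefl leaf₂ = refl
    isChild-irrefl outside = refl
    isChild-irrefl (arm i p) rewrite ==F-refl i = n≢1+n p

  edge-irrefl : ∀ a → edge a a ≡ false
  edge-irrefl a rewrite isChild-irrefl a = refl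

  edge-arm-step : ∀ i p → edge (arm i p) (arm i (suc p)) ≡ true
  edge-arm-step i p rewrite ==F-refl i | ≡⇒≡ᵇ-true p p refl = refl

  edge-arm⇒ : ∀ i p j q → edge (arm i p) (arm j q) ≡ true → j ≡ i × (q ≡ suc p ⊎ p ≡ suc q)
  edge-arm⇒ i p j q e with ∨-elim {(i ==F j) ∧ (q ≡ᵇ suc p)} e
  ... | inj₁ down = sym (==F⇒≡ i j (∧-elimˡ down)) , inj₁ (≡ᵇ-true⇒≡ q (suc p) (∧-elimʳ {i ==F j} down))
  ... | inj₂ up = ==F⇒≡ j i (∧-elimˡ up) , inj₂ (≡ᵇ-true⇒≡ p (suc q) (∧-elimʳ {j ==F i} up))

  arm-injectiveˡ : ∀ {i j : Fin k} {p q} → arm i p ≡ arm j q → i ≡ j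
  arm-injectiveˡ refl = refl

  edge-arms-apart : ∀ i p j q → i ≢ j → edge (arm i p) (arm j q) ≡ false
  edge-arms-apart i p j q i≢j rewrite ≢⇒==F-false i j i≢j | ≢⇒==F-false j i (λ e → i≢j (sym e)) = refl

  _==ₛ_ : Site k → Site k → Bool
  hub ==ₛ hub = true
  hub′ ==ₛ hub′ = true
  leaf₁ ==ₛ leaf₁ = true
  leaf₂ ==ₛ leaf₂ = true
  outside ==ₛ outside = true
  arm i p ==ₛ arm j q = (i ==F j) ∧ (p ≡ᵇ q)
  _ ==ₛ _ = false

  ==ₛ⇒≡ : ∀ a b → (a ==ₛ b) ≡ true → a ≡ b
  ==ₛ⇒≡ hub hub e = refl
  ==ₛ⇒≡ hub′ hub′ e = refl
  ==ₛ⇒≡ leaf₁ leaf₁ e = refl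
  ==ₛ⇒≡ leaf₂ leaf₂ e = refl
  ==ₛ⇒≡ outside outside e = refl
  ==ₛ⇒≡ (arm i p) (arm j q) e rewrite ==F⇒≡ i j (∧-elimˡ e) | ≡ᵇ-true⇒≡ p q (∧-elimʳ {i ==F j} e) = refl
  ==ₛ⇒≡ hub hub′ ()
  ==ₛ⇒≡ hub leaf₁ ()
  ==ₛ⇒≡ hub leaf₂ ()
  ==ₛ⇒≡ hub outside ()
  ==ₛ⇒≡ hub (arm _ _) ()
  ==ₛ⇒≡ hub′ hub ()
  ==ₛ⇒≡ hub′ leaf₁ ()
  ==ₛ⇒≡ hub′ leaf₂ ()
  ==ₛ⇒≡ hub′ outside ()
  ==ₛ⇒≡ hub′ (arm _ _) ()
  ==ₛ⇒≡ leaf₁ hub ()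
  ==ₛ⇒≡ leaf₁ hub′ ()
  ==ₛ⇒≡ leaf₁ leaf₂ ()
  ==ₛ⇒≡ leaf₁ outside ()
  ==ₛ⇒≡ leaf₁ (arm _ _) ()
  ==ₛ⇒≡ leaf₂ hub ()
  ==ₛ⇒≡ leaf₂ hub′ ()
  ==ₛ⇒≡ leaf₂ leaf₁ ()
  ==ₛ⇒≡ leaf₂ outside ()
  ==ₛ⇒≡ leaf₂ (arm _ _) ()
  ==ₛ⇒≡ outside hub ()
  ==ₛ⇒≡ outside hub′ ()
  ==ₛ⇒≡ outside leaf₁ ()
  ==ₛ⇒≡ outside leaf₂ ()
  ==ₛ⇒≡ outside (arm _ _) ()
  ==ₛ⇒≡ (arm _ _) hub ()
  ==ₛ⇒≡ (arm _ _) hub′ ()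
  ==ₛ⇒≡ (arm _ _) leaf₁ ()
  ==ₛ⇒≡ (arm _ _) leaf₂ ()
  ==ₛ⇒≡ (arm _ _) outside ()

  ==ₛ-refl : ∀ a → (a ==ₛ a) ≡ true
  ==ₛ-refl hub = refl
  ==ₛ-refl hub′ = refl
  ==ₛ-refl leaf₁ = refl
  ==ₛ-refl leaf₂ = refl
  ==ₛ-refl outside = refl
  ==ₛ-refl (arm i p) = ∧-intro (==F-refl i) (≡⇒≡ᵇ-true p p refl)

  ≢⇒==ₛ-false : ∀ a b → a ≢ b → (a ==ₛ b) ≡ false
  ≢⇒==ₛ-false a b a≢b with true⊎false (a ==ₛ b)
  ... | inj₁ e = ⊥-elim (a≢b (==ₛ⇒≡ a b e))
  ... | inj₂ e = e

  arm-==ₛ-same : ∀ i q p → (arm i q ==ₛ arm i p) ≡ (q ≡ᵇ p)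
  arm-==ₛ-same i q p rewrite ==F-refl i = refl

  arm-==ₛ-apart : ∀ i i′ q p → i′ ≢ i → (arm i′ q ==ₛ arm i p) ≡ false
  arm-==ₛ-apart i i′ q p i′≢i rewrite ≢⇒==F-false i′ i i′≢i = refl

  data Walk (α : Site k → Bool) (v : Site k) : Site k → Set where
    start  : α v ≡ true → Walk α v v
    extend : ∀ {y x} → Walk α v y → edge y x ≡ true → α x ≡ true → Walk α v x

  walk-target : ∀ {α v x} → Walk α v x → α x ≡ true
  walk-target (start p) = p
  walk-target (extend _ _ p) = p

  walk-trans : ∀ {α u v w} → Walk α u v → Walk α v w → Walk α u w
  walk-trans w (start _) = w
  walk-trans w (extend w′ e p) = extend (walk-trans w w′) e p

  walk-sym : ∀ {α u v} → Walk α u v → Walk α v u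
  walk-sym (start p) = start p
  walk-sym (extend {y} {x} w e p) = walk-trans (extend (start p) (trans (edge-sym x y) e) (walk-target w)) (walk-sym w)

  walk-edge : ∀ {α u v} → α u ≡ true → α v ≡ true → edge u v ≡ true → Walk α u v
  walk-edge pu pv e = extend (start pu) e pv

  Connected : (Site k → Bool) → Set
  Connected α = ∀ x y → α x ≡ true → α y ≡ true → Walk α x y

  connected-via-hub : ∀ α h → (∀ x → α x ≡ true → Walk α h x) → Connected α
  connected-via-hub α h reach x y px py = walk-trans (walk-sym (reach x px)) (reach y py)

  Closed : (Site k → Bool) → (Site k → Set) → Set
  Closed α C = ∀ x y → C x → α y ≡ true → edge x y ≡ true → C y

  closed-walk : ∀ {α C x y} → Closed α C → C x → Walk α x y → C y
  closed-walk closed cx (start _) = cx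
  closed-walk closed cx (extend w e p) = closed _ _ (closed-walk closed cx w) p e

  closed-split⇒disconnected : ∀ α C x y → Closed α C → C x → ¬ C y → α x ≡ true → α y ≡ true → ¬ Connected α
  closed-split⇒disconnected α C x y closed cx ¬cy px py conn = ¬cy (closed-walk closed cx (conn x y px py))

  walk-cong : ∀ {α β u v} → (∀ z → α z ≡ β z) → Walk α u v → Walk β u v
  walk-cong h (start p) = start (trans (sym (h _)) p)
  walk-cong h (extend w e p) = extend (walk-cong h w) e (trans (sym (h _)) p)

  connected-cong : ∀ {α β} → (∀ z → α z ≡ β z) → Connected α → Connected β
  connected-cong h conn x y px py = walk-cong h (conn x y (trans (h x) px) (trans (h y) py))

  delete₁ : (Site k → Bool) → Site k → Site k → Bool
  delete₁ α a z = α z ∧ not (z ==ₛ a)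

  delete₂ : (Site k → Bool) → Site k → Site k → Site k → Bool
  delete₂ α a b z = α z ∧ not ((z ==ₛ a) ∨ (z ==ₛ b))

  delete₂-swap : ∀ (α : Site k → Bool) a b z → delete₂ α b a z ≡ delete₂ α a b z
  delete₂-swap α a b z = cong (λ t → α z ∧ not t) (∨-comm (z ==ₛ b) (z ==ₛ a))

  delete₁-keeps : ∀ (α : Site k → Bool) a w → α w ≡ true → (w ==ₛ a) ≡ false → delete₁ α a w ≡ true
  delete₁-keeps α a w αw w≢a rewrite αw | w≢a = refl

  delete₂-keeps : ∀ (α : Site k → Bool) a b w → α w ≡ true → (w ==ₛ a) ≡ false → (w ==ₛ b) ≡ false → delete₂ α a b w ≡ true
  delete₂-keeps α a b w αw w≢a w≢b rewrite αw | w≢a | w≢b = refl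

  delete₁-removes : ∀ (α : Site k → Bool) a → delete₁ α a a ≡ false
  delete₁-removes α a rewrite ==ₛ-refl a = ∧-zeroʳ (α a)

  delete₂-removes-first : ∀ (α : Site k → Bool) a b → delete₂ α a b a ≡ false
  delete₂-removes-first α a b rewrite ==ₛ-refl a = ∧-zeroʳ (α a)

  delete₂-removes-second : ∀ (α : Site k → Bool) a b → delete₂ α a b b ≡ false
  delete₂-removes-second α a b rewrite ==ₛ-refl b | ∨-zeroʳ (b ==ₛ a) = ∧-zeroʳ (α b)

  -- Positions are connected, so a move of 0.33 has to leave a connected remainder.
  data Move (α β : Site k → Bool) : Set where
    take₁ : ∀ a → α a ≡ true → Connected (delete₁ α a) → (∀ z → β z ≡ delete₁ α a z) → Move α β
    take₂ : ∀ a b → α a ≡ true → α b ≡ true → edge a b ≡ true → Connected (delete₂ α a b) →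
            (∀ z → β z ≡ delete₂ α a b z) → Move α β

  Move-connected : ∀ {α β} → Move α β → Connected β
  Move-connected (take₁ a _ c h) = connected-cong (λ z → sym (h z)) c
  Move-connected (take₂ a b _ _ _ c h) = connected-cong (λ z → sym (h z)) c

  data Parent : Site k → Site k → Set where
    hub-arm    : ∀ i → Parent hub (arm i 0)
    hub-hub′   : Parent hub hub′
    hub′-leaf₁ : Parent hub′ leaf₁
    hub′-leaf₂ : Parent hub′ leaf₂
    arm-arm    : ∀ i p → Parent (arm i p) (arm i (suc p))

  isChild⇒Parent : ∀ a b → isChild a b ≡ true → Parent a b
  isChild⇒Parent hub (arm i zero) _ = hub-arm i
  isChild⇒Parent hub hub′ _ = hub-hub′
  isChild⇒Parent hub′ leaf₁ _ = hub′-leaf₁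
  isChild⇒Parent hub′ leaf₂ _ = hub′-leaf₂
  isChild⇒Parent (arm i p) (arm j q) e rewrite ==F⇒≡ i j (∧-elimˡ e) | ≡ᵇ-true⇒≡ q (suc p) (∧-elimʳ {i ==F j} e) = arm-arm j p
  isChild⇒Parent hub hub ()
  isChild⇒Parent hub leaf₁ ()
  isChild⇒Parent hub leaf₂ ()
  isChild⇒Parent hub outside ()
  isChild⇒Parent hub (arm i (suc p)) ()
  isChild⇒Parent hub′ hub ()
  isChild⇒Parent hub′ hub′ ()
  isChild⇒Parent hub′ outside ()
  isChild⇒Parent hub′ (arm i p) ()
  isChild⇒Parent leaf₁ b ()
  isChild⇒Parent leaf₂ b ()
  isChild⇒Parent outside b ()
  isChild⇒Parent (arm i p) hub ()
  isChild⇒Parent (arm i p) hub′ ()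
  isChild⇒Parent (arm i p) leaf₁ ()
  isChild⇒Parent (arm i p) leaf₂ ()
  isChild⇒Parent (arm i p) outside ()

  edge⇒Parent : ∀ a b → edge a b ≡ true → Parent a b ⊎ Parent b a
  edge⇒Parent a b e with ∨-elim {isChild a b} e
  ... | inj₁ ab = inj₁ (isChild⇒Parent a b ab)
  ... | inj₂ ba = inj₂ (isChild⇒Parent b a ba)

  data ParentChildMove (α β : Site k → Bool) : Set where
    parent-child : ∀ {a b} → Parent a b → α a ≡ true → α b ≡ true → Connected (delete₂ α a b) →
                   (∀ z → β z ≡ delete₂ α a b z) → ParentChildMove α β

  take₂⇒parent-child : ∀ {α β} a b → α a ≡ true → α b ≡ true → edge a b ≡ true → Connected (delete₂ α a b) →
                       (∀ z → β z ≡ delete₂ α a b z) → ParentChildMove α β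
  take₂⇒parent-child {α} a b pa pb e c h with edge⇒Parent a b e
  ... | inj₁ ab = parent-child ab pa pb c h
  ... | inj₂ ba = parent-child ba pb pa (connected-cong (λ z → sym (delete₂-swap α a b z)) c)
                    (λ z → trans (h z) (sym (delete₂-swap α a b z)))

record Realisation (k : ℕ) : Set where
  field
    n : ℕ
    E : Fin n → Fin n → Bool
    decode : Fin n → Site k
    encode : Site k → Fin n
    valid : Site k → Bool
    decode-valid : ∀ x → valid (decode x) ≡ true
    encode-decode : ∀ x → encode (decode x) ≡ x
    decode-encode : ∀ a → valid a ≡ true → decode (encode a) ≡ a
    E-decode : ∀ x y → E x y ≡ edge (decode x) (decode y)

module Play {k : ℕ} (S : Realisation k) where
  open Realisation S

  E-sym : ∀ x y → E x y ≡ E y x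
  E-sym x y = trans (E-decode x y) (trans (edge-sym (decode x) (decode y)) (sym (E-decode y x)))

  open GameOn E E-sym public

  AllValid : (Site k → Bool) → Set
  AllValid α = ∀ a → α a ≡ true → valid a ≡ true

  position : (Site k → Bool) → VSet n
  position α = tabulate λ x → α (decode x)

  position-lookup : ∀ α x → lookup (position α) x ≡ α (decode x)
  position-lookup α x = lookup∘tabulate _ x

  position-cong : ∀ {α β} → (∀ z → α z ≡ β z) → position α ≡ position β
  position-cong h = tabulate-cong λ x → h (decode x)

  encode-∈ : ∀ {α} a → AllValid α → α a ≡ true → encode a ∈ˢ position α
  encode-∈ {α} a valid-α αa = trans (position-lookup α (encode a)) (subst (λ z → α z ≡ true) (sym (decode-encode a (valid-α a αa))) αa)

  decode-injective : ∀ x y → decode x ≡ decode y → x ≡ y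
  decode-injective x y e = trans (sym (encode-decode x)) (trans (cong encode e) (encode-decode y))

  ==F-decode : ∀ x y → (x ==F y) ≡ (decode x ==ₛ decode y)
  ==F-decode x y with true⊎false (x ==F y)
  ... | inj₁ e rewrite ==F⇒≡ x y e = trans (==F-refl y) (sym (==ₛ-refl (decode y)))
  ... | inj₂ e rewrite e = sym (≢⇒==ₛ-false (decode x) (decode y)
                               λ d → true≢false (subst (λ z → (x ==F z) ≡ true) (decode-injective x y d) (==F-refl x)) e)

  reachᵛ⇒walk : ∀ {α x y} → Reachᵛ (position α) x y → Walk α (decode x) (decode y)
  reachᵛ⇒walk {α} (rhere p) = start (trans (sym (position-lookup α _)) p)
  reachᵛ⇒walk {α} (rthere {y} {x} r e p) =
    extend (reachᵛ⇒walk r) (trans (sym (E-decode y x)) e) (trans (sym (position-lookup α x)) p)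

  walk⇒reachᵛ : ∀ {α a b} → AllValid α → Walk α a b → Reachᵛ (position α) (encode a) (encode b)
  walk⇒reachᵛ valid-α (start p) = rhere (encode-∈ _ valid-α p)
  walk⇒reachᵛ valid-α (extend {y} {x} w e p) = rthere (walk⇒reachᵛ valid-α w)
    (trans (E-decode (encode y) (encode x))
      (subst₂ (λ u v → edge u v ≡ true) (sym (decode-encode y (valid-α y (walk-target w)))) (sym (decode-encode x (valid-α x p))) e))
    (encode-∈ _ valid-α p)

  connectedᵛ⇒connected : ∀ {α} → AllValid α → Connectedᵛ (position α) → Connected α
  connectedᵛ⇒connected {α} valid-α conn a b pa pb =
    subst₂ (Walk α) (decode-encode a (valid-α a pa)) (decode-encode b (valid-α b pb))
      (reachᵛ⇒walk (conn (encode a) (encode b) (encode-∈ a valid-α pa) (encode-∈ b valid-α pb)))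

  connected⇒connectedᵛ : ∀ {α} → AllValid α → Connected α → Connectedᵛ (position α)
  connected⇒connectedᵛ {α} valid-α conn x y px py =
    subst₂ (Reachᵛ (position α)) (encode-decode x) (encode-decode y)
      (walk⇒reachᵛ valid-α (conn (decode x) (decode y) (trans (sym (position-lookup α x)) px) (trans (sym (position-lookup α y)) py)))

  remove-single : ∀ α v → remove (position α) (single v) ≡ position (delete₁ α (decode v))
  remove-single α v = lookup-ext _ _ λ x → trans (remove-lookup (position α) (single v) x)
    (trans (cong₂ (λ p q → p ∧ not q) (position-lookup α x) (trans (lookup∘tabulate _ x) (==F-decode x v)))
      (sym (position-lookup (delete₁ α (decode v)) x)))

  remove-pair : ∀ α u v → remove (position α) (pair u v) ≡ position (delete₂ α (decode u) (decode v))
  remove-pair α u v = lookup-ext _ _ λ x → trans (remove-lookup (position α) (pair u v) x)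
    (trans (cong₂ (λ p q → p ∧ not q) (position-lookup α x)
             (trans (lookup∘tabulate _ x) (cong₂ _∨_ (==F-decode x u) (==F-decode x v))))
      (sym (position-lookup (delete₂ α (decode u) (decode v)) x)))

  valid-delete₁ : ∀ {α} a → AllValid α → AllValid (delete₁ α a)
  valid-delete₁ a valid-α z p = valid-α z (∧-elimˡ p)

  valid-delete₂ : ∀ {α} a b → AllValid α → AllValid (delete₂ α a b)
  valid-delete₂ a b valid-α z p = valid-α z (∧-elimˡ p)

  valid-cong : ∀ {α β} → (∀ z → β z ≡ α z) → AllValid α → AllValid β
  valid-cong h valid-α z p = valid-α z (trans (sym (h z)) p)

  Move-valid : ∀ α β → AllValid α → Move α β → AllValid β
  Move-valid α β valid-α (take₁ a _ _ h) = valid-cong h (valid-delete₁ a valid-α)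
  Move-valid α β valid-α (take₂ a b _ _ _ _ h) = valid-cong h (valid-delete₂ a b valid-α)

  ∈-moves⇒Move : ∀ α Y → AllValid α → Connected α → Y ∈ moves (position α) → ∃ λ β → Move α β × Y ≡ position β
  ∈-moves⇒Move α Y valid-α conn m with ∈-moves⇒Moveᵛ (position α) Y m
  ... | delete-one v p l eq =
    delete₁ α (decode v) ,
    take₁ (decode v) (trans (sym (position-lookup α v)) p)
      (connectedᵛ⇒connected (valid-delete₁ (decode v) valid-α)
        (subst Connectedᵛ (remove-single α v) (legal⇒connected (position α) v (single v) (connected⇒connectedᵛ valid-α conn) p l)))
      (λ z → refl) ,
    trans eq (remove-single α v)
  ... | delete-two u v lt pu pv e l eq =
    delete₂ α (decode u) (decode v) ,
    take₂ (decode u) (decode v) (trans (sym (position-lookup α u)) pu) (trans (sym (position-lookup α v)) pv)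
      (trans (sym (E-decode u v)) e)
      (connectedᵛ⇒connected (valid-delete₂ (decode u) (decode v) valid-α)
        (subst Connectedᵛ (remove-pair α u v) (legal⇒connected (position α) u (pair u v) (connected⇒connectedᵛ valid-α conn) pu l)))
      (λ z → refl) ,
    trans eq (remove-pair α u v)

  private
    delete₁-encode : ∀ α a → valid a ≡ true → ∀ z → delete₁ α (decode (encode a)) z ≡ delete₁ α a z
    delete₁-encode α a va z rewrite decode-encode a va = refl

    delete₂-encode : ∀ α a b → valid a ≡ true → valid b ≡ true → ∀ z →
                     delete₂ α (decode (encode a)) (decode (encode b)) z ≡ delete₂ α a b z
    delete₂-encode α a b va vb z rewrite decode-encode a va | decode-encode b vb = refl

    -- The concrete move lists a pair once, with its smaller label first.
    take-pair : ∀ α β a b → AllValid α → Connected α → α a ≡ true → α b ≡ true → edge a b ≡ true →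
                Connected (delete₂ α a b) → (∀ z → β z ≡ delete₂ α a b z) →
                toℕ (encode a) < toℕ (encode b) → position β ∈ moves (position α)
    take-pair α β a b valid-α conn pa pb e ca h lt =
      Moveᵛ⇒∈-moves (position α) (position β)
        (delete-two (encode a) (encode b) (<⇒<ᵇ-true _ _ lt) (encode-∈ a valid-α pa) (encode-∈ b valid-α pb)
          (trans (E-decode (encode a) (encode b))
            (trans (cong₂ edge (decode-encode a (valid-α a pa)) (decode-encode b (valid-α b pb))) e))
          (connected⇒legal (position α) (encode a) (pair (encode a) (encode b)) (connected⇒connectedᵛ valid-α conn) (encode-∈ a valid-α pa)
            (subst Connectedᵛ (sym removed) (connected⇒connectedᵛ (valid-delete₂ a b valid-α) ca)))
          (trans (position-cong h) (sym removed)))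
      where
      removed : remove (position α) (pair (encode a) (encode b)) ≡ position (delete₂ α a b)
      removed = trans (remove-pair α (encode a) (encode b)) (position-cong (delete₂-encode α a b (valid-α a pa) (valid-α b pb)))

  Move⇒∈-moves : ∀ α β → AllValid α → Connected α → Move α β → position β ∈ moves (position α)
  Move⇒∈-moves α β valid-α conn (take₁ a pa ca h) =
    Moveᵛ⇒∈-moves (position α) (position β)
      (delete-one (encode a) (encode-∈ a valid-α pa)
        (connected⇒legal (position α) (encode a) (single (encode a)) (connected⇒connectedᵛ valid-α conn) (encode-∈ a valid-α pa)
          (subst Connectedᵛ (sym removed) (connected⇒connectedᵛ (valid-delete₁ a valid-α) ca)))
        (trans (position-cong h) (sym removed)))
    where
    removed : remove (position α) (single (encode a)) ≡ position (delete₁ α a)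
    removed = trans (remove-single α (encode a)) (position-cong (delete₁-encode α a (valid-α a pa)))
  Move⇒∈-moves α β valid-α conn (take₂ a b pa pb e ca h) with <-cmp (toℕ (encode a)) (toℕ (encode b))
  ... | tri< lt _ _ = take-pair α β a b valid-α conn pa pb e ca h lt
  ... | tri≈ _ eq _ = ⊥-elim (true≢false (trans (cong (λ z → edge z b) (sym a≡b)) e) (edge-irrefl b))
    where
    a≡b : a ≡ b
    a≡b = trans (sym (decode-encode a (valid-α a pa))) (trans (cong decode (toℕ-injective eq)) (decode-encode b (valid-α b pb)))
  ... | tri> _ _ gt = take-pair α β b a valid-α conn pb pa (trans (edge-sym b a) e)
                        (connected-cong (λ z → sym (delete₂-swap α a b z)) ca)
                        (λ z → trans (h z) (sym (delete₂-swap α a b z))) gt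

  grundyᴾ : (Site k → Bool) → ℕ
  grundyᴾ α = grundyᵛ (position α)

  grundyᴾ-cong : ∀ {α β} → (∀ z → α z ≡ β z) → grundyᴾ α ≡ grundyᴾ β
  grundyᴾ-cong h = cong grundyᵛ (position-cong h)

  grundyᴾ-≢-option : ∀ α β → AllValid α → Connected α → Move α β → grundyᴾ β ≢ grundyᴾ α
  grundyᴾ-≢-option α β valid-α conn m = grundyᵛ-≢-option (position α) (position β) (Move⇒∈-moves α β valid-α conn m)

  grundyᴾ-≤ : ∀ α v → AllValid α → Connected α → (∀ β → Move α β → grundyᴾ β ≢ v) → grundyᴾ α ≤ v
  grundyᴾ-≤ α v valid-α conn avoid = grundyᵛ-≤ (position α) v λ Y m e →
    let (β , mv , eq) = ∈-moves⇒Move α Y valid-α conn m in avoid β mv (trans (cong grundyᵛ (sym eq)) e)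

  grundyᴾ-≡ : ∀ α v → AllValid α → Connected α → (∀ β → Move α β → grundyᴾ β ≢ v) →
              (∀ j → j < v → ∃ λ β → Move α β × grundyᴾ β ≡ j) → grundyᴾ α ≡ v
  grundyᴾ-≡ α v valid-α conn avoid reach = grundyᵛ-≡ (position α) v
    (λ Y m e → let (β , mv , eq) = ∈-moves⇒Move α Y valid-α conn m in avoid β mv (trans (cong grundyᵛ (sym eq)) e))
    λ j j<v → let (β , mv , e) = reach j j<v in position β , Move⇒∈-moves α β valid-α conn mv , e

  grundyᴾ-empty : ∀ α → (∀ z → α z ≡ false) → grundyᴾ α ≡ 0
  grundyᴾ-empty α absent =
    grundyᴾ-≡ α 0 (λ a e → ⊥-elim (true≢false e (absent a))) (λ x y e → ⊥-elim (true≢false e (absent x)))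
      (λ β mv _ → no-move mv) (λ j ())
    where
    no-move : ∀ {β} → Move α β → ⊥
    no-move (take₁ a pa _ _) = true≢false pa (absent a)
    no-move (take₂ a b pa _ _ _ _) = true≢false pa (absent a)

  size : (Site k → Bool) → ℕ
  size α = count (position α)

  size-decreases : ∀ α β → AllValid α → Connected α → Move α β → size β < size α
  size-decreases α β valid-α conn m = moves-shrink (position α) (position β) (Move⇒∈-moves α β valid-α conn m)

grundyᴾ-realisation-independent : ∀ {k} (S₁ S₂ : Realisation k) α →
  Play.AllValid S₁ α → Play.AllValid S₂ α → Connected α → Play.grundyᴾ S₁ α ≡ Play.grundyᴾ S₂ α
grundyᴾ-realisation-independent S₁ S₂ α = go (P₁.size α) α refl
  where
  module P₁ = Play S₁
  module P₂ = Play S₂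
  Claim : ℕ → Set
  Claim m = ∀ α → P₁.size α ≡ m → P₁.AllValid α → P₂.AllValid α → Connected α → P₁.grundyᴾ α ≡ P₂.grundyᴾ α
  go : ∀ m → Claim m
  go = <-rec Claim λ m rec α size≡m v₁ v₂ conn →
    let same : ∀ β → Move α β → P₁.grundyᴾ β ≡ P₂.grundyᴾ β
        same β mv = rec (subst (P₁.size β <_) size≡m (P₁.size-decreases α β v₁ conn mv)) β refl
                        (P₁.Move-valid α β v₁ mv) (P₂.Move-valid α β v₂ mv) (Move-connected mv)
    in trans (P₁.grundyᵛ-mex (P₁.position α))
         (trans (mex-cong (map P₁.grundyᵛ (P₁.moves (P₁.position α))) (map P₂.grundyᵛ (P₂.moves (P₂.position α)))
                  (λ m₁ → let (Y , Y∈ , e) = ∈-map⁻ P₁.grundyᵛ m₁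
                              (β , mv , Y≡) = P₁.∈-moves⇒Move α Y v₁ conn Y∈
                          in subst (_∈ map P₂.grundyᵛ (P₂.moves (P₂.position α)))
                                   (trans (sym (same β mv)) (trans (cong P₁.grundyᵛ (sym Y≡)) (sym e)))
                                   (∈-map⁺ P₂.grundyᵛ (P₂.Move⇒∈-moves α β v₂ conn mv)))
                  (λ m₂ → let (Y , Y∈ , e) = ∈-map⁻ P₂.grundyᵛ m₂
                              (β , mv , Y≡) = P₂.∈-moves⇒Move α Y v₂ conn Y∈
                          in subst (_∈ map P₁.grundyᵛ (P₁.moves (P₁.position α)))
                                   (trans (same β mv) (trans (cong P₂.grundyᵛ (sym Y≡)) (sym e)))
                                   (∈-map⁺ P₁.grundyᵛ (P₁.Move⇒∈-moves α β v₁ conn mv))))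
           (sym (P₂.grundyᵛ-mex (P₂.position α))))

-- Paths

mod3 : ℕ → ℕ
mod3 zero = 0
mod3 (suc zero) = 1
mod3 (suc (suc zero)) = 2
mod3 (suc (suc (suc n))) = mod3 n

mod3-suc-≢ : ∀ L → mod3 (suc L) ≢ mod3 L
mod3-suc-≢ zero ()
mod3-suc-≢ (suc zero) ()
mod3-suc-≢ (suc (suc zero)) ()
mod3-suc-≢ (suc (suc (suc L))) e = mod3-suc-≢ L e

mod3-2+-≢ : ∀ L → mod3 (suc (suc L)) ≢ mod3 L
mod3-2+-≢ zero ()
mod3-2+-≢ (suc zero) ()
mod3-2+-≢ (suc (suc zero)) ()
mod3-2+-≢ (suc (suc (suc L))) e = mod3-2+-≢ L e

mod3-options : ∀ L j → j < mod3 L → (∃ λ L′ → suc L′ ≡ L × mod3 L′ ≡ j) ⊎ (∃ λ L′ → suc (suc L′) ≡ L × mod3 L′ ≡ j)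
mod3-options zero j ()
mod3-options (suc zero) zero lt = inj₁ (0 , refl , refl)
mod3-options (suc zero) (suc j) (s≤s ())
mod3-options (suc (suc zero)) zero lt = inj₂ (0 , refl , refl)
mod3-options (suc (suc zero)) (suc zero) lt = inj₁ (1 , refl , refl)
mod3-options (suc (suc zero)) (suc (suc j)) (s≤s (s≤s ()))
mod3-options (suc (suc (suc L))) j lt with mod3-options L j lt
... | inj₁ (L′ , e , r) = inj₁ (3 + L′ , cong (λ x → 3 + x) e , r)
... | inj₂ (L′ , e , r) = inj₂ (3 + L′ , cong (λ x → 3 + x) e , r)

inRange : ℕ → ℕ → ℕ → Bool
inRange lo L q = (lo ≤ᵇ q) ∧ (q <ᵇ lo + L)

inRange⇒ : ∀ lo L q → inRange lo L q ≡ true → lo ≤ q × q < lo + L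
inRange⇒ lo L q e = ≤ᵇ-true⇒≤ lo q (∧-elimˡ e) , <ᵇ-true⇒< q (lo + L) (∧-elimʳ {lo ≤ᵇ q} e)

inRange-intro : ∀ lo L q → lo ≤ q → q < lo + L → inRange lo L q ≡ true
inRange-intro lo L q a b = ∧-intro (≤⇒≤ᵇ-true lo q a) (<⇒<ᵇ-true q (lo + L) b)

inRange-drop-first : ∀ lo L′ q → (inRange lo (suc L′) q ∧ not (q ≡ᵇ lo)) ≡ inRange (suc lo) L′ q
inRange-drop-first lo L′ q = true-iff⇒≡ ⇒ ⇐
  where
  ⇒ : (inRange lo (suc L′) q ∧ not (q ≡ᵇ lo)) ≡ true → inRange (suc lo) L′ q ≡ true
  ⇒ e with inRange⇒ lo (suc L′) q (∧-elimˡ e)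
  ... | a , b = inRange-intro (suc lo) L′ q (≤∧≢⇒< a (λ x → true≢false (≡⇒≡ᵇ-true q lo (sym x)) (not-true⇒false (∧-elimʳ {inRange lo (suc L′) q} e))))
                  (subst (q <_) (+-suc lo L′) b)
  ⇐ : inRange (suc lo) L′ q ≡ true → (inRange lo (suc L′) q ∧ not (q ≡ᵇ lo)) ≡ true
  ⇐ e with inRange⇒ (suc lo) L′ q e
  ... | a , b = ∧-intro (inRange-intro lo (suc L′) q (<⇒≤ a) (subst (q <_) (sym (+-suc lo L′)) b))
                    (false⇒not-true (≢⇒≡ᵇ-false q lo λ x → <-irrefl (sym x) a))

inRange-drop-last : ∀ lo L′ q → (inRange lo (suc L′) q ∧ not (q ≡ᵇ lo + L′)) ≡ inRange lo L′ q
inRange-drop-last lo L′ q = true-iff⇒≡ ⇒ ⇐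
  where
  ⇒ : (inRange lo (suc L′) q ∧ not (q ≡ᵇ lo + L′)) ≡ true → inRange lo L′ q ≡ true
  ⇒ e with inRange⇒ lo (suc L′) q (∧-elimˡ e)
  ... | a , b = inRange-intro lo L′ q a (≤∧≢⇒< (≤-pred (subst (q <_) (+-suc lo L′) b))
                  (λ x → true≢false (≡⇒≡ᵇ-true q (lo + L′) x) (not-true⇒false (∧-elimʳ {inRange lo (suc L′) q} e))))
  ⇐ : inRange lo L′ q ≡ true → (inRange lo (suc L′) q ∧ not (q ≡ᵇ lo + L′)) ≡ true
  ⇐ e with inRange⇒ lo L′ q e
  ... | a , b = ∧-intro (inRange-intro lo (suc L′) q a (subst (q <_) (sym (+-suc lo L′)) (<-trans b (n<1+n _))))
                    (false⇒not-true (≢⇒≡ᵇ-false q (lo + L′) λ x → <-irrefl x b))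

private
  ∧-not-∨-split : ∀ x a b → (x ∧ not (a ∨ b)) ≡ ((x ∧ not a) ∧ not b)
  ∧-not-∨-split true true b = refl
  ∧-not-∨-split true false b = refl
  ∧-not-∨-split false a b = refl

inRange-drop-first-two : ∀ lo L′ q → (inRange lo (suc (suc L′)) q ∧ not ((q ≡ᵇ lo) ∨ (q ≡ᵇ suc lo))) ≡ inRange (suc (suc lo)) L′ q
inRange-drop-first-two lo L′ q = trans (∧-not-∨-split (inRange lo (suc (suc L′)) q) (q ≡ᵇ lo) (q ≡ᵇ suc lo))
  (trans (cong (λ x → x ∧ not (q ≡ᵇ suc lo)) (inRange-drop-first lo (suc L′) q)) (inRange-drop-first (suc lo) L′ q))

private
  ∧-not-∨-split′ : ∀ x a b → (x ∧ not (a ∨ b)) ≡ ((x ∧ not b) ∧ not a)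
  ∧-not-∨-split′ true true true = refl
  ∧-not-∨-split′ true true false = refl
  ∧-not-∨-split′ true false true = refl
  ∧-not-∨-split′ true false false = refl
  ∧-not-∨-split′ false a b = refl

inRange-drop-last-two : ∀ lo L′ q → (inRange lo (suc (suc L′)) q ∧ not ((q ≡ᵇ lo + L′) ∨ (q ≡ᵇ suc (lo + L′)))) ≡ inRange lo L′ q
inRange-drop-last-two lo L′ q = trans (∧-not-∨-split′ (inRange lo (suc (suc L′)) q) (q ≡ᵇ lo + L′) (q ≡ᵇ suc (lo + L′)))
  (trans (cong (λ x → x ∧ not (q ≡ᵇ lo + L′)) drop-one) (inRange-drop-last lo L′ q))
  where
  drop-one : (inRange lo (suc (suc L′)) q ∧ not (q ≡ᵇ suc (lo + L′))) ≡ inRange lo (suc L′) q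
  drop-one = trans (cong (λ t → inRange lo (suc (suc L′)) q ∧ not (q ≡ᵇ t)) (sym (+-suc lo L′))) (inRange-drop-last lo (suc L′) q)

inRangeᴹ : ℕ → ℕ → Maybe ℕ → Bool
inRangeᴹ lo L (just q) = inRange lo L q
inRangeᴹ lo L nothing = false

inRangeᴹ-if : ∀ lo L c x → inRangeᴹ lo L (if c then just x else nothing) ≡ (c ∧ inRange lo L x)
inRangeᴹ-if lo L true x = refl
inRangeᴹ-if lo L false x = refl

inRangeᴹ-if-else : ∀ lo L c x m → inRangeᴹ lo L (if c then just x else m) ≡ (if c then inRange lo L x else inRangeᴹ lo L m)
inRangeᴹ-if-else lo L true x m = refl
inRangeᴹ-if-else lo L false x m = refl

record PathIn (k : ℕ) : Set where
  field
    N : ℕ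
    π : ℕ → Site k
    index : Site k → Maybe ℕ
    index-π : ∀ p → p < N → index (π p) ≡ just p
    π-index : ∀ a p → index a ≡ just p → π p ≡ a
    index-< : ∀ a p → index a ≡ just p → p < N
    edge⇒consecutive : ∀ p q → p < N → q < N → edge (π p) (π q) ≡ true → q ≡ suc p ⊎ p ≡ suc q
    consecutive-edge : ∀ p → suc p < N → edge (π p) (π (suc p)) ≡ true

module Segments {k : ℕ} (S : Realisation k) (P : PathIn k)
  (π-valid : ∀ p → p < PathIn.N P → Realisation.valid S (PathIn.π P p) ≡ true) where

  open PathIn P
  open Play S

  segment : ℕ → ℕ → Site k → Bool
  segment lo L a = inRangeᴹ lo L (index a)

  segment-π : ∀ lo L p → p < N → segment lo L (π p) ≡ inRange lo L p
  segment-π lo L p lt rewrite index-π p lt = refl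

  segment⇒ : ∀ lo L a → segment lo L a ≡ true → Σ ℕ λ q → index a ≡ just q × lo ≤ q × q < lo + L
  segment⇒ lo L a e with index a in eq
  ... | just q = q , refl , inRange⇒ lo L q e
  segment⇒ lo L a () | nothing

  segment-valid : ∀ lo L → AllValid (segment lo L)
  segment-valid lo L a e with segment⇒ lo L a e
  ... | q , eq , _ = subst (λ z → Realisation.valid S z ≡ true) (π-index a q eq) (π-valid q (index-< a q eq))

  ==ₛ-π : ∀ z q p → index z ≡ just q → p < N → (z ==ₛ π p) ≡ (q ≡ᵇ p)
  ==ₛ-π z q p eq lt = true-iff⇒≡ f g
    where
    f : (z ==ₛ π p) ≡ true → (q ≡ᵇ p) ≡ true
    f e = ≡⇒≡ᵇ-true q p (just-injective (trans (sym eq) (trans (cong index (==ₛ⇒≡ z (π p) e)) (index-π p lt))))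
    g : (q ≡ᵇ p) ≡ true → (z ==ₛ π p) ≡ true
    g e rewrite sym (≡ᵇ-true⇒≡ q p e) | sym (π-index z q eq) = ==ₛ-refl (π q)

  walk-along : ∀ lo L d → lo + L ≤ N → d < L → Walk (segment lo L) (π lo) (π (lo + d))
  walk-along lo L zero le lt = subst (λ x → Walk (segment lo L) (π lo) (π x)) (sym (+-identityʳ lo))
     (start (trans (segment-π lo L lo (<-≤-trans (subst (lo <_) refl (m<m+n lo lt)) le)) (inRange-intro lo L lo ≤-refl (m<m+n lo lt))))
  walk-along lo L (suc d) le lt = extend (walk-along lo L d le (<-trans (n<1+n d) lt))
     (subst (λ x → edge (π (lo + d)) (π x) ≡ true) (sym (+-suc lo d)) (consecutive-edge (lo + d) (subst (_< N) (+-suc lo d) lt2)))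
     (trans (segment-π lo L (lo + suc d) lt2) (inRange-intro lo L (lo + suc d) (m≤m+n lo (suc d)) (+-monoʳ-< lo lt)))
    where
    lt2 : lo + suc d < N
    lt2 = <-≤-trans (+-monoʳ-< lo lt) le

  segment-connected : ∀ lo L → lo + L ≤ N → Connected (segment lo L)
  segment-connected lo L le = connected-via-hub (segment lo L) (π lo) h
    where
    h : ∀ x → segment lo L x ≡ true → Walk (segment lo L) (π lo) x
    h x e with segment⇒ lo L x e
    ... | q , eq , a , b = subst (Walk (segment lo L) (π lo)) (trans (cong π (m+[n∸m]≡n a)) (π-index x q eq))
            (walk-along lo L (q ∸ lo) le (+-cancelˡ-< lo _ _ (subst (_< lo + L) (sym (m+[n∸m]≡n a)) b)))

  delete₁-segment : ∀ lo L p lo′ L′ → p < N → (∀ q → (inRange lo L q ∧ not (q ≡ᵇ p)) ≡ inRange lo′ L′ q) →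
                    ∀ z → delete₁ (segment lo L) (π p) z ≡ segment lo′ L′ z
  delete₁-segment lo L p lo′ L′ p<N h z with index z in eq
  ... | nothing = refl
  ... | just q = trans (cong (λ t → inRange lo L q ∧ not t) (==ₛ-π z q p eq p<N)) (h q)

  delete₂-segment : ∀ lo L p p′ lo′ L′ → p < N → p′ < N →
                    (∀ q → (inRange lo L q ∧ not ((q ≡ᵇ p) ∨ (q ≡ᵇ p′))) ≡ inRange lo′ L′ q) →
                    ∀ z → delete₂ (segment lo L) (π p) (π p′) z ≡ segment lo′ L′ z
  delete₂-segment lo L p p′ lo′ L′ p<N p′<N h z with index z in eq
  ... | nothing = refl
  ... | just q = trans (cong (λ t → inRange lo L q ∧ not t) (cong₂ _∨_ (==ₛ-π z q p eq p<N) (==ₛ-π z q p′ eq p′<N))) (h q)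

  delete₁-keeps-π : ∀ lo L m q → m < N → q < N → inRange lo L q ≡ true → q ≢ m → delete₁ (segment lo L) (π m) (π q) ≡ true
  delete₁-keeps-π lo L m q m<N q<N inside q≢m =
    trans (cong₂ (λ a b → a ∧ not b) (segment-π lo L q q<N) (==ₛ-π (π q) q m (index-π q q<N) m<N))
          (∧-not-intro inside (≢⇒≡ᵇ-false q m q≢m))

  delete₂-keeps-π : ∀ lo L m m′ q → m < N → m′ < N → q < N → inRange lo L q ≡ true → q ≢ m → q ≢ m′ →
                    delete₂ (segment lo L) (π m) (π m′) (π q) ≡ true
  delete₂-keeps-π lo L m m′ q m<N m′<N q<N inside q≢m q≢m′ =
    trans (cong₂ (λ a b → a ∧ not b) (segment-π lo L q q<N)
            (cong₂ _∨_ (==ₛ-π (π q) q m (index-π q q<N) m<N) (==ₛ-π (π q) q m′ (index-π q q<N) m′<N)))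
          (∧-not-intro inside (∨-false (≢⇒≡ᵇ-false q m q≢m) (≢⇒≡ᵇ-false q m′ q≢m′)))

  Avoids : (Site k → Bool) → ℕ → Set
  Avoids γ m = ∀ y → γ y ≡ true → ∃ λ r → index y ≡ just r × r ≢ m

  delete₁-avoids : ∀ lo L m → m < N → Avoids (delete₁ (segment lo L) (π m)) m
  delete₁-avoids lo L m m<N y e with segment⇒ lo L y (∧-elimˡ e)
  ... | r , eq , _ = r , eq , λ r≡m →
    true≢false (trans (==ₛ-π y r m eq m<N) (≡⇒≡ᵇ-true r m r≡m)) (not-true⇒false (∧-elimʳ {segment lo L y} e))

  delete₂-avoids : ∀ lo L m m′ → m < N → Avoids (delete₂ (segment lo L) (π m) (π m′)) m
  delete₂-avoids lo L m m′ m<N y e with segment⇒ lo L y (∧-elimˡ e)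
  ... | r , eq , _ = r , eq , λ r≡m →
    true≢false (trans (==ₛ-π y r m eq m<N) (≡⇒≡ᵇ-true r m r≡m)) (∨-falseˡ (not-true⇒false (∧-elimʳ {segment lo L y} e)))

  -- Edges only join consecutive indices, so nothing crosses an absent index.
  gap⇒disconnected : ∀ γ m p q → Avoids γ m → p < m → m < q → q < N → γ (π p) ≡ true → γ (π q) ≡ true → ¬ Connected γ
  gap⇒disconnected γ m p q avoids p<m m<q q<N γp γq =
    closed-split⇒disconnected γ Below (π p) (π q) closed (p , index-π p (<-trans p<m (<-trans m<q q<N)) , p<m) q-above γp γq
    where
    Below : Site k → Set
    Below z = ∃ λ r → index z ≡ just r × r < m
    q-above : ¬ Below (π q)
    q-above (r , e , r<m) = <-asym m<q (subst (_< m) (just-injective (trans (sym e) (index-π q q<N))) r<m)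
    closed : Closed γ Below
    closed x y (r₁ , e₁ , r₁<m) γy xy with avoids y γy
    ... | r₂ , e₂ , r₂≢m with edge⇒consecutive r₁ r₂ (index-< x r₁ e₁) (index-< y r₂ e₂)
                               (subst₂ (λ u v → edge u v ≡ true) (sym (π-index x r₁ e₁)) (sym (π-index y r₂ e₂)) xy)
    ... | inj₁ refl = r₂ , e₂ , ≤∧≢⇒< r₁<m r₂≢m
    ... | inj₂ refl = r₂ , e₂ , <-trans (n<1+n r₂) r₁<m

  data SegmentOption (lo L : ℕ) (β : Site k → Bool) : Set where
    shorter : ∀ lo′ L′ → lo ≤ lo′ → lo′ + L′ ≤ lo + L → (suc L′ ≡ L ⊎ suc (suc L′) ≡ L) →
              (∀ z → β z ≡ segment lo′ L′ z) → SegmentOption lo L β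

  private
    +-2+ : ∀ m n → m + suc (suc n) ≡ suc (suc (m + n))
    +-2+ m n = trans (+-suc m (suc n)) (cong suc (+-suc m n))

  segment-take₁ : ∀ lo L q β → lo + L ≤ N → (∀ z → β z ≡ delete₁ (segment lo L) (π q) z) →
                  Connected (delete₁ (segment lo L) (π q)) → lo ≤ q → q < lo + L → SegmentOption lo L β
  segment-take₁ lo zero q β end≤N h c lo≤q q<end = ⊥-elim (<⇒≱ (subst (q <_) (+-identityʳ lo) q<end) lo≤q)
  segment-take₁ lo (suc L) q β end≤N h c lo≤q q<end with q ≟ lo
  ... | yes refl = shorter (suc q) L (n≤1+n q) (≤-reflexive (sym (+-suc q L))) (inj₁ refl)
                     λ z → trans (h z) (delete₁-segment q (suc L) q (suc q) L (<-≤-trans q<end end≤N) (inRange-drop-first q L) z)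
  ... | no q≢lo with q ≟ lo + L
  ... | yes refl = shorter lo L ≤-refl (+-monoʳ-≤ lo (n≤1+n L)) (inj₁ refl)
                     λ z → trans (h z) (delete₁-segment lo (suc L) (lo + L) lo L (<-≤-trans q<end end≤N) (inRange-drop-last lo L) z)
  ... | no q≢last =
    ⊥-elim (gap⇒disconnected _ q lo (lo + L) (delete₁-avoids lo (suc L) q q<N) lo<q q<last last<N
              (delete₁-keeps-π lo (suc L) q lo q<N (<-trans lo<q q<N) (inRange-intro lo (suc L) lo ≤-refl (m<m+n lo (s≤s z≤n))) (≢-sym q≢lo))
              (delete₁-keeps-π lo (suc L) q (lo + L) q<N last<N (inRange-intro lo (suc L) (lo + L) (m≤m+n lo L) last<end) (≢-sym q≢last))
              c)
    where
    q<N = <-≤-trans q<end end≤N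
    lo<q = ≤∧≢⇒< lo≤q (≢-sym q≢lo)
    last<end = +-monoʳ-< lo (n<1+n L)
    last<N = <-≤-trans last<end end≤N
    q<last = ≤∧≢⇒< (≤-pred (subst (q <_) (+-suc lo L) q<end)) q≢last

  segment-take₂ : ∀ lo L m β → lo + L ≤ N → (∀ z → β z ≡ delete₂ (segment lo L) (π m) (π (suc m)) z) →
                  Connected (delete₂ (segment lo L) (π m) (π (suc m))) → lo ≤ m → suc m < lo + L → SegmentOption lo L β
  segment-take₂ lo zero m β end≤N h c lo≤m m+1<end =
    ⊥-elim (<⇒≱ (<-trans (n<1+n m) (subst (suc m <_) (+-identityʳ lo) m+1<end)) lo≤m)
  segment-take₂ lo (suc zero) m β end≤N h c lo≤m m+1<end = ⊥-elim (<⇒≱ (≤-pred (subst (suc m <_) (+-comm lo 1) m+1<end)) lo≤m)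
  segment-take₂ lo (suc (suc L)) m β end≤N h c lo≤m m+1<end with m ≟ lo
  ... | yes refl = shorter (suc (suc m)) L (≤-trans (n≤1+n m) (n≤1+n _)) (≤-reflexive (sym (+-2+ m L))) (inj₂ refl)
                     λ z → trans (h z) (delete₂-segment m (suc (suc L)) m (suc m) (suc (suc m)) L m<N m+1<N (inRange-drop-first-two m L) z)
    where
    m+1<N = <-≤-trans m+1<end end≤N
    m<N = <-trans (n<1+n m) m+1<N
  ... | no m≢lo with m ≟ lo + L
  ... | yes refl = shorter lo L ≤-refl (+-monoʳ-≤ lo (m≤n+m L 2)) (inj₂ refl)
                     λ z → trans (h z) (delete₂-segment lo (suc (suc L)) (lo + L) (suc (lo + L)) lo L m<N m+1<N (inRange-drop-last-two lo L) z)
    where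
    m+1<N = <-≤-trans m+1<end end≤N
    m<N = <-trans (n<1+n _) m+1<N
  ... | no m≢lo+L =
    ⊥-elim (gap⇒disconnected _ m lo last (delete₂-avoids lo (suc (suc L)) m (suc m) m<N) lo<m m<last last<N
              (delete₂-keeps-π lo (suc (suc L)) m (suc m) lo m<N m+1<N (<-trans lo<m m<N)
                 (inRange-intro lo (suc (suc L)) lo ≤-refl (m<m+n lo (s≤s z≤n))) (≢-sym m≢lo) (<⇒≢ (s≤s lo≤m)))
              (delete₂-keeps-π lo (suc (suc L)) m (suc m) last m<N m+1<N last<N
                 (inRange-intro lo (suc (suc L)) last (≤-trans (m≤m+n lo L) (n≤1+n _)) last<end)
                 (≢-sym (<⇒≢ m<last)) (λ e → m≢lo+L (sym (suc-injective e))))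
              c)
    where
    last = suc (lo + L)
    last<end : last < lo + suc (suc L)
    last<end = subst (last <_) (sym (+-2+ lo L)) (n<1+n _)
    last<N = <-≤-trans last<end end≤N
    m+1<N = <-≤-trans m+1<end end≤N
    m<N = <-trans (n<1+n m) m+1<N
    lo<m = ≤∧≢⇒< lo≤m (≢-sym m≢lo)
    m<last = ≤-pred (subst (suc m <_) (+-2+ lo L) m+1<end)

  delete₁-cong : ∀ (α : Site k → Bool) {a b} → a ≡ b → ∀ z → delete₁ α a z ≡ delete₁ α b z
  delete₁-cong α refl z = refl

  delete₂-cong : ∀ (α : Site k → Bool) {a b a′ b′} → a ≡ a′ → b ≡ b′ → ∀ z → delete₂ α a b z ≡ delete₂ α a′ b′ z
  delete₂-cong α refl refl z = refl

  -- Deleting an interior vertex disconnects a path, so a move shortens it at one end.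
  segment-Move : ∀ lo L β → lo + L ≤ N → Move (segment lo L) β → SegmentOption lo L β
  segment-Move lo L β end≤N (take₁ a pa c h) with segment⇒ lo L a pa
  ... | q , eq , lo≤q , q<end = segment-take₁ lo L q β end≤N (λ z → trans (h z) (same z)) (connected-cong same c) lo≤q q<end
    where
    same = delete₁-cong (segment lo L) (sym (π-index a q eq))
  segment-Move lo L β end≤N (take₂ a b pa pb e c h) with segment⇒ lo L a pa | segment⇒ lo L b pb
  ... | q₁ , eq₁ , lo≤q₁ , q₁<end | q₂ , eq₂ , lo≤q₂ , q₂<end
    with edge⇒consecutive q₁ q₂ (<-≤-trans q₁<end end≤N) (<-≤-trans q₂<end end≤N)
           (subst₂ (λ u v → edge u v ≡ true) (sym (π-index a q₁ eq₁)) (sym (π-index b q₂ eq₂)) e)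
  ... | inj₁ refl = segment-take₂ lo L q₁ β end≤N (λ z → trans (h z) (same z)) (connected-cong same c) lo≤q₁ q₂<end
    where
    same = delete₂-cong (segment lo L) (sym (π-index a q₁ eq₁)) (sym (π-index b _ eq₂))
  ... | inj₂ refl = segment-take₂ lo L q₂ β end≤N (λ z → trans (h z) (same z)) (connected-cong same c) lo≤q₂ q₁<end
    where
    same : ∀ z → delete₂ (segment lo L) a b z ≡ delete₂ (segment lo L) (π q₂) (π (suc q₂)) z
    same z = trans (delete₂-cong (segment lo L) (sym (π-index a _ eq₁)) (sym (π-index b q₂ eq₂)) z)
                   (delete₂-swap (segment lo L) (π q₂) (π (suc q₂)) z)

  take-last : ∀ lo L → lo + suc L ≤ N → Move (segment lo (suc L)) (segment lo L)
  take-last lo L end≤N =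
    take₁ (π (lo + L))
      (trans (segment-π lo (suc L) (lo + L) last<N) (inRange-intro lo (suc L) _ (m≤m+n lo L) last<end))
      (connected-cong rest (segment-connected lo L (≤-trans (+-monoʳ-≤ lo (n≤1+n L)) end≤N)))
      rest
    where
    last<end = +-monoʳ-< lo (n<1+n L)
    last<N = <-≤-trans last<end end≤N
    rest : ∀ z → segment lo L z ≡ delete₁ (segment lo (suc L)) (π (lo + L)) z
    rest z = sym (delete₁-segment lo (suc L) (lo + L) lo L last<N (inRange-drop-last lo L) z)

  take-last-two : ∀ lo L → lo + suc (suc L) ≤ N → Move (segment lo (suc (suc L))) (segment lo L)
  take-last-two lo L end≤N =
    take₂ (π (lo + L)) (π (suc (lo + L)))
      (trans (segment-π lo (suc (suc L)) (lo + L) a<N) (inRange-intro lo (suc (suc L)) _ (m≤m+n lo L) (<-trans (n<1+n _) b<end)))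
      (trans (segment-π lo (suc (suc L)) (suc (lo + L)) b<N) (inRange-intro lo (suc (suc L)) _ (≤-trans (m≤m+n lo L) (n≤1+n _)) b<end))
      (consecutive-edge (lo + L) b<N)
      (connected-cong rest (segment-connected lo L (≤-trans (+-monoʳ-≤ lo (m≤n+m L 2)) end≤N)))
      rest
    where
    b<end : suc (lo + L) < lo + suc (suc L)
    b<end = subst (suc (lo + L) <_) (sym (+-2+ lo L)) (n<1+n _)
    b<N = <-≤-trans b<end end≤N
    a<N = <-trans (n<1+n _) b<N
    rest : ∀ z → segment lo L z ≡ delete₂ (segment lo (suc (suc L))) (π (lo + L)) (π (suc (lo + L))) z
    rest z = sym (delete₂-segment lo (suc (suc L)) (lo + L) (suc (lo + L)) lo L a<N b<N (inRange-drop-last-two lo L) z)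

  grundy-segment : ∀ L lo → lo + L ≤ N → grundyᴾ (segment lo L) ≡ mod3 L
  grundy-segment = <-rec _ λ L rec lo end≤N →
    grundyᴾ-≡ (segment lo L) (mod3 L) (segment-valid lo L) (segment-connected lo L end≤N)
      (avoid L rec lo end≤N) (reach L rec lo end≤N)
    where
    Shorter : ℕ → Set
    Shorter L = ∀ {L′} → L′ < L → ∀ lo → lo + L′ ≤ N → grundyᴾ (segment lo L′) ≡ mod3 L′

    avoid : ∀ L → Shorter L → ∀ lo → lo + L ≤ N → ∀ β → Move (segment lo L) β → grundyᴾ β ≢ mod3 L
    avoid L rec lo end≤N β mv e with segment-Move lo L β end≤N mv
    ... | shorter lo′ L′ _ end′≤end (inj₁ refl) β≡ =
      mod3-suc-≢ L′ (trans (sym e) (trans (grundyᴾ-cong β≡) (rec (n<1+n L′) lo′ (≤-trans end′≤end end≤N))))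
    ... | shorter lo′ L′ _ end′≤end (inj₂ refl) β≡ =
      mod3-2+-≢ L′ (trans (sym e) (trans (grundyᴾ-cong β≡) (rec (<-trans (n<1+n L′) (n<1+n _)) lo′ (≤-trans end′≤end end≤N))))

    reach : ∀ L → Shorter L → ∀ lo → lo + L ≤ N → ∀ j → j < mod3 L → ∃ λ β → Move (segment lo L) β × grundyᴾ β ≡ j
    reach L rec lo end≤N j j<v with mod3-options L j j<v
    ... | inj₁ (L′ , refl , v≡j) =
      segment lo L′ , take-last lo L′ end≤N , trans (rec (n<1+n L′) lo (≤-trans (+-monoʳ-≤ lo (n≤1+n L′)) end≤N)) v≡j
    ... | inj₂ (L′ , refl , v≡j) =
      segment lo L′ , take-last-two lo L′ end≤N ,
      trans (rec (<-trans (n<1+n L′) (n<1+n _)) lo (≤-trans (+-monoʳ-≤ lo (m≤n+m L′ 2)) end≤N)) v≡j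

-- Star positions

data ArmShape {k : ℕ} (r : Fin k → ℕ) : Set where
  no-arms  : (∀ i → r i ≡ 0) → ArmShape r
  some-arm : ∀ j → 1 ≤ r j → (∀ i → i ≢ j → r i ≡ 0) ⊎ (∃ λ i → i ≢ j × 1 ≤ r i) → ArmShape r

armShape : ∀ {k} (r : Fin k → ℕ) → ArmShape r
armShape {zero} r = no-arms λ ()
armShape {suc k} r with armShape (λ i → r (suc i)) | r zero in r₀
... | no-arms rest | zero = no-arms λ { zero → r₀ ; (suc i) → rest i }
... | no-arms rest | suc _ = some-arm zero (subst (1 ≤_) (sym r₀) (s≤s z≤n)) (inj₁ λ { zero ne → ⊥-elim (ne refl) ; (suc i) _ → rest i })
... | some-arm j pj (inj₁ rest) | zero = some-arm (suc j) pj (inj₁ λ { zero _ → r₀ ; (suc i) ne → rest i λ e → ne (cong suc e) })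
... | some-arm j pj (inj₁ rest) | suc _ = some-arm (suc j) pj (inj₂ (zero , (λ ()) , subst (1 ≤_) (sym r₀) (s≤s z≤n)))
... | some-arm j pj (inj₂ (i , i≢j , pi)) | _ = some-arm (suc j) pj (inj₂ (suc i , (λ e → i≢j (Fin-suc-injective e)) , pi))

LeavesNeedHub : Bool → Bool → Bool → Set
LeavesNeedHub x y z = x ≡ false → y ≡ false × z ≡ false

leaves-absent : LeavesNeedHub false false false
leaves-absent _ = refl , refl

hub′-present : ∀ {y z} → LeavesNeedHub true y z
hub′-present ()

module _ {k : ℕ} where

  -- starPos r x y z holds the hub, the first r i vertices of each arm i, and hub′, leaf₁, leaf₂ as
  -- flagged by x, y, z; thus starOnly r is the star S with arms r and linked r is S -1- S_{1,1}.
  starPos : (Fin k → ℕ) → Bool → Bool → Bool → Site k → Bool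
  starPos r x y z hub = true
  starPos r x y z (arm i p) = p <ᵇ r i
  starPos r x y z hub′ = x
  starPos r x y z leaf₁ = y
  starPos r x y z leaf₂ = z
  starPos r x y z outside = false

  setArm : (Fin k → ℕ) → Fin k → ℕ → Fin k → ℕ
  setArm r i v i′ = if (i′ ==F i) then v else r i′

  setArm-same : ∀ r i v → setArm r i v i ≡ v
  setArm-same r i v rewrite ==F-refl i = refl

  setArm-other : ∀ r i v i′ → i′ ≢ i → setArm r i v i′ ≡ r i′
  setArm-other r i v i′ ne rewrite ≢⇒==F-false i′ i ne = refl

  setArm-≤ : ∀ r i v → v ≤ r i → ∀ i′ → setArm r i v i′ ≤ r i′
  setArm-≤ r i v le i′ with i′ ≟F i
  ... | yes refl rewrite setArm-same r i v = le
  ... | no ne rewrite setArm-other r i v i′ ne = ≤-refl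

  data OthersShape (r : Fin k → ℕ) (i : Fin k) : Set where
    none-other : (∀ j → j ≢ i → r j ≡ 0) → OthersShape r i
    some-other : ∀ j → j ≢ i → 1 ≤ r j →
                 (∀ j′ → j′ ≢ i → j′ ≢ j → r j′ ≡ 0) ⊎ (∃ λ j′ → j′ ≢ i × j′ ≢ j × 1 ≤ r j′) → OthersShape r i

  othersShape : ∀ r i → OthersShape r i
  othersShape r i with armShape (setArm r i 0)
  ... | no-arms rest = none-other λ j j≢i → trans (sym (setArm-other r i 0 j j≢i)) (rest j)
  ... | some-arm j pj more =
    some-other j (cleared j pj) (subst (1 ≤_) (setArm-other r i 0 j (cleared j pj)) pj) (Data.Sum.map only another more)
    where
    cleared : ∀ j → 1 ≤ setArm r i 0 j → j ≢ i
    cleared j pj refl = <⇒≱ pj (≤-reflexive (setArm-same r j 0))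
    only : (∀ j′ → j′ ≢ j → setArm r i 0 j′ ≡ 0) → ∀ j′ → j′ ≢ i → j′ ≢ j → r j′ ≡ 0
    only rest j′ j′≢i j′≢j = trans (sym (setArm-other r i 0 j′ j′≢i)) (rest j′ j′≢j)
    another : (∃ λ j′ → j′ ≢ j × 1 ≤ setArm r i 0 j′) → ∃ λ j′ → j′ ≢ i × j′ ≢ j × 1 ≤ r j′
    another (j′ , j′≢j , pj′) = j′ , cleared j′ pj′ , j′≢j , subst (1 ≤_) (setArm-other r i 0 j′ (cleared j′ pj′)) pj′

  starOnly linked linked-leaf₁ linked-leaf₂ : (Fin k → ℕ) → Site k → Bool
  starOnly r = starPos r false false false
  linked r = starPos r true true true
  linked-leaf₁ r = starPos r true false true
  linked-leaf₂ r = starPos r true true false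

  walk-arm : ∀ r x y z i q → q < r i → Walk (starPos r x y z) hub (arm i q)
  walk-arm r x y z i zero lt = walk-edge refl (<⇒<ᵇ-true 0 (r i) lt) refl
  walk-arm r x y z i (suc q) lt =
    extend (walk-arm r x y z i q (<-trans (n<1+n q) lt)) (edge-arm-step i q) (<⇒<ᵇ-true (suc q) (r i) lt)

  starPos-connected : ∀ r x y z → LeavesNeedHub x y z → Connected (starPos r x y z)
  starPos-connected r x y z leaves-ok = connected-via-hub _ hub reach
    where
    reach : ∀ w → starPos r x y z w ≡ true → Walk (starPos r x y z) hub w
    reach hub e = start refl
    reach hub′ e = walk-edge refl e refl
    reach leaf₁ e with true⊎false x
    ... | inj₁ x≡true = extend {y = hub′} (walk-edge refl x≡true refl) refl e
    ... | inj₂ x≡false = ⊥-elim (true≢false e (proj₁ (leaves-ok x≡false)))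
    reach leaf₂ e with true⊎false x
    ... | inj₁ x≡true = extend {y = hub′} (walk-edge refl x≡true refl) refl e
    ... | inj₂ x≡false = ⊥-elim (true≢false e (proj₂ (leaves-ok x≡false)))
    reach (arm i p) e = walk-arm r x y z i p (<ᵇ-true⇒< p (r i) e)
    reach outside ()

  arm-neighbour : ∀ (i : Fin k) q (w : Site k) → edge (arm i q) w ≡ true →
                  (q ≡ 0 × w ≡ hub) ⊎ (∃ λ q′ → w ≡ arm i q′ × (q′ ≡ suc q ⊎ q ≡ suc q′))
  arm-neighbour i zero hub e = inj₁ (refl , refl)
  arm-neighbour i q (arm j q′) e with edge-arm⇒ i q j q′ e
  ... | refl , adjacent = inj₂ (q′ , refl , adjacent)
  arm-neighbour i (suc q) hub ()
  arm-neighbour i q hub′ ()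
  arm-neighbour i q leaf₁ ()
  arm-neighbour i q leaf₂ ()
  arm-neighbour i q outside ()

  arm-gap⇒disconnected : ∀ (γ : Site k → Bool) i m → γ (arm i m) ≡ false → γ (arm i (suc m)) ≡ true → γ hub ≡ true →
                         ¬ Connected γ
  arm-gap⇒disconnected γ i m gap beyond γhub =
    closed-split⇒disconnected γ Beyond (arm i (suc m)) hub closed (suc m , refl , n<1+n m) (λ { (q , () , _) }) beyond γhub
    where
    Beyond : Site k → Set
    Beyond w = ∃ λ q → w ≡ arm i q × m < q
    closed : Closed γ Beyond
    closed .(arm i q) w (q , refl , m<q) γw e with arm-neighbour i q w e
    ... | inj₁ (refl , _) = ⊥-elim (<⇒≱ m<q z≤n)
    ... | inj₂ (q′ , w≡ , inj₁ q′≡1+q) = q′ , w≡ , subst (m <_) (sym q′≡1+q) (<-trans m<q (n<1+n q))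
    ... | inj₂ (q′ , w≡ , inj₂ q≡1+q′) =
      q′ , w≡ , ≤∧≢⇒< (≤-pred (subst (m <_) q≡1+q′ m<q))
                  λ m≡q′ → true≢false (subst (λ v → γ v ≡ true) w≡ γw) (subst (λ t → γ (arm i t) ≡ false) m≡q′ gap)

  arms-split⇒disconnected : ∀ (γ : Site k → Bool) i p y → γ hub ≡ false → γ (arm i p) ≡ true → γ y ≡ true →
                            (∀ q → y ≢ arm i q) → ¬ Connected γ
  arms-split⇒disconnected γ i p y no-hub γx γy y∉arm =
    closed-split⇒disconnected γ OnArm (arm i p) y closed (p , refl) (λ { (q , e) → y∉arm q e }) γx γy
    where
    OnArm : Site k → Set
    OnArm w = ∃ λ q → w ≡ arm i q
    closed : Closed γ OnArm
    closed .(arm i q) w (q , refl) γw e with arm-neighbour i q w e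
    ... | inj₁ (_ , w≡hub) = ⊥-elim (true≢false (subst (λ v → γ v ≡ true) w≡hub γw) no-hub)
    ... | inj₂ (q′ , w≡ , _) = q′ , w≡

  Leaf : Site k → Set
  Leaf w = ∀ y → edge w y ≡ true → y ≡ hub′

  leaf₁-leaf : Leaf leaf₁
  leaf₁-leaf hub′ e = refl
  leaf₁-leaf hub ()
  leaf₁-leaf leaf₁ ()
  leaf₁-leaf leaf₂ ()
  leaf₁-leaf outside ()
  leaf₁-leaf (arm i p) ()

  leaf₂-leaf : Leaf leaf₂
  leaf₂-leaf hub′ e = refl
  leaf₂-leaf hub ()
  leaf₂-leaf leaf₁ ()
  leaf₂-leaf leaf₂ ()
  leaf₂-leaf outside ()
  leaf₂-leaf (arm i p) ()

  isolated-leaf⇒disconnected : ∀ (γ : Site k → Bool) w y → Leaf w → γ hub′ ≡ false → γ w ≡ true →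
                               γ y ≡ true → y ≢ w → ¬ Connected γ
  isolated-leaf⇒disconnected γ w y lf gc gw gy ne = closed-split⇒disconnected γ (λ v → v ≡ w) w y cl refl ne gw gy
    where
    cl : Closed γ (λ v → v ≡ w)
    cl .w y′ refl gy′ ed with lf y′ ed
    ... | refl = ⊥-elim (true≢false gy′ gc)

  delete-arm-end : ∀ r x y z i p → suc p ≡ r i → ∀ w → delete₁ (starPos r x y z) (arm i p) w ≡ starPos (setArm r i p) x y z w
  delete-arm-end r x y z i p e hub = refl
  delete-arm-end r x y z i p e hub′ = ∧-identityʳ x
  delete-arm-end r x y z i p e leaf₁ = ∧-identityʳ y
  delete-arm-end r x y z i p e leaf₂ = ∧-identityʳ z
  delete-arm-end r x y z i p e outside = refl
  delete-arm-end r x y z i p e (arm i′ q) with i′ ≟F i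
  ... | yes refl rewrite arm-==ₛ-same i q p | setArm-same r i p | sym e = inRange-drop-last 0 p q
  ... | no ne rewrite arm-==ₛ-apart i i′ q p ne | setArm-other r i p i′ ne = ∧-identityʳ _

  delete-arm-end-two : ∀ r x y z i p → suc (suc p) ≡ r i → ∀ w →
                       delete₂ (starPos r x y z) (arm i p) (arm i (suc p)) w ≡ starPos (setArm r i p) x y z w
  delete-arm-end-two r x y z i p e hub = refl
  delete-arm-end-two r x y z i p e hub′ = ∧-identityʳ x
  delete-arm-end-two r x y z i p e leaf₁ = ∧-identityʳ y
  delete-arm-end-two r x y z i p e leaf₂ = ∧-identityʳ z
  delete-arm-end-two r x y z i p e outside = refl
  delete-arm-end-two r x y z i p e (arm i′ q) with i′ ≟F i
  ... | yes refl rewrite arm-==ₛ-same i q p | arm-==ₛ-same i q (suc p) | setArm-same r i p | sym e = inRange-drop-last-two 0 p q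
  ... | no ne rewrite arm-==ₛ-apart i i′ q p ne | arm-==ₛ-apart i i′ q (suc p) ne | setArm-other r i p i′ ne = ∧-identityʳ _

  take-arm-end : ∀ r x y z i p → LeavesNeedHub x y z → suc p ≡ r i → Move (starPos r x y z) (starPos (setArm r i p) x y z)
  take-arm-end r x y z i p leaves-ok e = take₁ (arm i p) (<⇒<ᵇ-true p (r i) (subst (p <_) e (n<1+n p)))
    (connected-cong (λ w → sym (delete-arm-end r x y z i p e w)) (starPos-connected (setArm r i p) x y z leaves-ok))
    (λ w → sym (delete-arm-end r x y z i p e w))

  take-arm-end-two : ∀ r x y z i p → LeavesNeedHub x y z → suc (suc p) ≡ r i →
                     Move (starPos r x y z) (starPos (setArm r i p) x y z)
  take-arm-end-two r x y z i p leaves-ok e = take₂ (arm i p) (arm i (suc p))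
    (<⇒<ᵇ-true p (r i) (subst (p <_) e (<-trans (n<1+n p) (n<1+n _))))
    (<⇒<ᵇ-true (suc p) (r i) (subst (suc p <_) e (n<1+n _)))
    (edge-arm-step i p)
    (connected-cong (λ w → sym (delete-arm-end-two r x y z i p e w)) (starPos-connected (setArm r i p) x y z leaves-ok))
    (λ w → sym (delete-arm-end-two r x y z i p e w))

  take-arm⇒end : ∀ r x y z i p → (p <ᵇ r i) ≡ true → Connected (delete₁ (starPos r x y z) (arm i p)) → suc p ≡ r i
  take-arm⇒end r x y z i p present c with m≤n⇒m<n∨m≡n (<ᵇ-true⇒< p (r i) present)
  ... | inj₂ end = end
  ... | inj₁ inner = ⊥-elim (arm-gap⇒disconnected _ i p (delete₁-removes (starPos r x y z) (arm i p)) beyond refl c)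
    where
    beyond = delete₁-keeps (starPos r x y z) (arm i p) (arm i (suc p)) (<⇒<ᵇ-true (suc p) (r i) inner)
               (trans (arm-==ₛ-same i (suc p) p) (≢⇒≡ᵇ-false (suc p) p 1+n≢n))

  take-arm-two⇒end : ∀ r x y z i p → (suc p <ᵇ r i) ≡ true → Connected (delete₂ (starPos r x y z) (arm i p) (arm i (suc p))) →
                     suc (suc p) ≡ r i
  take-arm-two⇒end r x y z i p present c with m≤n⇒m<n∨m≡n (<ᵇ-true⇒< (suc p) (r i) present)
  ... | inj₂ end = end
  ... | inj₁ inner = ⊥-elim (arm-gap⇒disconnected _ i (suc p) (delete₂-removes-second (starPos r x y z) (arm i p) (arm i (suc p))) beyond refl c)
    where
    beyond = delete₂-keeps (starPos r x y z) (arm i p) (arm i (suc p)) (arm i (suc (suc p))) (<⇒<ᵇ-true (suc (suc p)) (r i) inner)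
               (trans (arm-==ₛ-same i (suc (suc p)) p) (≢⇒≡ᵇ-false (suc (suc p)) p (≢-sym (<⇒≢ (<-trans (n<1+n p) (n<1+n (suc p)))))))
               (trans (arm-==ₛ-same i (suc (suc p)) (suc p)) (≢⇒≡ᵇ-false (suc (suc p)) (suc p) 1+n≢n))

  data StarOnlyMove (r : Fin k → ℕ) (β : Site k → Bool) : Set where
    shrink : ∀ r′ → (∀ z → β z ≡ starOnly r′ z) → Move (starOnly r) (starOnly r′) →
             Move (linked r) (linked r′) → (∀ i → r′ i ≤ r i) → StarOnlyMove r β
    hub-alone : (∀ i → r i ≡ 0) → (∀ z → β z ≡ delete₁ (starOnly r) hub z) → StarOnlyMove r β
    hub-of-one-arm : ∀ j L → r j ≡ suc L → (∀ i → i ≢ j → r i ≡ 0) → (∀ z → β z ≡ delete₁ (starOnly r) hub z) → StarOnlyMove r β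
    hub-and-arm-start : ∀ j L → r j ≡ suc L → (∀ i → i ≢ j → r i ≡ 0) → (∀ z →
                        β z ≡ delete₂ (starOnly r) hub (arm j 0) z) → StarOnlyMove r β
    hub-and-unit-arm : ∀ i j L → i ≢ j → r i ≡ 1 → r j ≡ suc L → (∀ i′ → i′ ≢ i → i′ ≢ j → r i′ ≡ 0) →
           (∀ z → β z ≡ delete₂ (starOnly r) hub (arm i 0) z) → StarOnlyMove r β

  shrink₁ : ∀ r β i p → suc p ≡ r i → (∀ z → β z ≡ delete₁ (starOnly r) (arm i p) z) → StarOnlyMove r β
  shrink₁ r β i p e h = shrink (setArm r i p) (λ z → trans (h z) (delete-arm-end r false false false i p e z))
    (take-arm-end r false false false i p leaves-absent e) (take-arm-end r true true true i p hub′-present e) (setArm-≤ r i p (suc≡⇒≤ e))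

  shrink₂ : ∀ r β i p → suc (suc p) ≡ r i → (∀ z → β z ≡ delete₂ (starOnly r) (arm i p) (arm i (suc p)) z) → StarOnlyMove r β
  shrink₂ r β i p e h = shrink (setArm r i p) (λ z → trans (h z) (delete-arm-end-two r false false false i p e z))
    (take-arm-end-two r false false false i p leaves-absent e) (take-arm-end-two r true true true i p hub′-present e) (setArm-≤ r i p (2+≡⇒≤ e))

  starOnly-hub-arm : ∀ r β i → (0 <ᵇ r i) ≡ true → Connected (delete₂ (starOnly r) hub (arm i 0)) →
                     (∀ z → β z ≡ delete₂ (starOnly r) hub (arm i 0) z) → StarOnlyMove r β
  starOnly-hub-arm r β i pi c h with othersShape r i | r i in rᵢ
  ... | _ | zero = ⊥-elim (true≢false pi refl)
  ... | none-other rest | suc L = hub-and-arm-start i L rᵢ rest h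
  ... | some-other j j≢i pj (inj₂ (j′ , j′≢i , j′≢j , pj′)) | suc _ =
    ⊥-elim (arms-split⇒disconnected _ j 0 (arm j′ 0) refl
              (delete₂-keeps (starOnly r) hub (arm i 0) (arm j 0) (<⇒<ᵇ-true 0 (r j) pj) refl (arm-==ₛ-apart i j 0 0 j≢i))
              (delete₂-keeps (starOnly r) hub (arm i 0) (arm j′ 0) (<⇒<ᵇ-true 0 (r j′) pj′) refl (arm-==ₛ-apart i j′ 0 0 j′≢i))
              (λ q e → j′≢j (arm-injectiveˡ e)) c)
  ... | some-other j j≢i pj (inj₁ rest) | suc zero = let (L , rⱼ) = positive⇒suc pj in hub-and-unit-arm i j L (≢-sym j≢i) rᵢ rⱼ rest h
  ... | some-other j j≢i pj (inj₁ _) | suc (suc _) =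
    ⊥-elim (arms-split⇒disconnected _ i 1 (arm j 0) refl
              (delete₂-keeps (starOnly r) hub (arm i 0) (arm i 1) (<⇒<ᵇ-true 1 (r i) (subst (1 <_) (sym rᵢ) (s≤s (s≤s z≤n)))) refl (arm-==ₛ-same i 1 0))
              (delete₂-keeps (starOnly r) hub (arm i 0) (arm j 0) (<⇒<ᵇ-true 0 (r j) pj) refl (arm-==ₛ-apart i j 0 0 j≢i))
              (λ q e → j≢i (arm-injectiveˡ e)) c)

  classify-starOnly : ∀ r β → Move (starOnly r) β → StarOnlyMove r β
  classify-starOnly r β (take₁ hub pa c h) with armShape r
  ... | no-arms rest = hub-alone rest h
  ... | some-arm j pj (inj₁ rest) = let (L , rⱼ) = positive⇒suc pj in hub-of-one-arm j L rⱼ rest h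
  ... | some-arm j pj (inj₂ (i , i≢j , pi)) =
    ⊥-elim (arms-split⇒disconnected (delete₁ (starOnly r) hub) i 0 (arm j 0) refl
              (delete₁-keeps (starOnly r) hub (arm i 0) (<⇒<ᵇ-true 0 (r i) pi) refl)
              (delete₁-keeps (starOnly r) hub (arm j 0) (<⇒<ᵇ-true 0 (r j) pj) refl)
              (λ q e → i≢j (sym (arm-injectiveˡ e))) c)
  classify-starOnly r β (take₁ (arm i p) pa c h) = shrink₁ r β i p (take-arm⇒end r false false false i p pa c) h
  classify-starOnly r β (take₁ hub′ () c h)
  classify-starOnly r β (take₁ leaf₁ () c h)
  classify-starOnly r β (take₁ leaf₂ () c h)
  classify-starOnly r β (take₁ outside () c h)
  classify-starOnly r β (take₂ a b pa pb e c h) with take₂⇒parent-child a b pa pb e c h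
  ... | parent-child (hub-arm i) _ pi c′ h′ = starOnly-hub-arm r β i pi c′ h′
  ... | parent-child (arm-arm i p) _ pp c′ h′ = shrink₂ r β i p (take-arm-two⇒end r false false false i p pp c′) h′
  ... | parent-child hub-hub′ _ () _ _
  ... | parent-child hub′-leaf₁ () _ _ _
  ... | parent-child hub′-leaf₂ () _ _ _

  data LinkedMove (r : Fin k → ℕ) (β : Site k → Bool) : Set where
    shrink : ∀ r′ → (∀ z → β z ≡ linked r′ z) → Move (starOnly r) (starOnly r′) → (∀ i → r′ i ≤ r i) → LinkedMove r β
    drop-leaf₁ : (∀ z → β z ≡ linked-leaf₁ r z) → LinkedMove r β
    drop-leaf₂ : (∀ z → β z ≡ linked-leaf₂ r z) → LinkedMove r β
    hub-bare : (∀ i → r i ≡ 0) → (∀ z → β z ≡ delete₁ (linked r) hub z) → LinkedMove r β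
    hub-unit-arm : ∀ i → r i ≡ 1 → (∀ i′ → i′ ≢ i → r i′ ≡ 0) → (∀ z → β z ≡ delete₂ (linked r) hub (arm i 0) z) → LinkedMove r β

  delete-leaf₁ : ∀ r w → delete₁ (linked r) leaf₁ w ≡ linked-leaf₁ r w
  delete-leaf₁ r hub = refl
  delete-leaf₁ r (arm i p) = ∧-identityʳ _
  delete-leaf₁ r hub′ = refl
  delete-leaf₁ r leaf₁ = refl
  delete-leaf₁ r leaf₂ = refl
  delete-leaf₁ r outside = refl

  delete-leaf₂ : ∀ r w → delete₁ (linked r) leaf₂ w ≡ linked-leaf₂ r w
  delete-leaf₂ r hub = refl
  delete-leaf₂ r (arm i p) = ∧-identityʳ _
  delete-leaf₂ r hub′ = refl
  delete-leaf₂ r leaf₁ = refl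
  delete-leaf₂ r leaf₂ = refl
  delete-leaf₂ r outside = refl

  shrink₁′ : ∀ r β i p → suc p ≡ r i → (∀ z → β z ≡ delete₁ (linked r) (arm i p) z) → LinkedMove r β
  shrink₁′ r β i p e h = shrink (setArm r i p) (λ z → trans (h z) (delete-arm-end r true true true i p e z))
    (take-arm-end r false false false i p leaves-absent e) (setArm-≤ r i p (suc≡⇒≤ e))

  shrink₂′ : ∀ r β i p → suc (suc p) ≡ r i → (∀ z → β z ≡ delete₂ (linked r) (arm i p) (arm i (suc p)) z) → LinkedMove r β
  shrink₂′ r β i p e h = shrink (setArm r i p) (λ z → trans (h z) (delete-arm-end-two r true true true i p e z))
    (take-arm-end-two r false false false i p leaves-absent e) (setArm-≤ r i p (2+≡⇒≤ e))

  linked-hub-arm : ∀ r β i → (0 <ᵇ r i) ≡ true → Connected (delete₂ (linked r) hub (arm i 0)) →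
                   (∀ z → β z ≡ delete₂ (linked r) hub (arm i 0) z) → LinkedMove r β
  linked-hub-arm r β i pi c h with othersShape r i | r i in rᵢ
  ... | _ | zero = ⊥-elim (true≢false pi refl)
  ... | none-other rest | suc zero = hub-unit-arm i rᵢ rest h
  ... | some-other j j≢i pj _ | suc zero =
    ⊥-elim (arms-split⇒disconnected _ j 0 hub′ refl
              (delete₂-keeps (linked r) hub (arm i 0) (arm j 0) (<⇒<ᵇ-true 0 (r j) pj) refl (arm-==ₛ-apart i j 0 0 j≢i))
              refl (λ q ()) c)
  ... | _ | suc (suc _) =
    ⊥-elim (arms-split⇒disconnected _ i 1 hub′ refl
              (delete₂-keeps (linked r) hub (arm i 0) (arm i 1) (<⇒<ᵇ-true 1 (r i) (subst (1 <_) (sym rᵢ) (s≤s (s≤s z≤n)))) refl (arm-==ₛ-same i 1 0))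
              refl (λ q ()) c)

  classify-linked : ∀ r β → Move (linked r) β → LinkedMove r β
  classify-linked r β (take₁ hub pa c h) with armShape r
  ... | no-arms rest = hub-bare rest h
  ... | some-arm j pj _ =
    ⊥-elim (arms-split⇒disconnected (delete₁ (linked r) hub) j 0 hub′ refl
              (delete₁-keeps (linked r) hub (arm j 0) (<⇒<ᵇ-true 0 (r j) pj) refl) refl (λ q ()) c)
  classify-linked r β (take₁ hub′ pa c h) = ⊥-elim (isolated-leaf⇒disconnected (delete₁ (linked r) hub′) leaf₁ hub leaf₁-leaf refl refl refl (λ ()) c)
  classify-linked r β (take₁ leaf₁ pa c h) = drop-leaf₁ (λ z → trans (h z) (delete-leaf₁ r z))
  classify-linked r β (take₁ leaf₂ pa c h) = drop-leaf₂ (λ z → trans (h z) (delete-leaf₂ r z))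
  classify-linked r β (take₁ (arm i p) pa c h) = shrink₁′ r β i p (take-arm⇒end r true true true i p pa c) h
  classify-linked r β (take₁ outside () c h)
  classify-linked r β (take₂ a b pa pb e c h) with take₂⇒parent-child a b pa pb e c h
  ... | parent-child (hub-arm i) _ pi c′ h′ = linked-hub-arm r β i pi c′ h′
  ... | parent-child (arm-arm i p) _ pp c′ h′ = shrink₂′ r β i p (take-arm-two⇒end r true true true i p pp c′) h′
  ... | parent-child hub-hub′ _ _ c′ _ = ⊥-elim (isolated-leaf⇒disconnected (delete₂ (linked r) hub hub′) leaf₁ leaf₂ leaf₁-leaf
                                            (delete₂-removes-second (linked r) hub hub′) refl refl (λ ()) c′)
  ... | parent-child hub′-leaf₁ _ _ c′ _ = ⊥-elim (isolated-leaf⇒disconnected (delete₂ (linked r) hub′ leaf₁) leaf₂ hub leaf₂-leaf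
                                              (delete₂-removes-first (linked r) hub′ leaf₁) refl refl (λ ()) c′)
  ... | parent-child hub′-leaf₂ _ _ c′ _ = ⊥-elim (isolated-leaf⇒disconnected (delete₂ (linked r) hub′ leaf₂) leaf₁ hub leaf₁-leaf
                                              (delete₂-removes-first (linked r) hub′ leaf₂) refl refl (λ ()) c′)

-- Paths inside the star

module _ {k : ℕ} (l : Fin k → ℕ) where

  validIn : Site k → Bool
  validIn hub = true
  validIn hub′ = true
  validIn leaf₁ = true
  validIn leaf₂ = true
  validIn outside = false
  validIn (arm i p) = p <ᵇ l i

  module ThroughArm (j : Fin k) where
    π : ℕ → Site k
    π 0 = leaf₂
    π 1 = hub′
    π 2 = hub
    π (suc (suc (suc p))) = arm j p

    N : ℕ
    N = 3 + l j

    index : Site k → Maybe ℕ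
    index leaf₂ = just 0
    index hub′ = just 1
    index hub = just 2
    index leaf₁ = nothing
    index outside = nothing
    index (arm i p) = if (i ==F j) ∧ (p <ᵇ l j) then just (3 + p) else nothing

    index-π : ∀ p → p < N → index (π p) ≡ just p
    index-π 0 _ = refl
    index-π 1 _ = refl
    index-π 2 _ = refl
    index-π (suc (suc (suc p))) (s≤s (s≤s (s≤s lt))) rewrite ==F-refl j | <⇒<ᵇ-true p (l j) lt = refl

    index-arm : ∀ i p q → index (arm i p) ≡ just q → (i ≡ j) × (p < l j) × (q ≡ 3 + p)
    index-arm i p q e with true⊎false ((i ==F j)) | true⊎false (p <ᵇ l j)
    ... | inj₁ a | inj₁ b rewrite a | b = ==F⇒≡ i j a , <ᵇ-true⇒< p (l j) b , sym (just-injective e)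
    ... | inj₁ a | inj₂ b rewrite a | b with e
    ... | ()
    index-arm i p q e | inj₂ a | _ rewrite a with e
    ... | ()

    π-index : ∀ a p → index a ≡ just p → π p ≡ a
    π-index leaf₂ .0 refl = refl
    π-index hub′ .1 refl = refl
    π-index hub .2 refl = refl
    π-index (arm i p) q e with index-arm i p q e
    ... | refl , _ , refl = refl

    index-< : ∀ a p → index a ≡ just p → p < N
    index-< leaf₂ .0 refl = s≤s z≤n
    index-< hub′ .1 refl = s≤s (s≤s z≤n)
    index-< hub .2 refl = s≤s (s≤s (s≤s z≤n))
    index-< (arm i p) q e with index-arm i p q e
    ... | refl , lt , refl = s≤s (s≤s (s≤s lt))

    edge⇒consecutive : ∀ p q → p < N → q < N → edge (π p) (π q) ≡ true → q ≡ suc p ⊎ p ≡ suc q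
    edge⇒consecutive 0 1 _ _ _ = inj₁ refl
    edge⇒consecutive 1 0 _ _ _ = inj₂ refl
    edge⇒consecutive 1 2 _ _ _ = inj₁ refl
    edge⇒consecutive 2 1 _ _ _ = inj₂ refl
    edge⇒consecutive 2 (suc (suc (suc zero))) _ _ _ = inj₁ refl
    edge⇒consecutive (suc (suc (suc zero))) 2 _ _ _ = inj₂ refl
    edge⇒consecutive (suc (suc (suc p))) (suc (suc (suc q))) _ _ e with edge-arm⇒ j p j q e
    ... | _ , inj₁ refl = inj₁ refl
    ... | _ , inj₂ refl = inj₂ refl
    edge⇒consecutive 0 0 _ _ ()
    edge⇒consecutive 0 2 _ _ ()
    edge⇒consecutive 0 (suc (suc (suc q))) _ _ ()
    edge⇒consecutive 1 1 _ _ ()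
    edge⇒consecutive 1 (suc (suc (suc q))) _ _ ()
    edge⇒consecutive 2 0 _ _ ()
    edge⇒consecutive 2 2 _ _ ()
    edge⇒consecutive 2 (suc (suc (suc (suc q)))) _ _ ()
    edge⇒consecutive (suc (suc (suc zero))) 0 _ _ ()
    edge⇒consecutive (suc (suc (suc (suc p)))) 0 _ _ ()
    edge⇒consecutive (suc (suc (suc zero))) 1 _ _ ()
    edge⇒consecutive (suc (suc (suc (suc p)))) 1 _ _ ()
    edge⇒consecutive (suc (suc (suc (suc p)))) 2 _ _ ()

    consecutive-edge : ∀ p → suc p < N → edge (π p) (π (suc p)) ≡ true
    consecutive-edge 0 _ = refl
    consecutive-edge 1 _ = refl
    consecutive-edge 2 _ = refl
    consecutive-edge (suc (suc (suc p))) _ = edge-arm-step j p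

    π-valid : ∀ p → p < N → validIn (π p) ≡ true
    π-valid 0 _ = refl
    π-valid 1 _ = refl
    π-valid 2 _ = refl
    π-valid (suc (suc (suc p))) (s≤s (s≤s (s≤s lt))) = <⇒<ᵇ-true p (l j) lt

  module Cherry where
    π : ℕ → Site k
    π 0 = leaf₁
    π 1 = hub′
    π _ = leaf₂

    N : ℕ
    N = 3

    index : Site k → Maybe ℕ
    index leaf₁ = just 0
    index hub′ = just 1
    index leaf₂ = just 2
    index _ = nothing

    index-π : ∀ p → p < N → index (π p) ≡ just p
    index-π 0 _ = refl
    index-π 1 _ = refl
    index-π 2 _ = refl
    index-π (suc (suc (suc p))) (s≤s (s≤s (s≤s ())))

    π-index : ∀ a p → index a ≡ just p → π p ≡ a
    π-index leaf₁ .0 refl = refl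
    π-index hub′ .1 refl = refl
    π-index leaf₂ .2 refl = refl
    π-index hub p ()
    π-index outside p ()
    π-index (arm i q) p ()

    index-< : ∀ a p → index a ≡ just p → p < N
    index-< leaf₁ .0 refl = s≤s z≤n
    index-< hub′ .1 refl = s≤s (s≤s z≤n)
    index-< leaf₂ .2 refl = s≤s (s≤s (s≤s z≤n))
    index-< hub p ()
    index-< outside p ()
    index-< (arm i q) p ()

    edge⇒consecutive : ∀ p q → p < N → q < N → edge (π p) (π q) ≡ true → q ≡ suc p ⊎ p ≡ suc q
    edge⇒consecutive 0 1 _ _ _ = inj₁ refl
    edge⇒consecutive 1 0 _ _ _ = inj₂ refl
    edge⇒consecutive 1 2 _ _ _ = inj₁ refl
    edge⇒consecutive 2 1 _ _ _ = inj₂ refl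
    edge⇒consecutive 0 0 _ _ ()
    edge⇒consecutive 0 2 _ _ ()
    edge⇒consecutive 1 1 _ _ ()
    edge⇒consecutive 2 0 _ _ ()
    edge⇒consecutive 2 2 _ _ ()
    edge⇒consecutive (suc (suc (suc p))) q (s≤s (s≤s (s≤s ()))) _ _
    edge⇒consecutive p (suc (suc (suc q))) _ (s≤s (s≤s (s≤s ()))) _

    consecutive-edge : ∀ p → suc p < N → edge (π p) (π (suc p)) ≡ true
    consecutive-edge 0 _ = refl
    consecutive-edge 1 _ = refl
    consecutive-edge (suc (suc p)) (s≤s (s≤s (s≤s ())))

    π-valid : ∀ p → p < N → validIn (π p) ≡ true
    π-valid 0 _ = refl
    π-valid 1 _ = refl
    π-valid (suc (suc p)) _ = refl

  module HubAlone where
    π : ℕ → Site k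
    π _ = hub

    N : ℕ
    N = 1

    index : Site k → Maybe ℕ
    index hub = just 0
    index _ = nothing

    index-π : ∀ p → p < N → index (π p) ≡ just p
    index-π 0 _ = refl
    index-π (suc p) (s≤s ())

    π-index : ∀ a p → index a ≡ just p → π p ≡ a
    π-index hub .0 refl = refl
    π-index hub′ p ()
    π-index leaf₁ p ()
    π-index leaf₂ p ()
    π-index outside p ()
    π-index (arm i q) p ()

    index-< : ∀ a p → index a ≡ just p → p < N
    index-< hub .0 refl = s≤s z≤n
    index-< hub′ p ()
    index-< leaf₁ p ()
    index-< leaf₂ p ()
    index-< outside p ()
    index-< (arm i q) p ()

    edge⇒consecutive : ∀ p q → p < N → q < N → edge (π p) (π q) ≡ true → q ≡ suc p ⊎ p ≡ suc q
    edge⇒consecutive p q _ _ ()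

    consecutive-edge : ∀ p → suc p < N → edge (π p) (π (suc p)) ≡ true
    consecutive-edge p (s≤s ())

    π-valid : ∀ p → p < N → validIn (π p) ≡ true
    π-valid p _ = refl

  module AcrossHub (i j : Fin k) (i≢j : i ≢ j) (lᵢ>0 : 0 < l i) where
    π : ℕ → Site k
    π 0 = arm i 0
    π 1 = hub
    π (suc (suc p)) = arm j p

    N : ℕ
    N = 2 + l j

    index : Site k → Maybe ℕ
    index hub = just 1
    index (arm i′ p) = if (i′ ==F i) ∧ (p ≡ᵇ 0) then just 0 else (if (i′ ==F j) ∧ (p <ᵇ l j) then just (2 + p) else nothing)
    index _ = nothing

    index-π : ∀ p → p < N → index (π p) ≡ just p
    index-π 0 _ rewrite ==F-refl i = refl
    index-π 1 _ = refl
    index-π (suc (suc p)) (s≤s (s≤s lt)) rewrite ≢⇒==F-false j i (λ e → i≢j (sym e)) | ==F-refl j | <⇒<ᵇ-true p (l j) lt = refl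

    index-arm : ∀ i′ p q → index (arm i′ p) ≡ just q → (i′ ≡ i × p ≡ 0 × q ≡ 0) ⊎ (i′ ≡ j × p < l j × q ≡ 2 + p)
    index-arm i′ p q e with true⊎false ((i′ ==F i) ∧ (p ≡ᵇ 0))
    ... | inj₁ a rewrite a = inj₁ (==F⇒≡ i′ i (∧-elimˡ a) , ≡ᵇ-true⇒≡ p 0 (∧-elimʳ {i′ ==F i} a) , sym (just-injective e))
    ... | inj₂ a rewrite a with true⊎false ((i′ ==F j) ∧ (p <ᵇ l j))
    ... | inj₁ b rewrite b = inj₂ (==F⇒≡ i′ j (∧-elimˡ b) , <ᵇ-true⇒< p (l j) (∧-elimʳ {i′ ==F j} b) , sym (just-injective e))
    ... | inj₂ b rewrite b with e
    ... | ()

    π-index : ∀ a p → index a ≡ just p → π p ≡ a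
    π-index hub .1 refl = refl
    π-index (arm i′ p) q e with index-arm i′ p q e
    ... | inj₁ (refl , refl , refl) = refl
    ... | inj₂ (refl , _ , refl) = refl
    π-index hub′ p ()
    π-index leaf₁ p ()
    π-index leaf₂ p ()
    π-index outside p ()

    index-< : ∀ a p → index a ≡ just p → p < N
    index-< hub .1 refl = s≤s (s≤s z≤n)
    index-< (arm i′ p) q e with index-arm i′ p q e
    ... | inj₁ (refl , refl , refl) = s≤s z≤n
    ... | inj₂ (refl , lt , refl) = s≤s (s≤s lt)
    index-< hub′ p ()
    index-< leaf₁ p ()
    index-< leaf₂ p ()
    index-< outside p ()

    edge⇒consecutive : ∀ p q → p < N → q < N → edge (π p) (π q) ≡ true → q ≡ suc p ⊎ p ≡ suc q
    edge⇒consecutive 0 1 _ _ _ = inj₁ refl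
    edge⇒consecutive 1 0 _ _ _ = inj₂ refl
    edge⇒consecutive 1 2 _ _ _ = inj₁ refl
    edge⇒consecutive 2 1 _ _ _ = inj₂ refl
    edge⇒consecutive 0 0 _ _ e = ⊥-elim (true≢false e (edge-irrefl (arm i 0)))
    edge⇒consecutive 0 (suc (suc q)) _ _ e = ⊥-elim (true≢false e (edge-arms-apart i 0 j q i≢j))
    edge⇒consecutive 1 1 _ _ ()
    edge⇒consecutive 1 (suc (suc (suc q))) _ _ ()
    edge⇒consecutive (suc (suc p)) 0 _ _ e = ⊥-elim (true≢false e (edge-arms-apart j p i 0 (λ e → i≢j (sym e))))
    edge⇒consecutive (suc (suc (suc p))) 1 _ _ ()
    edge⇒consecutive (suc (suc p)) (suc (suc q)) _ _ e with edge-arm⇒ j p j q e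
    ... | _ , inj₁ refl = inj₁ refl
    ... | _ , inj₂ refl = inj₂ refl

    consecutive-edge : ∀ p → suc p < N → edge (π p) (π (suc p)) ≡ true
    consecutive-edge 0 _ = refl
    consecutive-edge 1 _ = refl
    consecutive-edge (suc (suc p)) _ = edge-arm-step j p

    π-valid : ∀ p → p < N → validIn (π p) ≡ true
    π-valid 0 _ = <⇒<ᵇ-true 0 (l i) lᵢ>0
    π-valid 1 _ = refl
    π-valid (suc (suc p)) (s≤s (s≤s lt)) = <⇒<ᵇ-true p (l j) lt

  throughArm : Fin k → PathIn k
  throughArm j = record { ThroughArm j }

  cherry : PathIn k
  cherry = record { Cherry }

  hubAlone : PathIn k
  hubAlone = record { HubAlone }

  acrossHub : ∀ i j → i ≢ j → 0 < l i → PathIn k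
  acrossHub i j i≢j lᵢ>0 = record { AcrossHub i j i≢j lᵢ>0 }

module StarInduction {k : ℕ} (l : Fin k → ℕ) (S : Realisation k) (valid-in : ∀ a → validIn l a ≡ true → Realisation.valid S a ≡ true) where
  open Play S

  module ThroughArmPath (j : Fin k) = Segments S (throughArm l j) (λ p p<N → valid-in _ (ThroughArm.π-valid l j p p<N))
  module CherryPath = Segments S (cherry l) (λ p p<N → valid-in _ (Cherry.π-valid l p p<N))
  module HubAlonePath = Segments S (hubAlone l) (λ p p<N → valid-in _ (HubAlone.π-valid l p p<N))
  module AcrossHubPath (i j : Fin k) (i≢j : i ≢ j) (lᵢ>0 : 0 < l i) =
    Segments S (acrossHub l i j i≢j lᵢ>0) (λ p p<N → valid-in _ (AcrossHub.π-valid l i j i≢j lᵢ>0 p p<N))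

  WithinArms : (Fin k → ℕ) → Set
  WithinArms r = ∀ i → r i ≤ l i

  starPos-valid : ∀ r x y z → WithinArms r → AllValid (starPos r x y z)
  starPos-valid r x y z within hub e = valid-in hub refl
  starPos-valid r x y z within hub′ e = valid-in hub′ refl
  starPos-valid r x y z within leaf₁ e = valid-in leaf₁ refl
  starPos-valid r x y z within leaf₂ e = valid-in leaf₂ refl
  starPos-valid r x y z within (arm i p) e = valid-in (arm i p) (<⇒<ᵇ-true p (l i) (<-≤-trans (<ᵇ-true⇒< p (r i) e) (within i)))

  grundy-cherry : grundyᴾ (CherryPath.segment 0 3) ≡ 0
  grundy-cherry = CherryPath.grundy-segment 3 0 ≤-refl

  throughArm-arm : ∀ j lo L i p → ThroughArmPath.segment j lo L (arm i p) ≡ (((i ==F j) ∧ (p <ᵇ l j)) ∧ inRange lo L (3 + p))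
  throughArm-arm j lo L i p = inRangeᴹ-if lo L ((i ==F j) ∧ (p <ᵇ l j)) (3 + p)

  starOnly-one-arm : ∀ r j L → r j ≡ L → (∀ i → i ≢ j → r i ≡ 0) → L ≤ l j → ∀ z →
                     starOnly r z ≡ ThroughArmPath.segment j 2 (suc L) z
  starOnly-one-arm r j L rⱼ others L≤l hub = refl
  starOnly-one-arm r j L rⱼ others L≤l hub′ = refl
  starOnly-one-arm r j L rⱼ others L≤l leaf₁ = refl
  starOnly-one-arm r j L rⱼ others L≤l leaf₂ = refl
  starOnly-one-arm r j L rⱼ others L≤l outside = refl
  starOnly-one-arm r j L rⱼ others L≤l (arm i p) rewrite throughArm-arm j 2 (suc L) i p with i ≟F j
  ... | yes refl rewrite ==F-refl i | rⱼ = <ᵇ-≤-absorb p L (l i) L≤l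
  ... | no i≢j rewrite ≢⇒==F-false i j i≢j | others i i≢j = n<ᵇ0 p

  starOnly-one-arm-minus-hub : ∀ r j L → r j ≡ L → (∀ i → i ≢ j → r i ≡ 0) → L ≤ l j → ∀ z →
                               delete₁ (starOnly r) hub z ≡ ThroughArmPath.segment j 3 L z
  starOnly-one-arm-minus-hub r j L rⱼ others L≤l hub = refl
  starOnly-one-arm-minus-hub r j L rⱼ others L≤l hub′ = refl
  starOnly-one-arm-minus-hub r j L rⱼ others L≤l leaf₁ = refl
  starOnly-one-arm-minus-hub r j L rⱼ others L≤l leaf₂ = refl
  starOnly-one-arm-minus-hub r j L rⱼ others L≤l outside = refl
  starOnly-one-arm-minus-hub r j L rⱼ others L≤l (arm i p) rewrite throughArm-arm j 3 L i p | ∧-identityʳ (p <ᵇ r i) with i ≟F j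
  ... | yes refl rewrite ==F-refl i | rⱼ = <ᵇ-≤-absorb p L (l i) L≤l
  ... | no i≢j rewrite ≢⇒==F-false i j i≢j | others i i≢j = n<ᵇ0 p

  starOnly-one-arm-minus-hub-and-first : ∀ r j L → r j ≡ suc L → (∀ i → i ≢ j → r i ≡ 0) → suc L ≤ l j →
                                         ∀ z →
                                         delete₂ (starOnly r) hub (arm j 0) z ≡ ThroughArmPath.segment j 4 L z
  starOnly-one-arm-minus-hub-and-first r j L rⱼ others L≤l hub = refl
  starOnly-one-arm-minus-hub-and-first r j L rⱼ others L≤l hub′ = refl
  starOnly-one-arm-minus-hub-and-first r j L rⱼ others L≤l leaf₁ = refl
  starOnly-one-arm-minus-hub-and-first r j L rⱼ others L≤l leaf₂ = refl
  starOnly-one-arm-minus-hub-and-first r j L rⱼ others L≤l outside = refl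
  starOnly-one-arm-minus-hub-and-first r j L rⱼ others L≤l (arm i p) rewrite throughArm-arm j 4 L i p with i ≟F j
  ... | no i≢j rewrite ≢⇒==F-false i j i≢j | others i i≢j | n<ᵇ0 p = refl
  ... | yes refl rewrite ==F-refl i | rⱼ = arm-values p
    where
    arm-values : ∀ p → ((p <ᵇ suc L) ∧ not (p ≡ᵇ 0)) ≡ ((p <ᵇ l i) ∧ ((0 <ᵇ p) ∧ (p <ᵇ suc L)))
    arm-values zero = sym (∧-zeroʳ (0 <ᵇ l i))
    arm-values (suc p′) = trans (∧-identityʳ (p′ <ᵇ L)) (<ᵇ-≤-absorb (suc p′) (suc L) (l i) L≤l)

  private
    unit-arm-gone : ∀ p → ((p <ᵇ 1) ∧ not (false ∨ (p ≡ᵇ 0))) ≡ false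
    unit-arm-gone zero = refl
    unit-arm-gone (suc p) = refl

  delete-hub-unit-arm-off : ∀ (r : Fin k → ℕ) (i i′ : Fin k) p → r i ≡ 1 → (i′ ≢ i → r i′ ≡ 0) →
                            delete₂ (starOnly r) hub (arm i 0) (arm i′ p) ≡ false
  delete-hub-unit-arm-off r i i′ p rᵢ others with i′ ≟F i
  ... | yes refl rewrite rᵢ | arm-==ₛ-same i′ p 0 = unit-arm-gone p
  ... | no i′≢j rewrite others i′≢j | n<ᵇ0 p = refl

  starOnly-unit-arm-minus-hub-and-unit : ∀ r i j L → i ≢ j → r i ≡ 1 → r j ≡ L → (∀ i′ → i′ ≢ i → i′ ≢ j → r i′ ≡ 0) → L ≤ l j →
         ∀ z → delete₂ (starOnly r) hub (arm i 0) z ≡ ThroughArmPath.segment j 3 L z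
  starOnly-unit-arm-minus-hub-and-unit r i j L i≢j rᵢ rⱼ others L≤l hub = refl
  starOnly-unit-arm-minus-hub-and-unit r i j L i≢j rᵢ rⱼ others L≤l hub′ = refl
  starOnly-unit-arm-minus-hub-and-unit r i j L i≢j rᵢ rⱼ others L≤l leaf₁ = refl
  starOnly-unit-arm-minus-hub-and-unit r i j L i≢j rᵢ rⱼ others L≤l leaf₂ = refl
  starOnly-unit-arm-minus-hub-and-unit r i j L i≢j rᵢ rⱼ others L≤l outside = refl
  starOnly-unit-arm-minus-hub-and-unit r i j L i≢j rᵢ rⱼ others L≤l (arm i′ p) rewrite throughArm-arm j 3 L i′ p with i′ ≟F j
  ... | yes refl rewrite ==F-refl i′ | arm-==ₛ-apart i i′ p 0 (λ e → i≢j (sym e)) | rⱼ | ∧-identityʳ (p <ᵇ L) = <ᵇ-≤-absorb p L (l i′) L≤l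
  ... | no i≢j rewrite ≢⇒==F-false i′ j i≢j = delete-hub-unit-arm-off r i i′ p rᵢ (λ i′≢j → others i′ i′≢j i≢j)

  starOnly-two-arms-unit : ∀ r i j L (i≢j : i ≢ j) (lᵢ>0 : 0 < l i) → r i ≡ 1 → r j ≡ L → (∀ i′ → i′ ≢ i →
                           i′ ≢ j → r i′ ≡ 0) → L ≤ l j →
         ∀ z → starOnly r z ≡ AcrossHubPath.segment i j i≢j lᵢ>0 0 (2 + L) z
  starOnly-two-arms-unit r i j L i≢j lᵢ>0 rᵢ rⱼ others L≤l hub = refl
  starOnly-two-arms-unit r i j L i≢j lᵢ>0 rᵢ rⱼ others L≤l hub′ = refl
  starOnly-two-arms-unit r i j L i≢j lᵢ>0 rᵢ rⱼ others L≤l leaf₁ = refl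
  starOnly-two-arms-unit r i j L i≢j lᵢ>0 rᵢ rⱼ others L≤l leaf₂ = refl
  starOnly-two-arms-unit r i j L i≢j lᵢ>0 rᵢ rⱼ others L≤l outside = refl
  starOnly-two-arms-unit r i j L i≢j lᵢ>0 rᵢ rⱼ others L≤l (arm i′ p) rewrite inRangeᴹ-if-else 0 (2 + L) ((i′ ==F i) ∧ (p ≡ᵇ 0)) 0
        (if (i′ ==F j) ∧ (p <ᵇ l j) then just (2 + p) else nothing) with i′ ≟F i
  ... | yes refl rewrite ==F-refl i′ | rᵢ = arm-values p
    where
    arm-values : ∀ p →
                 (p <ᵇ 1) ≡ (if p ≡ᵇ 0 then true else inRangeᴹ 0 (2 + L) (if (i′ ==F j) ∧ (p <ᵇ l j) then just (2 + p) else nothing))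
    arm-values zero = refl
    arm-values (suc p) rewrite ≢⇒==F-false i′ j i≢j = refl
  ... | no i′≢i rewrite ≢⇒==F-false i′ i i′≢i | inRangeᴹ-if 0 (2 + L) ((i′ ==F j) ∧ (p <ᵇ l j)) (2 + p) with i′ ≟F j
  ... | yes refl rewrite ==F-refl i′ | rⱼ = <ᵇ-≤-absorb p L (l i′) L≤l
  ... | no i′≢j rewrite ≢⇒==F-false i′ j i′≢j | others i′ i′≢i i′≢j = n<ᵇ0 p

  starOnly-no-arms : ∀ r → (∀ i → r i ≡ 0) → ∀ z → starOnly r z ≡ HubAlonePath.segment 0 1 z
  starOnly-no-arms r others hub = refl
  starOnly-no-arms r others hub′ = refl
  starOnly-no-arms r others leaf₁ = refl
  starOnly-no-arms r others leaf₂ = refl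
  starOnly-no-arms r others outside = refl
  starOnly-no-arms r others (arm i p) rewrite others i = n<ᵇ0 p

  linked-no-arms-minus-hub : ∀ r → (∀ i → r i ≡ 0) → ∀ z → delete₁ (linked r) hub z ≡ CherryPath.segment 0 3 z
  linked-no-arms-minus-hub r others hub = refl
  linked-no-arms-minus-hub r others hub′ = refl
  linked-no-arms-minus-hub r others leaf₁ = refl
  linked-no-arms-minus-hub r others leaf₂ = refl
  linked-no-arms-minus-hub r others outside = refl
  linked-no-arms-minus-hub r others (arm i p) rewrite others i | n<ᵇ0 p = refl

  linked-unit-arm-minus-hub-and-unit : ∀ r i → r i ≡ 1 → (∀ i′ → i′ ≢ i → r i′ ≡ 0) → ∀ z →
                                       delete₂ (linked r) hub (arm i 0) z ≡ CherryPath.segment 0 3 z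
  linked-unit-arm-minus-hub-and-unit r i rᵢ others hub = refl
  linked-unit-arm-minus-hub-and-unit r i rᵢ others hub′ = refl
  linked-unit-arm-minus-hub-and-unit r i rᵢ others leaf₁ = refl
  linked-unit-arm-minus-hub-and-unit r i rᵢ others leaf₂ = refl
  linked-unit-arm-minus-hub-and-unit r i rᵢ others outside = refl
  linked-unit-arm-minus-hub-and-unit r i rᵢ others (arm i′ p) with i′ ≟F i
  ... | yes refl rewrite rᵢ | arm-==ₛ-same i′ p 0 = unit-arm-gone p
  ... | no i≢j rewrite others i′ i≢j | n<ᵇ0 p = refl

  linked-leaf₁-minus-hub′-leaf₂ : ∀ (r : Fin k → ℕ) w → delete₂ (linked-leaf₁ r) hub′ leaf₂ w ≡ starOnly r w
  linked-leaf₁-minus-hub′-leaf₂ r hub = refl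
  linked-leaf₁-minus-hub′-leaf₂ r (arm i p) = ∧-identityʳ _
  linked-leaf₁-minus-hub′-leaf₂ r hub′ = refl
  linked-leaf₁-minus-hub′-leaf₂ r leaf₁ = refl
  linked-leaf₁-minus-hub′-leaf₂ r leaf₂ = refl
  linked-leaf₁-minus-hub′-leaf₂ r outside = refl

  linked-leaf₂-minus-hub′-leaf₁ : ∀ (r : Fin k → ℕ) w → delete₂ (linked-leaf₂ r) hub′ leaf₁ w ≡ starOnly r w
  linked-leaf₂-minus-hub′-leaf₁ r hub = refl
  linked-leaf₂-minus-hub′-leaf₁ r (arm i p) = ∧-identityʳ _
  linked-leaf₂-minus-hub′-leaf₁ r hub′ = refl
  linked-leaf₂-minus-hub′-leaf₁ r leaf₁ = refl
  linked-leaf₂-minus-hub′-leaf₁ r leaf₂ = refl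
  linked-leaf₂-minus-hub′-leaf₁ r outside = refl

  starOnly-no-arms-minus-hub : ∀ (r : Fin k → ℕ) → (∀ i → r i ≡ 0) → ∀ z → delete₁ (starOnly r) hub z ≡ false
  starOnly-no-arms-minus-hub r others hub = refl
  starOnly-no-arms-minus-hub r others hub′ = refl
  starOnly-no-arms-minus-hub r others leaf₁ = refl
  starOnly-no-arms-minus-hub r others leaf₂ = refl
  starOnly-no-arms-minus-hub r others outside = refl
  starOnly-no-arms-minus-hub r others (arm i p) rewrite others i | n<ᵇ0 p = refl

  starOnly-valid : ∀ (r : Fin k → ℕ) → WithinArms r → AllValid (starOnly r)
  starOnly-valid r = starPos-valid r false false false

  linked-valid : ∀ (r : Fin k → ℕ) → WithinArms r → AllValid (linked r)
  linked-valid r = starPos-valid r true true true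

  starOnly-connected : ∀ (r : Fin k → ℕ) → Connected (starOnly r)
  starOnly-connected r = starPos-connected r false false false leaves-absent

  linked-connected : ∀ (r : Fin k → ℕ) → Connected (linked r)
  linked-connected r = starPos-connected r true true true hub′-present

  take-hub′-leaf₂ : ∀ (r : Fin k → ℕ) → Move (linked-leaf₁ r) (starOnly r)
  take-hub′-leaf₂ r = take₂ hub′ leaf₂ refl refl refl
    (connected-cong (λ w → sym (linked-leaf₁-minus-hub′-leaf₂ r w)) (starOnly-connected r)) (λ w → sym (linked-leaf₁-minus-hub′-leaf₂ r w))

  take-hub′-leaf₁ : ∀ (r : Fin k → ℕ) → Move (linked-leaf₂ r) (starOnly r)
  take-hub′-leaf₁ r = take₂ hub′ leaf₁ refl refl refl
    (connected-cong (λ w → sym (linked-leaf₂-minus-hub′-leaf₁ r w)) (starOnly-connected r)) (λ w → sym (linked-leaf₂-minus-hub′-leaf₁ r w))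

  take-hub-bare : ∀ (r : Fin k → ℕ) → (∀ i → r i ≡ 0) → Move (linked r) (delete₁ (linked r) hub)
  take-hub-bare r none =
    take₁ hub refl (connected-cong (λ w → sym (linked-no-arms-minus-hub r none w)) (CherryPath.segment-connected 0 3 ≤-refl)) (λ _ → refl)

  take-hub-unit-arm : ∀ (r : Fin k → ℕ) i → r i ≡ 1 → (∀ i′ → i′ ≢ i → r i′ ≡ 0) →
                      Move (linked r) (delete₂ (linked r) hub (arm i 0))
  take-hub-unit-arm r i rᵢ others = take₂ hub (arm i 0) refl (<⇒<ᵇ-true 0 (r i) (subst (0 <_) (sym rᵢ) (s≤s z≤n))) refl
    (connected-cong (λ w → sym (linked-unit-arm-minus-hub-and-unit r i rᵢ others w)) (CherryPath.segment-connected 0 3 ≤-refl))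
    (λ _ → refl)

  grundy-starOnly-no-arms : ∀ (r : Fin k → ℕ) → (∀ i → r i ≡ 0) → grundyᴾ (starOnly r) ≡ 1
  grundy-starOnly-no-arms r none = trans (grundyᴾ-cong (starOnly-no-arms r none)) (HubAlonePath.grundy-segment 1 0 ≤-refl)

  grundy-linked-no-arms-minus-hub : ∀ (r : Fin k → ℕ) → (∀ i → r i ≡ 0) → grundyᴾ (delete₁ (linked r) hub) ≡ 0
  grundy-linked-no-arms-minus-hub r none = trans (grundyᴾ-cong (linked-no-arms-minus-hub r none)) grundy-cherry

  grundy-linked-unit-arm-minus-hub-and-unit : ∀ (r : Fin k → ℕ) i → r i ≡ 1 → (∀ i′ → i′ ≢ i → r i′ ≡ 0) →
                                              grundyᴾ (delete₂ (linked r) hub (arm i 0)) ≡ 0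
  grundy-linked-unit-arm-minus-hub-and-unit r i rᵢ others =
    trans (grundyᴾ-cong (linked-unit-arm-minus-hub-and-unit r i rᵢ others)) grundy-cherry

  grundy-starOnly-one-arm : ∀ (r : Fin k → ℕ) j L → r j ≡ L → (∀ i → i ≢ j → r i ≡ 0) → L ≤ l j →
                            grundyᴾ (starOnly r) ≡ mod3 (suc L)
  grundy-starOnly-one-arm r j L rⱼ others L≤l =
    trans (grundyᴾ-cong (starOnly-one-arm r j L rⱼ others L≤l)) (ThroughArmPath.grundy-segment j (suc L) 2 (s≤s (s≤s (s≤s L≤l))))

  grundy-starOnly-unit-and-arm : ∀ (r : Fin k → ℕ) i j L (i≢j : i ≢ j) (lᵢ>0 : 0 < l i) → r i ≡ 1 → r j ≡ L →
                                 (∀ i′ → i′ ≢ i → i′ ≢ j → r i′ ≡ 0) → L ≤ l j → grundyᴾ (starOnly r) ≡ mod3 (2 + L)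
  grundy-starOnly-unit-and-arm r i j L i≢j lᵢ>0 rᵢ rⱼ others L≤l =
    trans (grundyᴾ-cong (starOnly-two-arms-unit r i j L i≢j lᵢ>0 rᵢ rⱼ others L≤l))
          (AcrossHubPath.grundy-segment i j i≢j lᵢ>0 (2 + L) 0 (s≤s (s≤s L≤l)))

  setArm-one-arm : ∀ (r : Fin k → ℕ) j L → (∀ i → i ≢ j → r i ≡ 0) → ∀ i → i ≢ j → setArm r j L i ≡ 0
  setArm-one-arm r j L others i i≢j = trans (setArm-other r j L i i≢j) (others i i≢j)

  setArm-two-arms : ∀ (r : Fin k → ℕ) i j L → (∀ i′ → i′ ≢ i → i′ ≢ j → r i′ ≡ 0) → ∀ i′ → i′ ≢ i → i′ ≢ j → setArm r j L i′ ≡ 0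
  setArm-two-arms r i j L others i′ i′≢i i′≢j = trans (setArm-other r j L i′ i′≢j) (others i′ i′≢i i′≢j)

  setArm-within : ∀ (r : Fin k → ℕ) → WithinArms r → ∀ i p → p ≤ r i → WithinArms (setArm r i p)
  setArm-within r within i p p≤rᵢ i′ = ≤-trans (setArm-≤ r i p p≤rᵢ i′) (within i′)

  -- The induction hypothesis, for the stars reached by a move of S.
  Smaller : (Fin k → ℕ) → Set
  Smaller r = ∀ r′ → Move (starOnly r) (starOnly r′) → WithinArms r′ → grundyᴾ (starOnly r′) ≡ grundyᴾ (linked r′)

  -- Shortening an arm of B answers the same shortening in S.
  linked-shrink-avoids : ∀ (r : Fin k → ℕ) → WithinArms r → Smaller r → ∀ r′ →
                         Move (starOnly r) (starOnly r′) → Move (linked r) (linked r′) →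
                         WithinArms r′ → grundyᴾ (starOnly r′) ≢ grundyᴾ (linked r)
  linked-shrink-avoids r within ih r′ mvS mvB within′ e =
    grundyᴾ-≢-option (linked r) (linked r′) (linked-valid r within) (linked-connected r) mvB (trans (sym (ih r′ mvS within′)) e)

  linked-options-avoid : ∀ (r : Fin k → ℕ) → WithinArms r → Smaller r → ∀ β → LinkedMove r β → grundyᴾ β ≢ grundyᴾ (starOnly r)
  linked-options-avoid r within ih β (shrink r′ β≡ mv r′≤r) e =
    grundyᴾ-≢-option (starOnly r) (starOnly r′) (starOnly-valid r within) (starOnly-connected r) mv
      (trans (ih r′ mv (λ i → ≤-trans (r′≤r i) (within i))) (trans (sym (grundyᴾ-cong β≡)) e))
  linked-options-avoid r within ih β (drop-leaf₁ β≡) e =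
    grundyᴾ-≢-option (linked-leaf₁ r) (starOnly r) (starPos-valid r true false true within) (starPos-connected r true false true hub′-present)
      (take-hub′-leaf₂ r) (trans (sym e) (grundyᴾ-cong β≡))
  linked-options-avoid r within ih β (drop-leaf₂ β≡) e =
    grundyᴾ-≢-option (linked-leaf₂ r) (starOnly r) (starPos-valid r true true false within) (starPos-connected r true true false hub′-present)
      (take-hub′-leaf₁ r) (trans (sym e) (grundyᴾ-cong β≡))
  linked-options-avoid r within ih β (hub-bare none β≡) e =
    0≢1+n (trans (sym (trans (grundyᴾ-cong β≡) (grundy-linked-no-arms-minus-hub r none))) (trans e (grundy-starOnly-no-arms r none)))
  linked-options-avoid r within ih β (hub-unit-arm i rᵢ others β≡) e =
    0≢1+n (trans (sym (trans (grundyᴾ-cong β≡) (grundy-linked-unit-arm-minus-hub-and-unit r i rᵢ others)))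
                 (trans e (grundy-starOnly-one-arm r i 1 rᵢ others (subst (_≤ l i) rᵢ (within i)))))

  starOnly-options-avoid : ∀ (r : Fin k → ℕ) → WithinArms r → Smaller r → grundyᴾ (starOnly r) ≢ 0 →
                           ∀ β → StarOnlyMove r β → grundyᴾ β ≢ grundyᴾ (linked r)
  starOnly-options-avoid r within ih _ β (shrink r′ β≡ mvS mvB r′≤r) e =
    linked-shrink-avoids r within ih r′ mvS mvB (λ i → ≤-trans (r′≤r i) (within i)) (trans (sym (grundyᴾ-cong β≡)) e)
  starOnly-options-avoid r within ih _ β (hub-alone none β≡) e =
    grundyᴾ-≢-option (linked r) (delete₁ (linked r) hub) (linked-valid r within) (linked-connected r) (take-hub-bare r none)
      (trans (trans (grundy-linked-no-arms-minus-hub r none) (sym option)) e)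
    where
    option : grundyᴾ β ≡ 0
    option = grundyᴾ-empty β λ z → trans (β≡ z) (starOnly-no-arms-minus-hub r none z)
  starOnly-options-avoid r within ih _ β (hub-of-one-arm j L rⱼ others β≡) e =
    linked-shrink-avoids r within ih (setArm r j L)
      (take-arm-end r false false false j L leaves-absent (sym rⱼ)) (take-arm-end r true true true j L hub′-present (sym rⱼ))
      (setArm-within r within j L (subst (L ≤_) (sym rⱼ) (n≤1+n L)))
      (trans (trans answer (sym option)) e)
    where
    lⱼ = subst (_≤ l j) rⱼ (within j)
    answer : grundyᴾ (starOnly (setArm r j L)) ≡ mod3 (suc L)
    answer = grundy-starOnly-one-arm (setArm r j L) j L (setArm-same r j L) (setArm-one-arm r j L others) (≤-trans (n≤1+n L) lⱼ)
    option : grundyᴾ β ≡ mod3 (suc L)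
    option = trans (grundyᴾ-cong λ z → trans (β≡ z) (starOnly-one-arm-minus-hub r j (suc L) rⱼ others lⱼ z))
                   (ThroughArmPath.grundy-segment j (suc L) 3 (s≤s (s≤s (s≤s lⱼ))))
  starOnly-options-avoid r within ih _ β (hub-and-arm-start j zero rⱼ others β≡) e =
    grundyᴾ-≢-option (linked r) (delete₂ (linked r) hub (arm j 0)) (linked-valid r within) (linked-connected r)
      (take-hub-unit-arm r j rⱼ others) (trans (trans (grundy-linked-unit-arm-minus-hub-and-unit r j rⱼ others) (sym option)) e)
    where
    lⱼ = subst (_≤ l j) rⱼ (within j)
    option : grundyᴾ β ≡ 0
    option = trans (grundyᴾ-cong λ z → trans (β≡ z) (starOnly-one-arm-minus-hub-and-first r j 0 rⱼ others lⱼ z))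
                   (ThroughArmPath.grundy-segment j 0 4 (s≤s (s≤s (s≤s lⱼ))))
  starOnly-options-avoid r within ih _ β (hub-and-arm-start j (suc L) rⱼ others β≡) e =
    linked-shrink-avoids r within ih (setArm r j L)
      (take-arm-end-two r false false false j L leaves-absent (sym rⱼ)) (take-arm-end-two r true true true j L hub′-present (sym rⱼ))
      (setArm-within r within j L (subst (L ≤_) (sym rⱼ) (m≤n+m L 2)))
      (trans (trans answer (sym option)) e)
    where
    lⱼ = subst (_≤ l j) rⱼ (within j)
    answer : grundyᴾ (starOnly (setArm r j L)) ≡ mod3 (suc L)
    answer = grundy-starOnly-one-arm (setArm r j L) j L (setArm-same r j L) (setArm-one-arm r j L others) (≤-trans (m≤n+m L 2) lⱼ)
    option : grundyᴾ β ≡ mod3 (suc L)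
    option = trans (grundyᴾ-cong λ z → trans (β≡ z) (starOnly-one-arm-minus-hub-and-first r j (suc L) rⱼ others lⱼ z))
                   (ThroughArmPath.grundy-segment j (suc L) 4 (s≤s (s≤s (s≤s lⱼ))))
  starOnly-options-avoid r within ih S≢0 β (hub-and-unit-arm i j zero i≢j rᵢ rⱼ others β≡) e =
    S≢0 (grundy-starOnly-unit-and-arm r i j 1 i≢j (subst (_≤ l i) rᵢ (within i)) rᵢ rⱼ others (subst (_≤ l j) rⱼ (within j)))
  starOnly-options-avoid r within ih _ β (hub-and-unit-arm i j (suc L) i≢j rᵢ rⱼ others β≡) e =
    linked-shrink-avoids r within ih (setArm r j L)
      (take-arm-end-two r false false false j L leaves-absent (sym rⱼ)) (take-arm-end-two r true true true j L hub′-present (sym rⱼ))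
      (setArm-within r within j L (subst (L ≤_) (sym rⱼ) (m≤n+m L 2)))
      (trans (trans answer (sym option)) e)
    where
    lⱼ = subst (_≤ l j) rⱼ (within j)
    answer : grundyᴾ (starOnly (setArm r j L)) ≡ mod3 (suc (suc L))
    answer = grundy-starOnly-unit-and-arm (setArm r j L) i j L i≢j (subst (_≤ l i) rᵢ (within i))
               (trans (setArm-other r j L i i≢j) rᵢ) (setArm-same r j L) (setArm-two-arms r i j L others) (≤-trans (m≤n+m L 2) lⱼ)
    option : grundyᴾ β ≡ mod3 (suc (suc L))
    option = trans (grundyᴾ-cong λ z → trans (β≡ z) (starOnly-unit-arm-minus-hub-and-unit r i j (suc (suc L)) i≢j rᵢ rⱼ others lⱼ z))
                   (ThroughArmPath.grundy-segment j (suc (suc L)) 3 (s≤s (s≤s (s≤s lⱼ))))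

  starOnly≡linked : ∀ (r : Fin k → ℕ) → WithinArms r → grundyᴾ (starOnly r) ≡ grundyᴾ (linked r)
  starOnly≡linked r within = <-rec Claim shrinking (size (starOnly r)) r refl within
    where
    Claim : ℕ → Set
    Claim m = ∀ r → size (starOnly r) ≡ m → WithinArms r → grundyᴾ (starOnly r) ≡ grundyᴾ (linked r)
    shrinking : ∀ m → (∀ {m′} → m′ < m → Claim m′) → Claim m
    shrinking m rec r refl within = ≤-antisym S≤B B≤S
      where
      ih : Smaller r
      ih r′ mv within′ = rec (size-decreases (starOnly r) (starOnly r′) (starOnly-valid r within) (starOnly-connected r) mv) r′ refl within′
      B≤S : grundyᴾ (linked r) ≤ grundyᴾ (starOnly r)
      B≤S = grundyᴾ-≤ (linked r) _ (linked-valid r within) (linked-connected r)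
              λ β mv → linked-options-avoid r within ih β (classify-linked r β mv)
      S≤B : grundyᴾ (starOnly r) ≤ grundyᴾ (linked r)
      S≤B with grundyᴾ (starOnly r) ≟ 0
      ... | yes S≡0 = subst (_≤ grundyᴾ (linked r)) (sym S≡0) z≤n
      ... | no S≢0 = grundyᴾ-≤ (starOnly r) _ (starOnly-valid r within) (starOnly-connected r)
                       λ β mv → starOnly-options-avoid r within ih S≢0 β (classify-starOnly r β mv)

armLabel : (ls : List ℕ) → Fin (length ls) → ℕ → ℕ
armLabel (ℓ ∷ ls) zero p = p
armLabel (ℓ ∷ ls) (suc i) p = ℓ + armLabel ls i p

armAt : (ls : List ℕ) → ℕ → Maybe (Fin (length ls) × ℕ)
armAt [] o = nothing
armAt (ℓ ∷ ls) o = if o <ᵇ ℓ then just (zero , o) else Maybe.map (λ ip → (suc (proj₁ ip) , proj₂ ip)) (armAt ls (o ∸ ℓ))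

armAt-armLabel : ∀ ls i p → p < List.lookup ls i → armAt ls (armLabel ls i p) ≡ just (i , p)
armAt-armLabel (ℓ ∷ ls) zero p lt rewrite <⇒<ᵇ-true p ℓ lt = refl
armAt-armLabel (ℓ ∷ ls) (suc i) p lt rewrite ≥⇒<ᵇ-false (ℓ + armLabel ls i p) ℓ (m≤m+n ℓ _) | m+n∸m≡n ℓ (armLabel ls i p) | armAt-armLabel ls i p lt = refl

armLabel-< : ∀ ls i p → p < List.lookup ls i → armLabel ls i p < sum ls
armLabel-< (ℓ ∷ ls) zero p lt = <-≤-trans lt (m≤m+n ℓ (sum ls))
armLabel-< (ℓ ∷ ls) (suc i) p lt = +-monoʳ-< ℓ (armLabel-< ls i p lt)

armAt⇒armLabel : ∀ ls o i p → armAt ls o ≡ just (i , p) → (armLabel ls i p ≡ o) × (p < List.lookup ls i)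
armAt⇒armLabel (ℓ ∷ ls) o i p e with true⊎false (o <ᵇ ℓ)
... | inj₁ q rewrite q with e
... | refl = refl , <ᵇ-true⇒< o ℓ q
armAt⇒armLabel (ℓ ∷ ls) o i p e | inj₂ q rewrite q with armAt ls (o ∸ ℓ) in eq
armAt⇒armLabel (ℓ ∷ ls) o i p () | inj₂ q | nothing
armAt⇒armLabel (ℓ ∷ ls) o .(suc i′) .p′ refl | inj₂ q | just (i′ , p′) with armAt⇒armLabel ls (o ∸ ℓ) i′ p′ eq
... | a , b = trans (cong (ℓ +_) a) (m+[n∸m]≡n (<ᵇ-false⇒≥ o ℓ q)) , b

armAt-total : ∀ ls o → o < sum ls → Σ (Fin (length ls) × ℕ) λ ip → armAt ls o ≡ just ip
armAt-total (ℓ ∷ ls) o lt with true⊎false (o <ᵇ ℓ)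
... | inj₁ q rewrite q = (zero , o) , refl
... | inj₂ q rewrite q with armAt-total ls (o ∸ ℓ) (+-cancelˡ-< ℓ _ _ (subst (_< ℓ + sum ls) (sym (m+[n∸m]≡n (<ᵇ-false⇒≥ o ℓ q))) lt))
... | (i , p) , e rewrite e = (suc i , p) , refl

module Labels (ls : List ℕ) where
  k : ℕ
  k = length ls
  l : Fin k → ℕ
  l = List.lookup ls
  s : ℕ
  s = sum ls

  siteOfArm : Maybe (Fin k × ℕ) → Site k
  siteOfArm (just (i , p)) = arm i p
  siteOfArm nothing = outside

  tailSite : ℕ → Site k
  tailSite 0 = hub′
  tailSite 1 = leaf₁
  tailSite 2 = leaf₂
  tailSite _ = outside

  siteAt : ℕ → Site k
  siteAt zero = hub
  siteAt (suc o) = if o <ᵇ s then siteOfArm (armAt ls o) else tailSite (o ∸ s)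

  labelOf : Site k → ℕ
  labelOf hub = 0
  labelOf (arm i p) = suc (armLabel ls i p)
  labelOf hub′ = suc s
  labelOf leaf₁ = suc (suc s)
  labelOf leaf₂ = suc (suc (suc s))
  labelOf outside = 0

  -- Only the first t of hub′, leaf₁, leaf₂ exist: t = 0 for S and t = 3 for S -1- S_{1,1}.
  validWith : ℕ → Site k → Bool
  validWith t hub = true
  validWith t (arm i p) = p <ᵇ l i
  validWith t hub′ = 0 <ᵇ t
  validWith t leaf₁ = 1 <ᵇ t
  validWith t leaf₂ = 2 <ᵇ t
  validWith t outside = false

  siteAt-labelOf : ∀ t a → validWith t a ≡ true → siteAt (labelOf a) ≡ a
  siteAt-labelOf t hub v = refl
  siteAt-labelOf t (arm i p) v rewrite <⇒<ᵇ-true (armLabel ls i p) s (armLabel-< ls i p (<ᵇ-true⇒< p (l i) v)) | armAt-armLabel ls i p (<ᵇ-true⇒< p (l i) v) = refl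
  siteAt-labelOf t hub′ v rewrite ≥⇒<ᵇ-false s s ≤-refl | n∸n≡0 s = refl
  siteAt-labelOf t leaf₁ v rewrite ≥⇒<ᵇ-false (suc s) s (n≤1+n s) | m+n∸n≡m 1 s = refl
  siteAt-labelOf t leaf₂ v rewrite ≥⇒<ᵇ-false (suc (suc s)) s (≤-trans (n≤1+n s) (n≤1+n _)) | m+n∸n≡m 2 s = refl

  labelOf-siteAt : ∀ t x → x < suc (s + t) → t ≤ 3 → (labelOf (siteAt x) ≡ x) × (validWith t (siteAt x) ≡ true)
  labelOf-siteAt t zero lt t3 = refl , refl
  labelOf-siteAt t (suc o) lt t3 with true⊎false (o <ᵇ s)
  ... | inj₁ q rewrite q with armAt-total ls o (<ᵇ-true⇒< o s q)
  ... | (i , p) , e rewrite e with armAt⇒armLabel ls o i p e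
  ... | a , b = cong suc a , <⇒<ᵇ-true p (l i) b
  labelOf-siteAt t (suc o) lt t3 | inj₂ q rewrite q = h (o ∸ s) (m+[n∸m]≡n (<ᵇ-false⇒≥ o s q)) (+-cancelˡ-< s _ _ (subst (_< s + t) (sym (m+[n∸m]≡n (<ᵇ-false⇒≥ o s q))) (≤-pred lt)))
    where
    h : ∀ d → s + d ≡ o → d < t → (labelOf (tailSite d) ≡ suc o) × (validWith t (tailSite d) ≡ true)
    h zero e lt′ = cong suc (trans (sym (+-identityʳ s)) e) , <⇒<ᵇ-true 0 t lt′
    h (suc zero) e lt′ = cong suc (trans (+-comm 1 s) e) , <⇒<ᵇ-true 1 t lt′
    h (suc (suc zero)) e lt′ = cong suc (trans (+-comm 2 s) e) , <⇒<ᵇ-true 2 t lt′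
    h (suc (suc (suc d))) e lt′ = ⊥-elim (<⇒≱ (≤-trans (s≤s (s≤s (s≤s (s≤s z≤n)))) lt′) t3)

∈-pathEdges : ∀ prev first ℓ a b → (a , b) ∈ pathEdges prev first ℓ →
  (1 ≤ ℓ × a ≡ prev × b ≡ first) ⊎ (Σ ℕ λ p → suc p < ℓ × a ≡ first + p × b ≡ first + suc p)
∈-pathEdges prev first (suc ℓ) a b (here refl) = inj₁ (s≤s z≤n , refl , refl)
∈-pathEdges prev first (suc ℓ) a b (there m) with ∈-pathEdges first (suc first) ℓ a b m
... | inj₁ (le , refl , refl) = inj₂ (0 , s≤s le , sym (+-identityʳ first) , sym (+-comm first 1))
... | inj₂ (p , lt , refl , refl) = inj₂ (suc p , s≤s lt , sym (+-suc first p) , sym (+-suc first (suc p)))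

pathEdges-first : ∀ prev first ℓ → 1 ≤ ℓ → (prev , first) ∈ pathEdges prev first ℓ
pathEdges-first prev first (suc ℓ) _ = here refl

pathEdges-step : ∀ prev first ℓ p → suc p < ℓ → (first + p , first + suc p) ∈ pathEdges prev first ℓ
pathEdges-step prev first (suc ℓ) zero (s≤s lt) = there (subst (λ z → z ∈ pathEdges first (suc first) ℓ)
  (cong₂ _,_ (sym (+-identityʳ first)) (+-comm 1 first)) (pathEdges-first first (suc first) ℓ lt))
pathEdges-step prev first (suc ℓ) (suc p) (s≤s lt) = there (subst (λ z → z ∈ pathEdges first (suc first) ℓ)
  (cong₂ _,_ (sym (+-suc first p)) (sym (+-suc first (suc p)))) (pathEdges-step first (suc first) ℓ p lt))

∈-starEdges : ∀ c next ls a b → (a , b) ∈ starEdges c next ls →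
  Σ (Fin (length ls)) λ i → (0 < List.lookup ls i × a ≡ c × b ≡ next + armLabel ls i 0) ⊎
     (Σ ℕ λ p → suc p < List.lookup ls i × a ≡ next + armLabel ls i p × b ≡ next + armLabel ls i (suc p))
∈-starEdges c next (ℓ ∷ ls) a b m with ∈-++⁻ (pathEdges c next ℓ) m
... | inj₁ m1 with ∈-pathEdges c next ℓ a b m1
... | inj₁ (le , e1 , e2) = zero , inj₁ (le , e1 , trans e2 (sym (+-identityʳ next)))
... | inj₂ (p , lt , e1 , e2) = zero , inj₂ (p , lt , e1 , e2)
∈-starEdges c next (ℓ ∷ ls) a b m | inj₂ m2 with ∈-starEdges c (next + ℓ) ls a b m2
... | i , inj₁ (le , e1 , e2) = suc i , inj₁ (le , e1 , trans e2 (+-assoc next ℓ _))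
... | i , inj₂ (p , lt , e1 , e2) = suc i , inj₂ (p , lt , trans e1 (+-assoc next ℓ _) , trans e2 (+-assoc next ℓ _))

starEdges-first : ∀ c next ls i → 0 < List.lookup ls i → (c , next + armLabel ls i 0) ∈ starEdges c next ls
starEdges-first c next (ℓ ∷ ls) zero lt = ∈-++⁺ˡ (subst (λ z → (c , z) ∈ pathEdges c next ℓ) (sym (+-identityʳ next)) (pathEdges-first c next ℓ lt))
starEdges-first c next (ℓ ∷ ls) (suc i) lt = ∈-++⁺ʳ (pathEdges c next ℓ)
  (subst (λ z → (c , z) ∈ starEdges c (next + ℓ) ls) (+-assoc next ℓ _) (starEdges-first c (next + ℓ) ls i lt))

starEdges-step : ∀ c next ls i p → suc p < List.lookup ls i →
                 (next + armLabel ls i p , next + armLabel ls i (suc p)) ∈ starEdges c next ls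
starEdges-step c next (ℓ ∷ ls) zero p lt = ∈-++⁺ˡ (pathEdges-step c next ℓ p lt)
starEdges-step c next (ℓ ∷ ls) (suc i) p lt = ∈-++⁺ʳ (pathEdges c next ℓ)
  (subst (λ z → z ∈ starEdges c (next + ℓ) ls) (cong₂ _,_ (+-assoc next ℓ _) (+-assoc next ℓ _)) (starEdges-step c (next + ℓ) ls i p lt))

hits : ∀ {n} → Fin n → Fin n → ℕ × ℕ → Bool
hits u v e = ((proj₁ e ≡ᵇ toℕ u) ∧ (proj₂ e ≡ᵇ toℕ v)) ∨ ((proj₁ e ≡ᵇ toℕ v) ∧ (proj₂ e ≡ᵇ toℕ u))

-- A graph on labels 0 .. s + t whose edges are exactly the labelled parent-child pairs realises the
-- sites valid for t; encode is made total by reducing modulo the number of vertices.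
module RealiseGraph (ls : List ℕ) (t : ℕ) (t≤3 : t ≤ 3) (n′ : ℕ) (n′≡ : n′ ≡ Labels.s ls + t) (es : List (ℕ × ℕ))
  (es-parents : ∀ e → e ∈ es → ∃₂ λ a b → Labels.validWith ls t a ≡ true × Labels.validWith ls t b ≡ true × edge a b ≡ true ×
                                            e ≡ (Labels.labelOf ls a , Labels.labelOf ls b))
  (parents-listed : ∀ {a b} → Parent a b → Labels.validWith ls t a ≡ true → Labels.validWith ls t b ≡ true →
                    (Labels.labelOf ls a , Labels.labelOf ls b) ∈ es) where
  open Labels ls

  G : Graph
  G = mkGraph (suc n′) es

  labelOf-< : ∀ a → validWith t a ≡ true → labelOf a < suc n′
  labelOf-< a v = subst (λ z → labelOf a < suc z) (sym n′≡) (bound a v)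
    where
    bound : ∀ a → validWith t a ≡ true → labelOf a < suc (s + t)
    bound hub v = s≤s z≤n
    bound (arm i p) v = s≤s (<-≤-trans (armLabel-< ls i p (<ᵇ-true⇒< p (l i) v)) (m≤m+n s t))
    bound hub′ v = s≤s (subst (_≤ s + t) (+-comm s 1) (+-monoʳ-≤ s (<ᵇ-true⇒< 0 t v)))
    bound leaf₁ v = s≤s (subst (_≤ s + t) (+-comm s 2) (+-monoʳ-≤ s (<ᵇ-true⇒< 1 t v)))
    bound leaf₂ v = s≤s (subst (_≤ s + t) (+-comm s 3) (+-monoʳ-≤ s (<ᵇ-true⇒< 2 t v)))

  toℕ-mod : ∀ x → x < suc n′ → toℕ (x mod suc n′) ≡ x
  toℕ-mod x x<n = trans (toℕ-fromℕ< _) (m<n⇒m%n≡m x<n)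

  decoded : ∀ (x : Fin (suc n′)) → (labelOf (siteAt (toℕ x)) ≡ toℕ x) × (validWith t (siteAt (toℕ x)) ≡ true)
  decoded x = labelOf-siteAt t (toℕ x) (subst (λ z → toℕ x < suc z) n′≡ (toℕ<n x)) t≤3

  adj-sites : ∀ x y → adj G x y ≡ edge (siteAt (toℕ x)) (siteAt (toℕ y))
  adj-sites x y = true-iff⇒≡ listed⇒edge edge⇒listed
    where
    a = siteAt (toℕ x)
    b = siteAt (toℕ y)
    label-a = proj₁ (decoded x)
    label-b = proj₁ (decoded y)
    site-of : ∀ c z → validWith t c ≡ true → (labelOf c ≡ᵇ z) ≡ true → siteAt z ≡ c
    site-of c z vc e = trans (cong siteAt (sym (≡ᵇ-true⇒≡ (labelOf c) z e))) (siteAt-labelOf t c vc)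
    listed⇒edge : adj G x y ≡ true → edge a b ≡ true
    listed⇒edge e with any-true⇒∃ (hits x y) es (∧-elimʳ {not (toℕ x ≡ᵇ toℕ y)} e)
    ... | _ , m , hit with es-parents _ m
    ... | c , d , vc , vd , cd , refl with ∨-elim {(labelOf c ≡ᵇ toℕ x) ∧ (labelOf d ≡ᵇ toℕ y)} hit
    ... | inj₁ forward = subst₂ (λ u v → edge u v ≡ true) (sym (site-of c (toℕ x) vc (∧-elimˡ forward)))
                                (sym (site-of d (toℕ y) vd (∧-elimʳ {labelOf c ≡ᵇ toℕ x} forward))) cd
    ... | inj₂ backward = subst₂ (λ u v → edge u v ≡ true) (sym (site-of d (toℕ x) vd (∧-elimʳ {labelOf c ≡ᵇ toℕ y} backward)))
                                 (sym (site-of c (toℕ y) vc (∧-elimˡ backward))) (trans (edge-sym d c) cd)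
    hit-listed : ((labelOf a , labelOf b) ∈ es) ⊎ ((labelOf b , labelOf a) ∈ es) → any (hits x y) es ≡ true
    hit-listed (inj₁ m) = ∈⇒any-true (hits x y) m (∨-introˡ _ (∧-intro (≡⇒≡ᵇ-true _ _ label-a) (≡⇒≡ᵇ-true _ _ label-b)))
    hit-listed (inj₂ m) = ∈⇒any-true (hits x y) m (∨-introʳ _ (∧-intro (≡⇒≡ᵇ-true _ _ label-b) (≡⇒≡ᵇ-true _ _ label-a)))
    edge⇒listed : edge a b ≡ true → adj G x y ≡ true
    edge⇒listed e = ∧-intro
      (false⇒not-true (≢⇒≡ᵇ-false (toℕ x) (toℕ y) λ x≡y → true≢false e (trans (cong (λ z → edge a (siteAt z)) (sym x≡y)) (edge-irrefl a))))
      (hit-listed (Data.Sum.map (λ ab → parents-listed ab (proj₂ (decoded x)) (proj₂ (decoded y)))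
                                (λ ba → parents-listed ba (proj₂ (decoded y)) (proj₂ (decoded x)))
                                (edge⇒Parent a b e)))

  realisation : Realisation (length ls)
  realisation = record
    { n = suc n′
    ; E = adj G
    ; decode = λ x → siteAt (toℕ x)
    ; encode = λ a → labelOf a mod suc n′
    ; valid = validWith t
    ; decode-valid = λ x → proj₂ (decoded x)
    ; encode-decode = λ x → toℕ-injective (trans (toℕ-mod _ (subst (_< suc n′) (sym (proj₁ (decoded x))) (toℕ<n x))) (proj₁ (decoded x)))
    ; decode-encode = λ a v → trans (cong siteAt (toℕ-mod (labelOf a) (labelOf-< a v))) (siteAt-labelOf t a v)
    ; E-decode = adj-sites
    }

module StarGraphs (ls : List ℕ) where
  open Labels ls

  starEdges-valid : ∀ t e → e ∈ starEdges 0 1 ls → ∃₂ λ a b →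
                    validWith t a ≡ true × validWith t b ≡ true × edge a b ≡ true × e ≡ (labelOf a , labelOf b)
  starEdges-valid t (a , b) m with ∈-starEdges 0 1 ls a b m
  ... | i , inj₁ (lt , refl , refl) = hub , arm i 0 , refl , <⇒<ᵇ-true 0 (l i) lt , refl , refl
  ... | i , inj₂ (p , lt , refl , refl) =
    arm i p , arm i (suc p) , <⇒<ᵇ-true p (l i) (<-trans (n<1+n p) lt) , <⇒<ᵇ-true (suc p) (l i) lt , edge-arm-step i p , refl

  star-parents-listed : ∀ {a b} → Parent a b → validWith 0 a ≡ true → validWith 0 b ≡ true →
                        (labelOf a , labelOf b) ∈ starEdges 0 1 ls
  star-parents-listed (hub-arm i) _ vb = starEdges-first 0 1 ls i (<ᵇ-true⇒< 0 (l i) vb)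
  star-parents-listed (arm-arm i p) _ vb = starEdges-step 0 1 ls i p (<ᵇ-true⇒< (suc p) (l i) vb)
  star-parents-listed hub-hub′ _ ()
  star-parents-listed hub′-leaf₁ () _
  star-parents-listed hub′-leaf₂ () _

  module StarRealisation = RealiseGraph ls 0 z≤n s (sym (+-identityʳ s)) (starEdges 0 1 ls) (starEdges-valid 0) star-parents-listed

  linkedEdges : List (ℕ × ℕ)
  linkedEdges = starEdges 0 1 ls ++ starEdges (suc s) (suc (suc s)) (1 ∷ 1 ∷ []) ++ (0 , suc s) ∷ []

  linkedEdges-valid : ∀ e → e ∈ linkedEdges → ∃₂ λ a b →
                      validWith 3 a ≡ true × validWith 3 b ≡ true × edge a b ≡ true × e ≡ (labelOf a , labelOf b)
  linkedEdges-valid e m with ∈-++⁻ (starEdges 0 1 ls) m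
  ... | inj₁ m′ = starEdges-valid 3 e m′
  ... | inj₂ (here refl) = hub′ , leaf₁ , refl , refl , refl , refl
  ... | inj₂ (there (here refl)) = hub′ , leaf₂ , refl , refl , refl , cong (suc s ,_) (+-comm (suc (suc s)) 1)
  ... | inj₂ (there (there (here refl))) = hub , hub′ , refl , refl , refl , refl

  linked-parents-listed : ∀ {a b} → Parent a b → validWith 3 a ≡ true → validWith 3 b ≡ true →
                          (labelOf a , labelOf b) ∈ linkedEdges
  linked-parents-listed (hub-arm i) _ vb = ∈-++⁺ˡ (starEdges-first 0 1 ls i (<ᵇ-true⇒< 0 (l i) vb))
  linked-parents-listed (arm-arm i p) _ vb = ∈-++⁺ˡ (starEdges-step 0 1 ls i p (<ᵇ-true⇒< (suc p) (l i) vb))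
  linked-parents-listed hub-hub′ _ _ = ∈-++⁺ʳ (starEdges 0 1 ls) (there (there (here refl)))
  linked-parents-listed hub′-leaf₁ _ _ = ∈-++⁺ʳ (starEdges 0 1 ls) (here refl)
  linked-parents-listed hub′-leaf₂ _ _ = ∈-++⁺ʳ (starEdges 0 1 ls) (there (here (cong (suc s ,_) (+-comm 1 (suc (suc s))))))

  module LinkedRealisation = RealiseGraph ls 3 (s≤s (s≤s (s≤s z≤n))) (s + 3) refl linkedEdges linkedEdges-valid linked-parents-listed

module _ (ls : List ℕ) where
  open Labels ls
  open StarGraphs ls

  starᴿ linkedᴿ : Realisation k
  starᴿ = StarRealisation.realisation
  linkedᴿ = LinkedRealisation.realisation

  starOnly-valid-in-star : Play.AllValid starᴿ (starOnly l)
  starOnly-valid-in-star hub _ = refl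
  starOnly-valid-in-star (arm i p) e = e

  starOnly-valid-in-linked : Play.AllValid linkedᴿ (starOnly l)
  starOnly-valid-in-linked hub _ = refl
  starOnly-valid-in-linked (arm i p) e = e

  grundy-star : grundy (star ls) ≡ Play.grundyᴾ starᴿ (starOnly l)
  grundy-star = cong (Play.grundyᵛ starᴿ) (tabulate-cong λ x → sym (everything-present (Realisation.decode starᴿ x) (Realisation.decode-valid starᴿ x)))
    where
    everything-present : ∀ a → validWith 0 a ≡ true → starOnly l a ≡ true
    everything-present hub _ = refl
    everything-present (arm i p) v = v

  grundy-link : grundy (link (just ls) (1 ∷ 1 ∷ [])) ≡ Play.grundyᴾ linkedᴿ (linked l)
  grundy-link = cong (Play.grundyᵛ linkedᴿ) (tabulate-cong λ x → sym (everything-present (Realisation.decode linkedᴿ x) (Realisation.decode-valid linkedᴿ x)))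
    where
    everything-present : ∀ a → validWith 3 a ≡ true → linked l a ≡ true
    everything-present hub _ = refl
    everything-present (arm i p) v = v
    everything-present hub′ _ = refl
    everything-present leaf₁ _ = refl
    everything-present leaf₂ _ = refl

  validIn⇒validWith3 : ∀ a → validIn l a ≡ true → validWith 3 a ≡ true
  validIn⇒validWith3 hub e = e
  validIn⇒validWith3 (arm i p) e = e
  validIn⇒validWith3 hub′ e = e
  validIn⇒validWith3 leaf₁ e = e
  validIn⇒validWith3 leaf₂ e = e

lemma4 : (S : Maybe (List ℕ)) → MAll (All (λ ℓ → 1 ≤ ℓ)) S →
         grundy (starOrEmpty S) ≡ grundy (link S (1 ∷ 1 ∷ []))
lemma4 nothing _ = refl
lemma4 (just ls) _ = begin
  grundy (star ls)                           ≡⟨ grundy-star ls ⟩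
  Play.grundyᴾ (starᴿ ls) (starOnly l)       ≡⟨ grundyᴾ-realisation-independent (starᴿ ls) (linkedᴿ ls) (starOnly l)
                                                  (starOnly-valid-in-star ls) (starOnly-valid-in-linked ls)
                                                  (starPos-connected l false false false leaves-absent) ⟩
  Play.grundyᴾ (linkedᴿ ls) (starOnly l)     ≡⟨ StarInduction.starOnly≡linked l (linkedᴿ ls) (validIn⇒validWith3 ls) l (λ _ → ≤-refl) ⟩
  Play.grundyᴾ (linkedᴿ ls) (linked l)       ≡⟨ grundy-link ls ⟨
  grundy (link (just ls) (1 ∷ 1 ∷ []))       ∎
  where
  open ≡-Reasoning
  l = List.lookup ls
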